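{- Let $\mathbf a=(a_\ell)_{\ell\ge0}$, $\mathbf b=(b_{\ell,\ell'})_{\ell,\ell'\ge0}$ and $\lambda$ be indeterminates, let $\widetilde Q_{n,k}$ be as defined below, and let $\boldsymbol\alpha=(\alpha_n)_{n\ge1}$ with $$\alpha_n=(\lambda+n-1)\,a_{n-1}\Bigl(\sum_{\ell=0}^{n-1}b_{\ell,n-1-\ell}\Bigr).$$ Then for all $n,k\ge0$, $\widetilde Q_{n,k}=\Bigl(\prod_{i=0}^{k-1}a_i\Bigr)J_{n,k}(\boldsymbol\alpha,\mathbf 0)$.
   Context: $J_{n,k}(\boldsymbol\beta,\boldsymbol\gamma)$ is the generating polynomial of lattice paths from $(0,0)$ to $(n,k)$ staying in $\mathbb Z\times\mathbb N$ with steps $(1,1)$ (weight 1), $(1,-1)$ (weight $\beta_i$ when falling from height $i$) and $(1,0)$ (weight $\gamma_i$ at height $i$); with $\boldsymbol\gamma=\mathbf 0$ only paths without level steps contribute. A Laguerre digraph on $[n]$ is a directed graph on $[n]$ (loops allowed) with all in- and out-degrees in $\{0,1\}$; its components are directed paths (isolated vertices included) and directed cycles (loops included); $\mathrm{cyc}(G)$ is the number of cycles. With $\infty$–$\infty$ boundary conditions, $p(i)$ is the predecessor of $i$ (or $\infty$ if in-degree 0), $s(i)$ the successor (or $\infty$ if out-degree 0), $\infty$ exceeding all integers. $i$ is a peak if $p(i)<i>s(i)$, valley if $p(i)>i<s(i)$, double ascent if $p(i)<i<s(i)$, double descent if $p(i)>i>s(i)$, fixed point if $p(i)=i=s(i)$;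 $\mathrm{Peak}(G)$, $\mathrm{Val}(G)$ are the sets of peaks and valleys. $G$ is alternating if it has no double ascents, double descents or fixed points; $\mathbf{LD}^{\rm alt\infty}_{n,k}$ is the set of alternating Laguerre digraphs on $[n]$ with exactly $k$ paths. For $k\in[n]$: $\mathrm{lcross}(k,G)=\#\{(i,j,l): i,j\in[n], l\in[n]\cup\{\infty\}, i<j<k<l, p(i)=k, p(j)=l\}$, $\mathrm{lnest}(k,G)=\#\{(i,j,l): i,j\in[n], l\in[n]\cup\{\infty\}, i<j<k<l, p(j)=k, p(i)=l\}$. For $j\in[n]$: $\mathrm{ulev}(j,G)=\#\{i\in[n]: i<j<s(i)\}$ if $j<s(j)$, and $0$ otherwise. Finally $\widetilde Q_{n,k}=\sum_{G\in\mathbf{LD}^{\rm alt\infty}_{n,k}}\lambda^{\mathrm{cyc}(G)}\prod_{i\in\mathrm{Val}(G)}a_{\mathrm{ulev}(i,G)}\prod_{i\in\mathrm{Peak}(G)}b_{\mathrm{lcross}(i,G),\mathrm{lnest}(i,G)}$. -}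

module Defs where

open import Level using (Level)
open import Algebra.Bundles using (CommutativeSemiring)
open import Data.Nat using (ℕ; zero; suc; _∸_; _<ᵇ_; _≡ᵇ_)
open import Data.Bool using (Bool; true; false; _∧_; _∨_; not; if_then_else_)
open import Data.Fin using (Fin; toℕ)
open import Data.List using (List; []; _∷_; [_]; map; length; foldr; concatMap; upTo; allFin)
open import Data.Product using (_×_; _,_)
open import Data.Maybe using (Maybe; just; nothing)
import Data.Maybe as M
open import Data.Vec using (Vec; lookup) renaming ([] to []ᵥ; _∷_ to _∷ᵥ_)

filterB : {A : Set} → (A → Bool) → List A → List A
filterB p [] = []
filterB p (x ∷ xs) = if p x then x ∷ filterB p xs else filterB p xs

count : {A : Set} → (A → Bool) → List A → ℕ
count p xs = length (filterB p xs)

allB : {A : Set} → (A → Bool) → List A → Bool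
allB p = foldr (λ x r → p x ∧ r) true

anyB : {A : Set} → (A → Bool) → List A → Bool
anyB p = foldr (λ x r → p x ∨ r) false

allVecs : {A : Set} → List A → (m : ℕ) → List (Vec A m)
allVecs xs zero = [ []ᵥ ]
allVecs xs (suc m) = concatMap (λ x → map (x ∷ᵥ_) (allVecs xs m)) xs

-- Extended naturals ℕ ∪ {∞}: nothing = ∞, larger than every natural.

ℕ∞ : Set
ℕ∞ = Maybe ℕ

_<∞_ : ℕ∞ → ℕ∞ → Bool
just x <∞ just y = x <ᵇ y
just _ <∞ nothing = true
nothing <∞ _ = false

_=∞_ : ℕ∞ → ℕ∞ → Bool
just x =∞ just y = x ≡ᵇ y
nothing =∞ nothing = true
_ =∞ _ = false

-- Digraphs on the vertex set Fin n (a relabelling of [n] preserving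
-- order), given by the successor (out-neighbour) of each vertex:
-- G i = just j means the edge i → j; G i = nothing means out-degree 0.
-- Every digraph with out-degrees in {0,1} arises exactly once this way.

Digraph : ℕ → Set
Digraph n = Vec (Maybe (Fin n)) n

allDigraphs : (n : ℕ) → List (Digraph n)
allDigraphs n = allVecs (nothing ∷ map just (allFin n)) n

module _ {n : ℕ} (G : Digraph n) where

  vertices : List (Fin n)
  vertices = allFin n

  pointsTo : Maybe (Fin n) → Fin n → Bool
  pointsTo (just j) i = toℕ j ≡ᵇ toℕ i
  pointsTo nothing i = false

  -- in-degrees in {0,1} (out-degrees are automatically ≤ 1)
  isLaguerre : Bool
  isLaguerre = allB (λ i → allB (λ j → allB (λ k →
                 not (pointsTo (lookup G i) k ∧ pointsTo (lookup G j) k)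
                 ∨ (toℕ i ≡ᵇ toℕ j)) vertices) vertices) vertices

  succ : Fin n → ℕ∞
  succ i = M.map toℕ (lookup G i)

  pred : Fin n → ℕ∞
  pred i with filterB (λ j → pointsTo (lookup G j) i) vertices
  ... | [] = nothing
  ... | j ∷ _ = just (toℕ j)

  val : Fin n → ℕ∞
  val i = just (toℕ i)

  isPeak isValley isDAsc isDDesc isFix : Fin n → Bool
  isPeak i = (pred i <∞ val i) ∧ (succ i <∞ val i)
  isValley i = (val i <∞ pred i) ∧ (val i <∞ succ i)
  isDAsc i = (pred i <∞ val i) ∧ (val i <∞ succ i)
  isDDesc i = (val i <∞ pred i) ∧ (succ i <∞ val i)
  isFix i = (pred i =∞ val i) ∧ (val i =∞ succ i)

  isAlternating : Bool
  isAlternating = allB (λ i → not (isDAsc i ∨ isDDesc i ∨ isFix i)) vertices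

  -- number of path components = number of vertices of in-degree 0
  -- (each directed path has exactly one initial vertex; cycles have none)
  numPaths : ℕ
  numPaths = count (λ i → pred i =∞ nothing) vertices

  step : Maybe (Fin n) → Maybe (Fin n)
  step nothing = nothing
  step (just j) = lookup G j

  iter : ℕ → Maybe (Fin n) → Maybe (Fin n)
  iter zero x = x
  iter (suc m) x = step (iter m x)

  iterVal : ℕ → Fin n → ℕ∞
  iterVal m i = M.map toℕ (iter m (just i))

  isCycleMin : Fin n → Bool
  isCycleMin i = anyB (λ m → iterVal (suc m) i =∞ val i) (upTo n)
               ∧ allB (λ m → not (iterVal (suc m) i <∞ val i)) (upTo n)

  -- number of cycles = number of cycle minima
  cyc : ℕ
  cyc = count isCycleMin vertices

  extVertices : List ℕ∞
  extVertices = nothing ∷ map val vertices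

  triples : List (Fin n × Fin n × ℕ∞)
  triples = concatMap (λ i → concatMap (λ j → map (λ l → i , j , l) extVertices) vertices) vertices

  lcross : Fin n → ℕ
  lcross k = count (λ { (i , j , l) →
      (val i <∞ val j) ∧ (val j <∞ val k) ∧ (val k <∞ l)
      ∧ (pred i =∞ val k) ∧ (pred j =∞ l) }) triples

  lnest : Fin n → ℕ
  lnest k = count (λ { (i , j , l) →
      (val i <∞ val j) ∧ (val j <∞ val k) ∧ (val k <∞ l)
      ∧ (pred j =∞ val k) ∧ (pred i =∞ l) }) triples

  ulev : Fin n → ℕ
  ulev j = if val j <∞ succ j
           then count (λ i → (val i <∞ val j) ∧ (val j <∞ succ i)) vertices
           else 0

-- Algebraic part, over an arbitrary commutative semiring R
-- (the indeterminates a, b, λ are arbitrary elements of R).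

module _ {c ℓ : Level} (R : CommutativeSemiring c ℓ) where
  open CommutativeSemiring R

  sumR : List Carrier → Carrier
  sumR = foldr _+_ 0#

  prodR : List Carrier → Carrier
  prodR = foldr _*_ 1#

  powR : Carrier → ℕ → Carrier
  powR x zero = 1#
  powR x (suc m) = x * powR x m

  natR : ℕ → Carrier
  natR zero = 0#
  natR (suc m) = 1# + natR m

  -- Motzkin path polynomial: weighted paths from (0,0) to (m,h) in ℤ×ℕ;
  -- up step weight 1, down step from height i weight β i,
  -- level step at height i weight γ i.
  motz : (ℕ → Carrier) → (ℕ → Carrier) → ℕ → ℕ → Carrier
  motz β γ zero zero = 1#
  motz β γ zero (suc h) = 0#
  motz β γ (suc m) zero = β 1 * motz β γ m 1 + γ 0 * motz β γ m 0
  motz β γ (suc m) (suc h) =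
    motz β γ m h + β (suc (suc h)) * motz β γ m (suc (suc h)) + γ (suc h) * motz β γ m (suc h)

  J : (ℕ → Carrier) → (ℕ → Carrier) → ℕ → ℕ → Carrier
  J β γ n k = motz β γ n k

  zeroSeq : ℕ → Carrier
  zeroSeq _ = 0#

  alpha : Carrier → (ℕ → Carrier) → (ℕ → ℕ → Carrier) → ℕ → Carrier
  alpha lam a b zero = 0#
  alpha lam a b (suc m) = (lam + natR m) * a m * sumR (map (λ l → b l (m ∸ l)) (upTo (suc m)))

  weight : Carrier → (ℕ → Carrier) → (ℕ → ℕ → Carrier) → {n : ℕ} → Digraph n → Carrier
  weight lam a b G =
    powR lam (cyc G)
    * prodR (map (λ i → a (ulev G i)) (filterB (isValley G) (vertices G)))
    * prodR (map (λ i → b (lcross G i) (lnest G i)) (filterB (isPeak G) (vertices G)))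

  LDalt : (n k : ℕ) → List (Digraph n)
  LDalt n k = filterB (λ G → isLaguerre G ∧ isAlternating G ∧ (numPaths G ≡ᵇ k)) (allDigraphs n)

  Qtilde : Carrier → (ℕ → Carrier) → (ℕ → ℕ → Carrier) → ℕ → ℕ → Carrier
  Qtilde lam a b n k = sumR (map (weight lam a b) (LDalt n k))

  prodA : (ℕ → Carrier) → ℕ → Carrier
  prodA a k = prodR (map a (upTo k))

{-# OPTIONS --safe #-}
-- Removing the largest vertex n of an alternating Laguerre digraph leaves one on the smaller vertex set,
-- and n itself is either isolated (a valley, whose ulev counts the path ends, i.e. the other k − 1 paths)
-- or a peak u → n → v joining the end u of one path to the start v of another, closing a cycle (factor λ)
-- when v reaches u. No other vertex changes type or statistic. Over the k + 1 paths of the smaller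
-- digraph there are λ + k weighted choices of u, and the starts v, ordered, have
-- (lcross n, lnest n) = (l, k − l) for l = 0, …, k. Hence
--   Q̃(n+1, k) = a_{k−1} Q̃(n, k−1) + (λ + k) (Σ_l b_{l,k−l}) Q̃(n, k+1),
-- the recurrence of (∏_{i<k} a_i) J_{n,k}(α, 0), because α_{k+1} = (λ + k) a_k Σ_l b_{l,k−l}.
module Submission where

open import Defs
open import Level using (Level)
open import Data.Nat using (ℕ)
open import Algebra.Bundles using (CommutativeSemiring)

module Combinatorics where

  open import Data.Nat using (zero; suc; _+_; _∸_; _*_; _<ᵇ_; _≡ᵇ_; _<_; _≤_; z≤n; s≤s)
  open import Data.Nat.Properties
  open import Data.Nat.ListAction using (sum)
  open import Data.Bool using (Bool; true; false; _∧_; _∨_; not; if_then_else_)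
  open import Data.Bool.Properties using (∧-zeroʳ; ∧-identityʳ; ∨-zeroʳ)
  open import Data.List using (List; []; _∷_; [_]; map; length; concatMap; upTo; _++_; applyUpTo; tabulate; allFin; head)
  import Data.List.Properties as LP
  open LP using (upTo-∷ʳ; length-++; map-++; map-∘; map-tabulate; head-map)
  open import Data.List.Relation.Unary.All using (All; []; _∷_)
  import Data.List.Relation.Unary.All as All
  open import Data.List.Relation.Unary.All.Properties using (map⁺; concat⁺; all-upTo)
  open import Data.Maybe using (Maybe; just; nothing)
  import Data.Maybe as M
  open import Data.Fin using (Fin; toℕ; fromℕ<)
  import Data.Fin.Properties as FP
  open import Data.Vec using (Vec; lookup) renaming ([] to []ᵥ; _∷_ to _∷ᵥ_)
  open import Data.Product using (_×_; _,_; Σ; proj₁; proj₂)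
  open import Data.Sum using (_⊎_; inj₁; inj₂)
  open import Data.Empty using (⊥-elim)
  open import Function using (_∘_)
  open import Relation.Binary using (tri<; tri≈; tri>)
  open import Relation.Binary.PropositionalEquality using (_≡_; refl; sym; trans; cong; cong₂; subst; _≢_; module ≡-Reasoning)
  open import Relation.Nullary using (yes; no; ¬_)

  -- Counting and Boolean quantifiers over ranges

  upTo-snoc : ∀ n → upTo (suc n) ≡ upTo n ++ [ n ]
  upTo-snoc n = sym (upTo-∷ʳ n)

  filterB-++ : {A : Set} (p : A → Bool) (xs ys : List A) → filterB p (xs ++ ys) ≡ filterB p xs ++ filterB p ys
  filterB-++ p [] ys = refl
  filterB-++ p (x ∷ xs) ys with p x
  ... | true = cong (x ∷_) (filterB-++ p xs ys)
  ... | false = filterB-++ p xs ys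

  count-++ : {A : Set} (p : A → Bool) (xs ys : List A) → count p (xs ++ ys) ≡ count p xs + count p ys
  count-++ p xs ys rewrite filterB-++ p xs ys = length-++ (filterB p xs)

  ind : Bool → ℕ
  ind true = 1
  ind false = 0

  count-∷ : {A : Set} (p : A → Bool) (x : A) (xs : List A) → count p (x ∷ xs) ≡ ind (p x) + count p xs
  count-∷ p x xs with p x
  ... | true = refl
  ... | false = refl

  count-upTo-suc : (p : ℕ → Bool) (n : ℕ) → count p (upTo (suc n)) ≡ count p (upTo n) + ind (p n)
  count-upTo-suc p n = trans (cong (count p) (upTo-snoc n)) (trans (count-++ p (upTo n) [ n ]) (cong (count p (upTo n) +_) (lem (p n))))
    where
    lem : (b : Bool) → count (λ _ → b) [ n ] ≡ ind b
    lem true = refl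
    lem false = refl

  filterB-cong-upTo : (p q : ℕ → Bool) (n : ℕ) → (∀ i → i < n → p i ≡ q i) → filterB p (upTo n) ≡ filterB q (upTo n)
  filterB-cong-upTo p q zero h = refl
  filterB-cong-upTo p q (suc n) h = begin
    filterB p (upTo (suc n)) ≡⟨ cong (filterB p) (upTo-snoc n) ⟩
    filterB p (upTo n ++ [ n ]) ≡⟨ filterB-++ p (upTo n) [ n ] ⟩
    filterB p (upTo n) ++ filterB p [ n ] ≡⟨ cong₂ _++_ (filterB-cong-upTo p q n (λ i i<n → h i (m<n⇒m<1+n i<n))) (lem (p n) (q n) (h n (n<1+n n))) ⟩
    filterB q (upTo n) ++ filterB q [ n ] ≡⟨ sym (filterB-++ q (upTo n) [ n ]) ⟩
    filterB q (upTo n ++ [ n ]) ≡⟨ cong (filterB q) (sym (upTo-snoc n)) ⟩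
    filterB q (upTo (suc n)) ∎
    where
    open ≡-Reasoning
    lem : (b c : Bool) → b ≡ c → filterB (λ _ → b) [ n ] ≡ filterB (λ _ → c) [ n ]
    lem b .b refl = refl

  count-cong-upTo : (p q : ℕ → Bool) (n : ℕ) → (∀ i → i < n → p i ≡ q i) → count p (upTo n) ≡ count q (upTo n)
  count-cong-upTo p q n h = cong length (filterB-cong-upTo p q n h)

  allB-++ : {A : Set} (p : A → Bool) (xs ys : List A) → allB p (xs ++ ys) ≡ allB p xs ∧ allB p ys
  allB-++ p [] ys = refl
  allB-++ p (x ∷ xs) ys rewrite allB-++ p xs ys with p x
  ... | true = refl
  ... | false = refl

  anyB-++ : {A : Set} (p : A → Bool) (xs ys : List A) → anyB p (xs ++ ys) ≡ anyB p xs ∨ anyB p ys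
  anyB-++ p [] ys = refl
  anyB-++ p (x ∷ xs) ys rewrite anyB-++ p xs ys with p x
  ... | true = refl
  ... | false = refl

  allB-upTo-suc : (p : ℕ → Bool) (n : ℕ) → allB p (upTo (suc n)) ≡ allB p (upTo n) ∧ (p n ∧ true)
  allB-upTo-suc p n = trans (cong (allB p) (upTo-snoc n)) (allB-++ p (upTo n) [ n ])

  anyB-upTo-suc : (p : ℕ → Bool) (n : ℕ) → anyB p (upTo (suc n)) ≡ anyB p (upTo n) ∨ (p n ∨ false)
  anyB-upTo-suc p n = trans (cong (anyB p) (upTo-snoc n)) (anyB-++ p (upTo n) [ n ])

  allB-cong-upTo : (p q : ℕ → Bool) (n : ℕ) → (∀ i → i < n → p i ≡ q i) → allB p (upTo n) ≡ allB q (upTo n)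
  allB-cong-upTo p q zero h = refl
  allB-cong-upTo p q (suc n) h = trans (allB-upTo-suc p n) (trans (cong₂ (λ x y → x ∧ (y ∧ true))
    (allB-cong-upTo p q n (λ i i<n → h i (m<n⇒m<1+n i<n))) (h n (n<1+n n))) (sym (allB-upTo-suc q n)))

  ∧≡true⇒ : ∀ {a b : Bool} → a ∧ b ≡ true → (a ≡ true) × (b ≡ true)
  ∧≡true⇒ {true} {true} _ = refl , refl

  ∨≡true⇒ : ∀ {a b : Bool} → a ∨ b ≡ true → (a ≡ true) ⊎ (b ≡ true)
  ∨≡true⇒ {true} _ = inj₁ refl
  ∨≡true⇒ {false} {true} _ = inj₂ refl

  allB⇒∀< : (p : ℕ → Bool) (n : ℕ) → allB p (upTo n) ≡ true → ∀ i → i < n → p i ≡ true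
  allB⇒∀< p (suc n) h i i<n with ∧≡true⇒ {allB p (upTo n)} (trans (sym (allB-upTo-suc p n)) h)
  ... | h1 , h2 with i ≟ n
  ... | yes refl = proj₁ (∧≡true⇒ h2)
  ... | no i≢n = allB⇒∀< p n h1 i (≤∧≢⇒< (≤-pred i<n) i≢n)

  ∀<⇒allB : (p : ℕ → Bool) (n : ℕ) → (∀ i → i < n → p i ≡ true) → allB p (upTo n) ≡ true
  ∀<⇒allB p zero h = refl
  ∀<⇒allB p (suc n) h = trans (allB-upTo-suc p n) (cong₂ (λ x y → x ∧ (y ∧ true)) (∀<⇒allB p n (λ i i<n → h i (m<n⇒m<1+n i<n))) (h n (n<1+n n)))

  anyB⇒∃< : (p : ℕ → Bool) (n : ℕ) → anyB p (upTo n) ≡ true → Σ ℕ (λ i → (i < n) × (p i ≡ true))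
  anyB⇒∃< p zero ()
  anyB⇒∃< p (suc n) h with ∨≡true⇒ {anyB p (upTo n)} (trans (sym (anyB-upTo-suc p n)) h)
  ... | inj₁ h1 = let (i , i<n , pi) = anyB⇒∃< p n h1 in i , m<n⇒m<1+n i<n , pi
  ... | inj₂ h2 with ∨≡true⇒ {p n} h2
  ... | inj₁ pn = n , n<1+n n , pn

  ∃<⇒anyB : (p : ℕ → Bool) (n i : ℕ) → i < n → p i ≡ true → anyB p (upTo n) ≡ true
  ∃<⇒anyB p (suc n) i i<n pi with i ≟ n
  ... | yes refl = trans (anyB-upTo-suc p i) (trans (cong (λ x → anyB p (upTo i) ∨ (x ∨ false)) pi) (∨-zeroʳ (anyB p (upTo i))))
  ... | no i≢n = trans (anyB-upTo-suc p n) (cong (_∨ (p n ∨ false)) (∃<⇒anyB p n i (≤∧≢⇒< (≤-pred i<n) i≢n) pi))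

  count-cong : {A : Set} (p q : A → Bool) → (∀ x → p x ≡ q x) → (xs : List A) → count p xs ≡ count q xs
  count-cong p q e [] = refl
  count-cong p q e (x ∷ xs) = trans (count-∷ p x xs) (trans (cong₂ _+_ (cong ind (e x)) (count-cong p q e xs)) (sym (count-∷ q x xs)))

  -- Digraphs as successor functions on ℕ

  BoundedBy : ℕ → ℕ∞ → Set
  BoundedBy N e = ∀ y → e ≡ just y → y < N

  targets : ℕ∞ → ℕ → Bool
  targets (just j) i = j ≡ᵇ i
  targets nothing i = false

  stepₛ : (ℕ → ℕ∞) → ℕ∞ → ℕ∞
  stepₛ s nothing = nothing
  stepₛ s (just j) = s j

  iterₛ : (ℕ → ℕ∞) → ℕ → ℕ∞ → ℕ∞
  iterₛ s zero x = x
  iterₛ s (suc m) x = stepₛ s (iterₛ s m x)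

  -- The notions of Defs for the digraph on {0, …, N − 1} with successor function s, so that adding
  -- the vertex N only changes N and s.
  module Succ (N : ℕ) (s : ℕ → ℕ∞) where

    verticesₛ : List ℕ
    verticesₛ = upTo N

    isLaguerreₛ : Bool
    isLaguerreₛ = allB (λ i → allB (λ j → allB (λ k →
                   not (targets (s i) k ∧ targets (s j) k)
                   ∨ (i ≡ᵇ j)) verticesₛ) verticesₛ) verticesₛ

    predₛ : ℕ → ℕ∞
    predₛ i = head (filterB (λ j → targets (s j) i) verticesₛ)

    valₛ : ℕ → ℕ∞
    valₛ i = just i

    isPeakₛ isValleyₛ isDAscₛ isDDescₛ isFixₛ : ℕ → Bool
    isPeakₛ i = (predₛ i <∞ valₛ i) ∧ (s i <∞ valₛ i)
    isValleyₛ i = (valₛ i <∞ predₛ i) ∧ (valₛ i <∞ s i)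
    isDAscₛ i = (predₛ i <∞ valₛ i) ∧ (valₛ i <∞ s i)
    isDDescₛ i = (valₛ i <∞ predₛ i) ∧ (s i <∞ valₛ i)
    isFixₛ i = (predₛ i =∞ valₛ i) ∧ (valₛ i =∞ s i)

    isAlternatingₛ : Bool
    isAlternatingₛ = allB (λ i → not (isDAscₛ i ∨ isDDescₛ i ∨ isFixₛ i)) verticesₛ

    isStartₛ : ℕ → Bool
    isStartₛ i = predₛ i =∞ nothing

    numPathsₛ : ℕ
    numPathsₛ = count isStartₛ verticesₛ

    isCycleMinₛ : ℕ → Bool
    isCycleMinₛ i = anyB (λ m → iterₛ s (suc m) (just i) =∞ valₛ i) (upTo N)
                 ∧ allB (λ m → not (iterₛ s (suc m) (just i) <∞ valₛ i)) (upTo N)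

    cycₛ : ℕ
    cycₛ = count isCycleMinₛ verticesₛ

    extVerticesₛ : List ℕ∞
    extVerticesₛ = nothing ∷ map valₛ verticesₛ

    triplesₛ : List (ℕ × ℕ × ℕ∞)
    triplesₛ = concatMap (λ i → concatMap (λ j → map (λ l → i , j , l) extVerticesₛ) verticesₛ) verticesₛ

    lcrossₛ : ℕ → ℕ
    lcrossₛ k = count (λ { (i , j , l) →
        (valₛ i <∞ valₛ j) ∧ (valₛ j <∞ valₛ k) ∧ (valₛ k <∞ l)
        ∧ (predₛ i =∞ valₛ k) ∧ (predₛ j =∞ l) }) triplesₛ

    lnestₛ : ℕ → ℕ
    lnestₛ k = count (λ { (i , j , l) →
        (valₛ i <∞ valₛ j) ∧ (valₛ j <∞ valₛ k) ∧ (valₛ k <∞ l)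
        ∧ (predₛ j =∞ valₛ k) ∧ (predₛ i =∞ l) }) triplesₛ

    ulevₛ : ℕ → ℕ
    ulevₛ j = if valₛ j <∞ s j
             then count (λ i → (valₛ i <∞ valₛ j) ∧ (valₛ j <∞ s i)) verticesₛ
             else 0

    inLDaltₛ : ℕ → Bool
    inLDaltₛ k = isLaguerreₛ ∧ isAlternatingₛ ∧ (numPathsₛ ≡ᵇ k)

    valleyWeights : {ℓ : Level} {C : Set ℓ} → (ℕ → C) → List C
    valleyWeights a = map (λ i → a (ulevₛ i)) (filterB isValleyₛ verticesₛ)

    peakWeights : {ℓ : Level} {C : Set ℓ} → (ℕ → ℕ → C) → List C
    peakWeights b = map (λ i → b (lcrossₛ i) (lnestₛ i)) (filterB isPeakₛ verticesₛ)

  succList : {n m : ℕ} → Vec (Maybe (Fin n)) m → List ℕ∞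
  succList []ᵥ = []
  succList (x ∷ᵥ xs) = M.map toℕ x ∷ succList xs

  succOf : List ℕ∞ → ℕ → ℕ∞
  succOf [] _ = nothing
  succOf (x ∷ xs) zero = x
  succOf (x ∷ xs) (suc i) = succOf xs i

  succOf-succList : {n m : ℕ} (G : Vec (Maybe (Fin n)) m) (i : Fin m) → succOf (succList G) (toℕ i) ≡ M.map toℕ (lookup G i)
  succOf-succList (x ∷ᵥ G) Fin.zero = refl
  succOf-succList (x ∷ᵥ G) (Fin.suc i) = succOf-succList G i

  tabulate-toℕ : {A : Set} (n : ℕ) (f : ℕ → A) → tabulate {n = n} (f ∘ toℕ) ≡ applyUpTo f n
  tabulate-toℕ zero f = refl
  tabulate-toℕ (suc n) f = cong (f 0 ∷_) (tabulate-toℕ n (f ∘ suc))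

  map-toℕ-allFin : (n : ℕ) → map toℕ (allFin n) ≡ upTo n
  map-toℕ-allFin n = trans (map-tabulate (λ i → i) toℕ) (tabulate-toℕ n (λ i → i))

  module _ {A B : Set} (h : A → B) where
    map-filterB : (p : A → Bool) (q : B → Bool) → (∀ x → p x ≡ q (h x)) → (xs : List A) → map h (filterB p xs) ≡ filterB q (map h xs)
    map-filterB p q e [] = refl
    map-filterB p q e (x ∷ xs) rewrite sym (e x) with p x
    ... | true = cong (h x ∷_) (map-filterB p q e xs)
    ... | false = map-filterB p q e xs

    count-map : (p : A → Bool) (q : B → Bool) → (∀ x → p x ≡ q (h x)) → (xs : List A) → count p xs ≡ count q (map h xs)
    count-map p q e xs = trans (sym (LP.length-map h (filterB p xs))) (cong length (map-filterB p q e xs))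

    allB-map : (p : A → Bool) (q : B → Bool) → (∀ x → p x ≡ q (h x)) → (xs : List A) → allB p xs ≡ allB q (map h xs)
    allB-map p q e [] = refl
    allB-map p q e (x ∷ xs) = cong₂ _∧_ (e x) (allB-map p q e xs)

  map-concatMap : {A B C D : Set} (f : A → List C) (g : B → List D) (h : A → B) (k : C → D) →
    (∀ x → map k (f x) ≡ g (h x)) → (xs : List A) → map k (concatMap f xs) ≡ concatMap g (map h xs)
  map-concatMap f g h k e [] = refl
  map-concatMap f g h k e (x ∷ xs) = trans (map-++ k (f x) (concatMap f xs)) (cong₂ _++_ (e x) (map-concatMap f g h k e xs))

  allB-cong : {A : Set} (p q : A → Bool) → (∀ x → p x ≡ q x) → (xs : List A) → allB p xs ≡ allB q xs
  allB-cong p q e [] = refl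
  allB-cong p q e (x ∷ xs) = cong₂ _∧_ (e x) (allB-cong p q e xs)

  anyB-cong : {A : Set} (p q : A → Bool) → (∀ x → p x ≡ q x) → (xs : List A) → anyB p xs ≡ anyB q xs
  anyB-cong p q e [] = refl
  anyB-cong p q e (x ∷ xs) = cong₂ _∨_ (e x) (anyB-cong p q e xs)

  module Transfer {n : ℕ} (G : Digraph n) where
    sG : ℕ → ℕ∞
    sG = succOf (succList G)
    open Succ n sG

    vert : map toℕ (vertices G) ≡ verticesₛ
    vert = map-toℕ-allFin n

    succ-eq : ∀ i → succ G i ≡ sG (toℕ i)
    succ-eq i = sym (succOf-succList G i)

    pt-eq : ∀ j i → pointsTo G (lookup G j) i ≡ targets (sG (toℕ j)) (toℕ i)
    pt-eq j i rewrite succOf-succList G j with lookup G j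
    ... | just x = refl
    ... | nothing = refl

    pred-hd : ∀ i → pred G i ≡ M.map toℕ (head (filterB (λ j → pointsTo G (lookup G j) i) (vertices G)))
    pred-hd i with filterB (λ j → pointsTo G (lookup G j) i) (vertices G)
    ... | [] = refl
    ... | j ∷ _ = refl

    pred-eq : ∀ i → pred G i ≡ predₛ (toℕ i)
    pred-eq i = trans (pred-hd i) (trans (sym (head-map _)) (cong head (trans
      (map-filterB toℕ (λ j → pointsTo G (lookup G j) i) (λ j → targets (sG j) (toℕ i)) (λ j → pt-eq j i) (vertices G))
      (cong (filterB (λ j → targets (sG j) (toℕ i))) vert))))

    lag-eq : isLaguerre G ≡ isLaguerreₛ
    lag-eq = trans (allB-map toℕ _ _ (λ i → trans (allB-map toℕ _ _ (λ j → trans (allB-map toℕ _ _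
        (λ k → cong₂ (λ x y → not (x ∧ y) ∨ (toℕ i ≡ᵇ toℕ j)) (pt-eq i k) (pt-eq j k)) (vertices G))
        (cong (allB _) vert)) (vertices G)) (cong (allB _) vert)) (vertices G)) (cong (allB _) vert)

    peak-eq : ∀ i → isPeak G i ≡ isPeakₛ (toℕ i)
    peak-eq i = cong₂ (λ x y → (x <∞ just (toℕ i)) ∧ (y <∞ just (toℕ i))) (pred-eq i) (succ-eq i)
    valley-eq : ∀ i → isValley G i ≡ isValleyₛ (toℕ i)
    valley-eq i = cong₂ (λ x y → (just (toℕ i) <∞ x) ∧ (just (toℕ i) <∞ y)) (pred-eq i) (succ-eq i)
    dasc-eq : ∀ i → isDAsc G i ≡ isDAscₛ (toℕ i)
    dasc-eq i = cong₂ (λ x y → (x <∞ just (toℕ i)) ∧ (just (toℕ i) <∞ y)) (pred-eq i) (succ-eq i)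
    ddesc-eq : ∀ i → isDDesc G i ≡ isDDescₛ (toℕ i)
    ddesc-eq i = cong₂ (λ x y → (just (toℕ i) <∞ x) ∧ (y <∞ just (toℕ i))) (pred-eq i) (succ-eq i)
    fix-eq : ∀ i → isFix G i ≡ isFixₛ (toℕ i)
    fix-eq i = cong₂ (λ x y → (x =∞ just (toℕ i)) ∧ (just (toℕ i) =∞ y)) (pred-eq i) (succ-eq i)

    alt-eq : isAlternating G ≡ isAlternatingₛ
    alt-eq = trans (allB-map toℕ _ _ (λ i → cong not (cong₂ _∨_ (dasc-eq i) (cong₂ _∨_ (ddesc-eq i) (fix-eq i)))) (vertices G))
      (cong (allB _) vert)

    np-eq : numPaths G ≡ numPathsₛ
    np-eq = trans (count-map toℕ _ _ (λ i → cong (_=∞ nothing) (pred-eq i)) (vertices G)) (cong (count _) vert)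

    step-eq : ∀ x → M.map toℕ (step G x) ≡ stepₛ sG (M.map toℕ x)
    step-eq nothing = refl
    step-eq (just j) = sym (succOf-succList G j)

    iter-eq : ∀ m x → M.map toℕ (iter G m x) ≡ iterₛ sG m (M.map toℕ x)
    iter-eq zero x = refl
    iter-eq (suc m) x = trans (step-eq (iter G m x)) (cong (stepₛ sG) (iter-eq m x))

    cm-eq : ∀ i → isCycleMin G i ≡ isCycleMinₛ (toℕ i)
    cm-eq i = cong₂ _∧_ (anyB-cong _ _ (λ m → cong (_=∞ just (toℕ i)) (iter-eq (suc m) (just i))) (upTo n))
                        (allB-cong _ _ (λ m → cong (λ x → not (x <∞ just (toℕ i))) (iter-eq (suc m) (just i))) (upTo n))

    cyc-eq : cyc G ≡ cycₛ
    cyc-eq = trans (count-map toℕ _ _ cm-eq (vertices G)) (cong (count _) vert)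

    toℕ₂ : Fin n × Fin n × ℕ∞ → ℕ × ℕ × ℕ∞
    toℕ₂ (i , j , l) = toℕ i , toℕ j , l

    ext-eq : extVertices G ≡ extVerticesₛ
    ext-eq = cong (nothing ∷_) (trans (map-∘ (vertices G)) (cong (map valₛ) vert))

    trip-eq : map toℕ₂ (triples G) ≡ triplesₛ
    trip-eq = trans (map-concatMap _ _ toℕ toℕ₂ (λ i → trans (map-concatMap _ _ toℕ toℕ₂
        (λ j → trans (sym (map-∘ (extVertices G))) (cong (map (λ l → toℕ i , toℕ j , l)) ext-eq)) (vertices G))
        (cong (concatMap _) vert)) (vertices G))
      (cong (concatMap _) vert)

    lcross-eq : ∀ k → lcross G k ≡ lcrossₛ (toℕ k)
    lcross-eq k = trans (count-map toℕ₂ _ _ e (triples G)) (cong (count _) trip-eq)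
      where
      e : ∀ t → _ ≡ _
      e (i , j , l) = cong₂ (λ x y → (just (toℕ i) <∞ just (toℕ j)) ∧ (just (toℕ j) <∞ just (toℕ k)) ∧ (just (toℕ k) <∞ l)
        ∧ (x =∞ just (toℕ k)) ∧ (y =∞ l)) (pred-eq i) (pred-eq j)

    lnest-eq : ∀ k → lnest G k ≡ lnestₛ (toℕ k)
    lnest-eq k = trans (count-map toℕ₂ _ _ e (triples G)) (cong (count _) trip-eq)
      where
      e : ∀ t → _ ≡ _
      e (i , j , l) = cong₂ (λ x y → (just (toℕ i) <∞ just (toℕ j)) ∧ (just (toℕ j) <∞ just (toℕ k)) ∧ (just (toℕ k) <∞ l)
        ∧ (x =∞ just (toℕ k)) ∧ (y =∞ l)) (pred-eq j) (pred-eq i)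

    ulev-eq : ∀ j → ulev G j ≡ ulevₛ (toℕ j)
    ulev-eq j = cong₂ (λ x c → if just (toℕ j) <∞ x then c else 0) (succ-eq j)
      (trans (count-map toℕ _ _ (λ i → cong (λ y → (just (toℕ i) <∞ just (toℕ j)) ∧ (just (toℕ j) <∞ y)) (succ-eq i)) (vertices G))
        (cong (count _) vert))

    map-filterB-transfer : {ℓ' : Level} {C : Set ℓ'} (f : Fin n → C) (g : ℕ → C) (p : Fin n → Bool) (q : ℕ → Bool) →
      (∀ i → f i ≡ g (toℕ i)) → (∀ i → p i ≡ q (toℕ i)) → map f (filterB p (vertices G)) ≡ map g (filterB q verticesₛ)
    map-filterB-transfer f g p q ef ep = trans (LP.map-cong ef (filterB p (vertices G)))
      (trans (map-∘ (filterB p (vertices G))) (cong (map g) (trans (map-filterB toℕ p q ep (vertices G)) (cong (filterB q) vert))))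

    valleyWeights-transfer : {ℓ′ : Level} {C : Set ℓ′} (a : ℕ → C) →
      map (λ i → a (ulev G i)) (filterB (isValley G) (vertices G)) ≡ valleyWeights a
    valleyWeights-transfer a = map-filterB-transfer _ _ _ _ (λ i → cong a (ulev-eq i)) valley-eq

    peakWeights-transfer : {ℓ′ : Level} {C : Set ℓ′} (b : ℕ → ℕ → C) →
      map (λ i → b (lcross G i) (lnest G i)) (filterB (isPeak G) (vertices G)) ≡ peakWeights b
    peakWeights-transfer b = map-filterB-transfer _ _ _ _ (λ i → cong₂ b (lcross-eq i) (lnest-eq i)) peak-eq

    inLDalt-transfer : ∀ k → (isLaguerre G ∧ isAlternating G ∧ (numPaths G ≡ᵇ k)) ≡ inLDaltₛ k
    inLDalt-transfer k = cong₂ _∧_ lag-eq (cong₂ _∧_ alt-eq (cong (_≡ᵇ k) np-eq))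

  allLists : {A : Set} → List A → ℕ → List (List A)
  allLists xs zero = [ [] ]
  allLists xs (suc m) = concatMap (λ x → map (x ∷_) (allLists xs m)) xs

  map-succList-allVecs : {n : ℕ} (E : List (Maybe (Fin n))) (m : ℕ) → map succList (allVecs E m) ≡ allLists (map (M.map toℕ) E) m
  map-succList-allVecs E zero = refl
  map-succList-allVecs E (suc m) = map-concatMap _ _ (M.map toℕ) succList
    (λ x → trans (sym (map-∘ (allVecs E m))) (trans (map-∘ (allVecs E m)) (cong (map (M.map toℕ x ∷_)) (map-succList-allVecs E m)))) E

  succChoices : ℕ → List ℕ∞
  succChoices n = nothing ∷ map just (upTo n)

  succChoices-suc : ∀ n → succChoices (suc n) ≡ succChoices n ++ [ just n ]
  succChoices-suc n = cong (nothing ∷_) (trans (cong (map just) (upTo-snoc n)) (map-++ just (upTo n) [ n ]))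

  map-succList-allDigraphs : (n : ℕ) → map succList (allDigraphs n) ≡ allLists (succChoices n) n
  map-succList-allDigraphs n = trans (map-succList-allVecs _ n) (cong (λ E → allLists E n) (cong (nothing ∷_)
    (trans (sym (map-∘ (allFin n))) (trans (map-∘ (allFin n)) (cong (map just) (map-toℕ-allFin n))))))

  setAt : List ℕ∞ → ℕ → ℕ∞ → List ℕ∞
  setAt [] u t = []
  setAt (x ∷ L) zero t = t ∷ L
  setAt (x ∷ L) (suc u) t = x ∷ setAt L u t

  allLists-length : {A : Set} (E : List A) (m : ℕ) → All (λ L → length L ≡ m) (allLists E m)
  allLists-length E zero = refl ∷ []
  allLists-length E (suc m) = concat⁺ (map⁺ (All.universal (λ x → map⁺ (All.map (cong suc) (allLists-length E m))) E))

  ≡ᵇ→≡ : ∀ a b → (a ≡ᵇ b) ≡ true → a ≡ b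
  ≡ᵇ→≡ zero zero _ = refl
  ≡ᵇ→≡ (suc a) (suc b) h = cong suc (≡ᵇ→≡ a b h)
  ≡ᵇ→≡ zero (suc b) ()
  ≡ᵇ→≡ (suc a) zero ()

  ≡ᵇ-refl : ∀ a → (a ≡ᵇ a) ≡ true
  ≡ᵇ-refl zero = refl
  ≡ᵇ-refl (suc a) = ≡ᵇ-refl a

  inLDaltₛ⇒ : ∀ {N s k} → Succ.inLDaltₛ N s k ≡ true → (Succ.isLaguerreₛ N s ≡ true) × (Succ.numPathsₛ N s ≡ k)
  inLDaltₛ⇒ {N} {s} adm with ∧≡true⇒ {Succ.isLaguerreₛ N s} adm
  ... | laguerre , rest = laguerre , ≡ᵇ→≡ _ _ (proj₂ (∧≡true⇒ {Succ.isAlternatingₛ N s} rest))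

  ≢→≡ᵇ : ∀ a b → a ≢ b → (a ≡ᵇ b) ≡ false
  ≢→≡ᵇ zero zero h = ⊥-elim (h refl)
  ≢→≡ᵇ zero (suc b) h = refl
  ≢→≡ᵇ (suc a) zero h = refl
  ≢→≡ᵇ (suc a) (suc b) h = ≢→≡ᵇ a b (λ e → h (cong suc e))

  <ᵇ→< : ∀ a b → (a <ᵇ b) ≡ true → a < b
  <ᵇ→< zero (suc b) _ = s≤s z≤n
  <ᵇ→< (suc a) (suc b) h = s≤s (<ᵇ→< a b h)
  <ᵇ→< zero zero ()
  <ᵇ→< (suc a) zero ()

  <→<ᵇ : ∀ a b → a < b → (a <ᵇ b) ≡ true
  <→<ᵇ zero (suc b) _ = refl
  <→<ᵇ (suc a) (suc b) (s≤s h) = <→<ᵇ a b h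

  ≤→<ᵇ : ∀ a b → b ≤ a → (a <ᵇ b) ≡ false
  ≤→<ᵇ a zero _ = refl
  ≤→<ᵇ zero (suc b) ()
  ≤→<ᵇ (suc a) (suc b) (s≤s h) = ≤→<ᵇ a b h

  <ᵇ-false→ : ∀ a b → (a <ᵇ b) ≡ false → b ≤ a
  <ᵇ-false→ a b h with a <? b
  ... | yes a<b = case (trans (sym (<→<ᵇ a b a<b)) h)
    where
    case : true ≡ false → b ≤ a
    case ()
  ... | no a≮b = ≮⇒≥ a≮b

  bool-iff : (b c : Bool) → (b ≡ true → c ≡ true) → (c ≡ true → b ≡ true) → b ≡ c
  bool-iff true true f g = refl
  bool-iff false false f g = refl
  bool-iff true false f g = sym (f refl)
  bool-iff false true f g = g refl

  false≢true : false ≢ true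
  false≢true ()

  not-true : ∀ {b} → b ≡ false → not b ≡ true
  not-true refl = refl

  true-not : ∀ {b} → not b ≡ true → b ≡ false
  true-not {false} _ = refl

  count-none : (p : ℕ → Bool) (n : ℕ) → (∀ i → i < n → p i ≡ false) → count p (upTo n) ≡ 0
  count-none p zero h = refl
  count-none p (suc n) h = trans (count-upTo-suc p n) (cong₂ _+_ (count-none p n (λ i i<n → h i (m<n⇒m<1+n i<n))) (cong ind (h n (n<1+n n))))

  count-one : (p : ℕ → Bool) (n i0 : ℕ) → i0 < n → p i0 ≡ true → (∀ i → i < n → p i ≡ true → i ≡ i0) → count p (upTo n) ≡ 1
  count-one p (suc n) i0 i0<n pi0 h with i0 ≟ n
  ... | yes refl = trans (count-upTo-suc p n) (cong₂ _+_ (count-none p n (λ i i<n → f i i<n)) (cong ind pi0))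
    where
    f : ∀ i → i < i0 → p i ≡ false
    f i i<n with p i in eq
    ... | true = ⊥-elim (<-irrefl (h i (m<n⇒m<1+n i<n) eq) i<n)
    ... | false = refl
  ... | no i0≢n = trans (count-upTo-suc p n) (trans (cong₂ _+_ (count-one p n i0 (≤∧≢⇒< (≤-pred i0<n) i0≢n) pi0 (λ i i<n e → h i (m<n⇒m<1+n i<n) e)) (cong ind pn)) refl)
    where
    pn : p n ≡ false
    pn with p n in eq
    ... | true = ⊥-elim (i0≢n (sym (h n (n<1+n n) eq)))
    ... | false = refl

  count-le1 : (p : ℕ → Bool) (n : ℕ) → (∀ i j → i < n → j < n → p i ≡ true → p j ≡ true → i ≡ j) → count p (upTo n) ≤ 1
  count-le1 p zero h = z≤n
  count-le1 p (suc n) h with p n in eq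
  ... | true = subst (_≤ 1) (sym (trans (count-upTo-suc p n) (cong₂ _+_ (count-none p n f) (cong ind eq)))) ≤-refl
    where
    f : ∀ i → i < n → p i ≡ false
    f i i<n with p i in e2
    ... | true = ⊥-elim (<-irrefl (h i n (m<n⇒m<1+n i<n) (n<1+n n) e2 eq) i<n)
    ... | false = refl
  ... | false = subst (_≤ 1) (sym (trans (count-upTo-suc p n) (trans (cong (count p (upTo n) +_) (cong ind eq)) (+-identityʳ _))))
                  (count-le1 p n (λ i j i<n j<n → h i j (m<n⇒m<1+n i<n) (m<n⇒m<1+n j<n)))

  count-split : {A : Set} (p q : A → Bool) (xs : List A) → count p xs ≡ count (λ x → p x ∧ q x) xs + count (λ x → p x ∧ not (q x)) xs
  count-split p q [] = refl
  count-split p q (x ∷ xs) with p x | q x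
  ... | true | true = cong suc (count-split p q xs)
  ... | true | false = trans (cong suc (count-split p q xs)) (sym (+-suc _ _))
  ... | false | true = count-split p q xs
  ... | false | false = count-split p q xs

  count-compl : {A : Set} (p : A → Bool) (xs : List A) → count p xs + count (not ∘ p) xs ≡ length xs
  count-compl p [] = refl
  count-compl p (x ∷ xs) with p x
  ... | true = cong suc (count-compl p xs)
  ... | false = trans (+-suc _ _) (cong suc (count-compl p xs))

  count-drop1 : (p q : ℕ → Bool) (n v : ℕ) → v < n → p v ≡ true → q v ≡ false → (∀ i → i < n → i ≢ v → p i ≡ q i) →
    count p (upTo n) ≡ suc (count q (upTo n))
  count-drop1 p q (suc n) v v<n pv qv h with v ≟ n
  ... | yes refl = trans (count-upTo-suc p v) (trans (cong₂ _+_ (count-cong-upTo p q v (λ i i<v → h i (m<n⇒m<1+n i<v) (λ e → <-irrefl e i<v))) (cong ind pv))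
      (trans (+-comm _ 1) (cong suc (trans (sym (+-identityʳ _)) (trans (cong (count q (upTo v) +_) (cong ind (sym qv))) (sym (count-upTo-suc q v)))))))
  ... | no v≢n = trans (count-upTo-suc p n) (trans (cong₂ _+_ (count-drop1 p q n v (≤∧≢⇒< (≤-pred v<n) v≢n) pv qv (λ i i<n → h i (m<n⇒m<1+n i<n)))
       (cong ind (h n (n<1+n n) (λ e → v≢n (sym e))))) (sym (cong suc (count-upTo-suc q n))))

  sumN : {A : Set} → List A → (A → ℕ) → ℕ
  sumN xs f = sum (map f xs)

  sumN-++ : {A : Set} (xs ys : List A) (f : A → ℕ) → sumN (xs ++ ys) f ≡ sumN xs f + sumN ys f
  sumN-++ [] ys f = refl
  sumN-++ (x ∷ xs) ys f = trans (cong (f x +_) (sumN-++ xs ys f)) (sym (+-assoc (f x) _ _))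

  sumS : (n : ℕ) (f : ℕ → ℕ) → sumN (upTo (suc n)) f ≡ sumN (upTo n) f + f n
  sumS n f = trans (cong (λ z → sumN z f) (upTo-snoc n)) (trans (sumN-++ (upTo n) [ n ] f) (cong (sumN (upTo n) f +_) (+-identityʳ (f n))))

  sumN-cong-upTo : (n : ℕ) (f g : ℕ → ℕ) → (∀ i → i < n → f i ≡ g i) → sumN (upTo n) f ≡ sumN (upTo n) g
  sumN-cong-upTo zero f g h = refl
  sumN-cong-upTo (suc n) f g h = trans (sumS n f) (trans (cong₂ _+_ (sumN-cong-upTo n f g (λ i i<n → h i (m<n⇒m<1+n i<n))) (h n (n<1+n n))) (sym (sumS n g)))

  sumN-cong : {A : Set} (xs : List A) (f g : A → ℕ) → (∀ x → f x ≡ g x) → sumN xs f ≡ sumN xs g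
  sumN-cong [] f g h = refl
  sumN-cong (x ∷ xs) f g h = cong₂ _+_ (h x) (sumN-cong xs f g h)

  sumN-zero : (n : ℕ) (f : ℕ → ℕ) → (∀ i → i < n → f i ≡ 0) → sumN (upTo n) f ≡ 0
  sumN-zero zero f h = refl
  sumN-zero (suc n) f h = trans (sumS n f) (cong₂ _+_ (sumN-zero n f (λ i i<n → h i (m<n⇒m<1+n i<n))) (h n (n<1+n n)))

  sumN-single : (N v : ℕ) (f : ℕ → ℕ) → v < N → (∀ i → i < N → i ≢ v → f i ≡ 0) → sumN (upTo N) f ≡ f v
  sumN-single (suc N) v f v<N h with v ≟ N
  ... | yes refl = trans (sumS v f) (cong (_+ f v) (sumN-zero v f (λ i i<v → h i (m<n⇒m<1+n i<v) (λ e → <-irrefl e i<v))))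
  ... | no v≢N = trans (sumS N f) (trans (cong₂ _+_ (sumN-single N v f (≤∧≢⇒< (≤-pred v<N) v≢N) (λ i i<N → h i (m<n⇒m<1+n i<N))) (h N (n<1+n N) (λ e → v≢N (sym e)))) (+-identityʳ _))

  sumN-+ : {A : Set} (xs : List A) (f g : A → ℕ) → sumN xs (λ x → f x + g x) ≡ sumN xs f + sumN xs g
  sumN-+ [] f g = refl
  sumN-+ (x ∷ xs) f g = trans (cong (f x + g x +_) (sumN-+ xs f g)) (+-assoc-lemma (f x) (g x) _ _)
    where
    +-assoc-lemma : ∀ a b c d → a + b + (c + d) ≡ a + c + (b + d)
    +-assoc-lemma a b c d = trans (+-assoc a b (c + d)) (trans (cong (a +_) (trans (sym (+-assoc b c d)) (trans (cong (_+ d) (+-comm b c)) (+-assoc c b d)))) (sym (+-assoc a c (b + d))))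

  sumN-swap : {A B : Set} (xs : List A) (ys : List B) (f : A → B → ℕ) → sumN xs (λ x → sumN ys (f x)) ≡ sumN ys (λ y → sumN xs (λ x → f x y))
  sumN-swap [] ys f = sym (sumN-zero' ys)
    where
    sumN-zero' : {B : Set} (ys : List B) → sumN ys (λ _ → 0) ≡ 0
    sumN-zero' [] = refl
    sumN-zero' (y ∷ ys) = sumN-zero' ys
  sumN-swap (x ∷ xs) ys f = trans (cong (sumN ys (f x) +_) (sumN-swap xs ys f)) (sym (sumN-+ ys (f x) (λ y → sumN xs (λ x → f x y))))

  count-sumN : {A : Set} (p : A → Bool) (xs : List A) → count p xs ≡ sumN xs (ind ∘ p)
  count-sumN p [] = refl
  count-sumN p (x ∷ xs) = trans (count-∷ p x xs) (cong (ind (p x) +_) (count-sumN p xs))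

  count-concatMap : {A B : Set} (p : B → Bool) (f : A → List B) (xs : List A) → count p (concatMap f xs) ≡ sumN xs (count p ∘ f)
  count-concatMap p f [] = refl
  count-concatMap p f (x ∷ xs) = trans (count-++ p (f x) (concatMap f xs)) (cong (count p (f x) +_) (count-concatMap p f xs))

  count-mapL : {A B : Set} (p : B → Bool) (f : A → B) (xs : List A) → count p (map f xs) ≡ count (p ∘ f) xs
  count-mapL p f [] = refl
  count-mapL p f (x ∷ xs) = trans (count-∷ p (f x) (map f xs)) (trans (cong (ind (p (f x)) +_) (count-mapL p f xs)) (sym (count-∷ (p ∘ f) x xs)))

  filterB-cong : {A : Set} (p q : A → Bool) → (∀ x → p x ≡ q x) → (xs : List A) → filterB p xs ≡ filterB q xs
  filterB-cong p q e [] = refl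
  filterB-cong p q e (x ∷ xs) rewrite e x with q x
  ... | true = cong (x ∷_) (filterB-cong p q e xs)
  ... | false = filterB-cong p q e xs

  filterS : (p : ℕ → Bool) (n : ℕ) → filterB p (upTo (suc n)) ≡ filterB p (upTo n) ++ (if p n then [ n ] else [])
  filterS p n = trans (cong (filterB p) (upTo-snoc n)) (trans (filterB-++ p (upTo n) [ n ]) (cong (filterB p (upTo n) ++_) (lem (p n))))
    where
    lem : (b : Bool) → filterB (λ _ → b) [ n ] ≡ (if b then [ n ] else [])
    lem true = refl
    lem false = refl

  map-filterB-upTo-suc : {ℓ : Level} {C : Set ℓ} (f : ℕ → C) (p : ℕ → Bool) (n : ℕ) → map f (filterB p (upTo (suc n))) ≡ map f (filterB p (upTo n)) ++ (if p n then [ f n ] else [])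
  map-filterB-upTo-suc f p n = trans (cong (map f) (filterS p n)) (trans (LP.map-++ f (filterB p (upTo n)) _) (cong (map f (filterB p (upTo n)) ++_) (lem (p n))))
    where
    lem : (b : Bool) → map f (if b then [ n ] else []) ≡ (if b then [ f n ] else [])
    lem true = refl
    lem false = refl

  mapfilter-cong-up : {ℓ : Level} {B : Set ℓ} (f g : ℕ → B) (p q : ℕ → Bool) (n : ℕ) → (∀ i → i < n → p i ≡ q i) →
    (∀ i → i < n → p i ≡ true → f i ≡ g i) → map f (filterB p (upTo n)) ≡ map g (filterB q (upTo n))
  mapfilter-cong-up f g p q zero hp hf = refl
  mapfilter-cong-up f g p q (suc n) hp hf = trans (cong (map f) (filterS p n)) (trans (LP.map-++ f (filterB p (upTo n)) _)
      (trans (cong₂ _++_ (mapfilter-cong-up f g p q n (λ i i<n → hp i (m<n⇒m<1+n i<n)) (λ i i<n → hf i (m<n⇒m<1+n i<n))) (lem (p n) (q n) (hp n (n<1+n n)) (hf n (n<1+n n))))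
      (trans (sym (LP.map-++ g (filterB q (upTo n)) _)) (cong (map g) (sym (filterS q n))))))
    where
    lem : (b c : Bool) → b ≡ c → (b ≡ true → f n ≡ g n) → map f (if b then [ n ] else []) ≡ map g (if c then [ n ] else [])
    lem true .true refl h = cong [_] (h refl)
    lem false .false refl h = refl

  count0-filter : {A : Set} (p : A → Bool) (xs : List A) → count p xs ≡ 0 → filterB p xs ≡ []
  count0-filter p xs h with filterB p xs
  ... | [] = refl

  filter-single : (u N : ℕ) → u < N → filterB (λ j → j ≡ᵇ u) (upTo N) ≡ [ u ]
  filter-single u (suc N) u<N with u ≟ N
  ... | yes refl = trans (filterS _ u) (trans (cong₂ _++_ (count0-filter _ (upTo u) (count-none _ u (λ j j<u → ≢→≡ᵇ j u (λ e → <-irrefl e j<u))))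
                         (cong (λ b → if b then [ u ] else []) (≡ᵇ-refl u))) refl)
  ... | no u≢N = trans (filterS _ N) (trans (cong₂ _++_ (filter-single u N (≤∧≢⇒< (≤-pred u<N) u≢N)) (cong (λ b → if b then [ N ] else []) (≢→≡ᵇ N u (λ e → u≢N (sym e))))) refl)

  #above #below : ℕ → (ℕ → Bool) → ℕ → ℕ
  #above n p v = count (λ w → (v <ᵇ w) ∧ p w) (upTo n)
  #below n p v = count (λ w → (w <ᵇ v) ∧ p w) (upTo n)

  #above-suc : ∀ n p v → v < n → #above (suc n) p v ≡ #above n p v + ind (p n)
  #above-suc n p v v<n = trans (count-upTo-suc _ n) (cong (λ z → #above n p v + ind (z ∧ p n)) (<→<ᵇ v n v<n))

  #below-suc : ∀ n p v → v < n → #below (suc n) p v ≡ #below n p v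
  #below-suc n p v v<n = trans (count-upTo-suc _ n) (trans (cong (λ z → #below n p v + ind (z ∧ p n)) (≤→<ᵇ n v (<⇒≤ v<n))) (+-identityʳ _))

  #above-top : ∀ n p → #above (suc n) p n ≡ 0
  #above-top n p = trans (count-upTo-suc _ n) (cong₂ _+_ (count-none _ n (λ w w<n → cong (_∧ p w) (≤→<ᵇ n w (<⇒≤ w<n))))
                                                      (cong (λ z → ind (z ∧ p n)) (≤→<ᵇ n n ≤-refl)))

  #below-top : ∀ n p → #below (suc n) p n ≡ count p (upTo n)
  #below-top n p = trans (count-upTo-suc _ n) (trans (cong₂ _+_ (count-cong-upTo _ _ n (λ w w<n → cong (_∧ p w) (<→<ᵇ w n w<n)))
                                                             (cong (λ z → ind (z ∧ p n)) (≤→<ᵇ n n ≤-refl))) (+-identityʳ _))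

  just-inj : ∀ {x y : ℕ} → just x ≡ just y → x ≡ y
  just-inj refl = refl

  nothing≢just : ∀ {y : ℕ} → nothing ≢ just y
  nothing≢just ()

  =∞→≡ : (x y : ℕ∞) → (x =∞ y) ≡ true → x ≡ y
  =∞→≡ (just a) (just b) h = cong just (≡ᵇ→≡ a b h)
  =∞→≡ nothing nothing h = refl
  =∞→≡ (just a) nothing ()
  =∞→≡ nothing (just b) ()

  ≡→=∞ : (x : ℕ∞) → (x =∞ x) ≡ true
  ≡→=∞ (just a) = ≡ᵇ-refl a
  ≡→=∞ nothing = refl

  targets⇒ : (x : ℕ∞) (k : ℕ) → targets x k ≡ true → x ≡ just k
  targets⇒ (just a) k h = cong just (≡ᵇ→≡ a k h)

  targets-refl : (k : ℕ) → targets (just k) k ≡ true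
  targets-refl k = ≡ᵇ-refl k

  targets-≢ : (x : ℕ∞) (k : ℕ) → x ≢ just k → targets x k ≡ false
  targets-≢ nothing k h = refl
  targets-≢ (just a) k h = ≢→≡ᵇ a k (λ e → h (cong just e))

  pigeonhole-ℕ : (N : ℕ) (f : ℕ → ℕ) → (∀ j → j ≤ N → f j < N) → Σ ℕ (λ a → Σ ℕ (λ b → (a < b) × (b ≤ N) × (f a ≡ f b)))
  pigeonhole-ℕ N f h with FP.pigeonhole (n<1+n N) (λ (i : Fin (suc N)) → fromℕ< (h (toℕ i) (≤-pred (FP.toℕ<n i))))
  ... | i , j , i<j , e = toℕ i , toℕ j , i<j , ≤-pred (FP.toℕ<n j) ,
        trans (sym (FP.toℕ-fromℕ< (h (toℕ i) (≤-pred (FP.toℕ<n i))))) (trans (cong toℕ e) (FP.toℕ-fromℕ< (h (toℕ j) (≤-pred (FP.toℕ<n j)))))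

  head-filterB : {Q : ℕ → Set} (p : ℕ → Bool) (xs : List ℕ) (j : ℕ) → All Q xs → head (filterB p xs) ≡ just j → (p j ≡ true) × Q j
  head-filterB p [] j [] ()
  head-filterB p (x ∷ xs) j (q ∷ qs) h with p x in eq
  ... | true = subst (λ z → (p z ≡ true) × _) (just-inj h) (eq , subst _ (sym (just-inj h)) q)
  ... | false = head-filterB p xs j qs h

  count-pos : (p : ℕ → Bool) (N j : ℕ) → j < N → p j ≡ true → 1 ≤ count p (upTo N)
  count-pos p (suc N) j j<N pj with j ≟ N
  ... | yes refl = subst (1 ≤_) (sym (count-upTo-suc p j)) (subst (λ b → 1 ≤ count p (upTo j) + ind b) (sym pj) (m≤n+m 1 _))
  ... | no j≢N = subst (1 ≤_) (sym (count-upTo-suc p N)) (≤-trans (count-pos p N j (≤∧≢⇒< (≤-pred j<N) j≢N) pj) (m≤m+n _ _))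

  head-filterB-none : (p : ℕ → Bool) (xs : List ℕ) → count p xs ≡ 0 → head (filterB p xs) ≡ nothing
  head-filterB-none p xs h with filterB p xs
  ... | [] = refl
  ... | x ∷ r = ⊥-elim (1+n≢0 h)

  head-filterB-count : (p : ℕ → Bool) (xs : List ℕ) → count p xs ≤ 1 → ind (not (head (filterB p xs) =∞ nothing)) ≡ count p xs
  head-filterB-count p xs h with filterB p xs
  ... | [] = refl
  ... | x ∷ [] = refl
  ... | x ∷ y ∷ r = ⊥-elim (<-irrefl refl (≤-trans (s≤s (s≤s z≤n)) h))

  -- Orbits of a successor function

  module Orbit (s : ℕ → ℕ∞) where

    iter-nothing : ∀ m → iterₛ s m nothing ≡ nothing
    iter-nothing zero = refl
    iter-nothing (suc m) = cong (stepₛ s) (iter-nothing m)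

    iter-+ : ∀ a b x → iterₛ s (a + b) x ≡ iterₛ s a (iterₛ s b x)
    iter-+ zero b x = refl
    iter-+ (suc a) b x = cong (stepₛ s) (iter-+ a b x)

    iter-suc′ : ∀ m x → iterₛ s (suc m) x ≡ iterₛ s m (stepₛ s x)
    iter-suc′ m x = trans (cong (λ z → iterₛ s z x) (+-comm 1 m)) (iter-+ m 1 x)

    iter-nothing-mono : ∀ a b x → iterₛ s a x ≡ nothing → a ≤ b → iterₛ s b x ≡ nothing
    iter-nothing-mono a b x h a≤b = trans (cong (λ z → iterₛ s z x) (sym (m∸n+n≡m a≤b))) (trans (iter-+ (b ∸ a) a x) (trans (cong (iterₛ s (b ∸ a)) h) (iter-nothing (b ∸ a))))

    iter-just-before : ∀ a b x y → iterₛ s b x ≡ just y → a ≤ b → Σ ℕ (λ z → iterₛ s a x ≡ just z)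
    iter-just-before a b x y h a≤b with iterₛ s a x in eq
    ... | just z = z , refl
    ... | nothing = ⊥-elim (nothing≢just (trans (sym (iter-nothing-mono a b x eq a≤b)) h))

    orZero : ℕ∞ → ℕ
    orZero (just z) = z
    orZero nothing = 0

    module Bounded (N : ℕ) (bnd : ∀ x → BoundedBy N (s x)) where

      iter-bounded : ∀ m x y → x < N → iterₛ s m (just x) ≡ just y → y < N
      iter-bounded zero x y x<N h = subst (_< N) (just-inj h) x<N
      iter-bounded (suc m) x y x<N h with iterₛ s m (just x) in eq
      ... | just z = bnd z y h

      orbit-shorten : ∀ m x y → x < N → iterₛ s m (just x) ≡ just y → N ≤ m → Σ ℕ (λ m′ → (m′ < m) × (iterₛ s m′ (just x) ≡ just y))
      orbit-shorten m x y x<N h N≤m with pigeonhole-ℕ N (λ j → orZero (iterₛ s j (just x))) fb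
        where
        fb : ∀ j → j ≤ N → orZero (iterₛ s j (just x)) < N
        fb j j≤N with iter-just-before j m (just x) y h (≤-trans j≤N N≤m)
        ... | z , e = subst (λ w → orZero w < N) (sym e) (iter-bounded j x z x<N e)
      ... | a , b , a<b , b≤N , e = (m ∸ b) + a , lt , eq
        where
        ja : Σ ℕ (λ z → iterₛ s a (just x) ≡ just z)
        ja = iter-just-before a m (just x) y h (≤-trans (<⇒≤ a<b) (≤-trans b≤N N≤m))
        jb : Σ ℕ (λ z → iterₛ s b (just x) ≡ just z)
        jb = iter-just-before b m (just x) y h (≤-trans b≤N N≤m)
        eab : iterₛ s a (just x) ≡ iterₛ s b (just x)
        eab = trans (proj₂ ja) (trans (cong just (trans (cong orZero (sym (proj₂ ja))) (trans e (cong orZero (proj₂ jb))))) (sym (proj₂ jb)))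
        lt : (m ∸ b) + a < m
        lt = subst ((m ∸ b) + a <_) (m∸n+n≡m (≤-trans b≤N N≤m)) (+-monoʳ-< (m ∸ b) a<b)
        eq : iterₛ s ((m ∸ b) + a) (just x) ≡ just y
        eq = trans (iter-+ (m ∸ b) a (just x)) (trans (cong (iterₛ s (m ∸ b)) eab) (trans (sym (iter-+ (m ∸ b) b (just x)))
             (trans (cong (λ z → iterₛ s z (just x)) (m∸n+n≡m (≤-trans b≤N N≤m))) h)))

      orbit-below-aux : ∀ F m x y → m ≤ F → x < N → iterₛ s m (just x) ≡ just y → Σ ℕ (λ m′ → (m′ < N) × (iterₛ s m′ (just x) ≡ just y))
      orbit-below-aux F m x y m≤F x<N h with m <? N
      ... | yes m<N = m , m<N , h
      orbit-below-aux zero m x y m≤F x<N h | no m≮N = ⊥-elim (m≮N (subst (_< N) (sym (n≤0⇒n≡0 m≤F)) (≤-trans (s≤s z≤n) x<N)))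
      orbit-below-aux (suc F) m x y m≤F x<N h | no m≮N with orbit-shorten m x y x<N h (≮⇒≥ m≮N)
      ... | m′ , m′<m , h′ = orbit-below-aux F m′ x y (≤-pred (≤-trans m′<m m≤F)) x<N h′

      orbit-below : ∀ m x y → x < N → iterₛ s m (just x) ≡ just y → Σ ℕ (λ m′ → (m′ < N) × (iterₛ s m′ (just x) ≡ just y))
      orbit-below m x y = orbit-below-aux m m x y ≤-refl

      period-below : ∀ m i → i < N → iterₛ s (suc m) (just i) ≡ just i → Σ ℕ (λ m′ → (m′ < N) × (iterₛ s (suc m′) (just i) ≡ just i))
      period-below m i i<N h with s i in eq
      ... | nothing = ⊥-elim (nothing≢just (trans (sym (iter-nothing m)) (trans (sym (subst (λ w → iterₛ s (suc m) (just i) ≡ iterₛ s m w) eq (iter-suc′ m (just i)))) h)))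
      ... | just i1 with orbit-below m i1 i (bnd i i1 eq) (trans (sym (subst (λ w → iterₛ s (suc m) (just i) ≡ iterₛ s m w) eq (iter-suc′ m (just i)))) h)
      ... | m′ , m′<N , h′ = m′ , m′<N , trans (subst (λ w → iterₛ s (suc m′) (just i) ≡ iterₛ s m′ w) eq (iter-suc′ m′ (just i))) h′

    periodic-reduce : ∀ p i → iterₛ s (suc p) (just i) ≡ just i → ∀ m → Σ ℕ (λ r → (r ≤ p) × (iterₛ s m (just i) ≡ iterₛ s r (just i)))
    periodic-reduce p i h zero = 0 , z≤n , refl
    periodic-reduce p i h (suc m) with periodic-reduce p i h m
    ... | r , r≤p , e with r ≟ p
    ... | yes refl = 0 , z≤n , trans (cong (stepₛ s) e) h
    ... | no r≢p = suc r , ≤∧≢⇒< r≤p r≢p , cong (stepₛ s) e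

    periodic-total : ∀ p i → iterₛ s (suc p) (just i) ≡ just i → ∀ m → iterₛ s m (just i) ≢ nothing
    periodic-total p i h m e with periodic-reduce p i h m
    ... | r , r≤p , e2 = nothing≢just (trans (sym (iter-nothing-mono r (suc p) (just i) (trans (sym e2) e) (m≤n⇒m≤1+n r≤p))) h)

    periodic-multiple : ∀ p i → iterₛ s (suc p) (just i) ≡ just i → ∀ c → iterₛ s (c * suc p) (just i) ≡ just i
    periodic-multiple p i h zero = refl
    periodic-multiple p i h (suc c) = trans (iter-+ (suc p) (c * suc p) (just i)) (trans (cong (iterₛ s (suc p)) (periodic-multiple p i h c)) h)

    Periodic : ℕ → Set
    Periodic i = Σ ℕ (λ p → iterₛ s (suc p) (just i) ≡ just i)

    IsCycleMin : ℕ → Set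
    IsCycleMin i = Periodic i × (∀ m → (iterₛ s m (just i) <∞ just i) ≡ false)

    Reach : ℕ → ℕ → Set
    Reach x y = Σ ℕ (λ m → iterₛ s m (just x) ≡ just y)

    reachB : ℕ → ℕ → ℕ → Bool
    reachB N x y = anyB (λ m → iterₛ s m (just x) =∞ just y) (upTo N)

    reachB⇒Reach : ∀ N x y → reachB N x y ≡ true → Reach x y
    reachB⇒Reach N x y h with anyB⇒∃< _ N h
    ... | m , _ , e = m , =∞→≡ _ _ e

    module CycleMin (N : ℕ) (bnd : ∀ x → BoundedBy N (s x)) where
      open Bounded N bnd

      Reach⇒reachB : ∀ x y → x < N → Reach x y → reachB N x y ≡ true
      Reach⇒reachB x y x<N (m , e) with orbit-below m x y x<N e
      ... | m′ , m′<N , e′ = ∃<⇒anyB _ N m′ m′<N (subst (λ w → (w =∞ just y) ≡ true) (sym e′) (≡→=∞ (just y)))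

      isCycleMin⇒ : ∀ i → i < N → Succ.isCycleMinₛ N s i ≡ true → IsCycleMin i
      isCycleMin⇒ i i<N h with ∧≡true⇒ {anyB _ (upTo N)} h
      ... | h1 , h2 with anyB⇒∃< _ N h1
      ... | p , p<N , e = (p , per) , all
        where
        per : iterₛ s (suc p) (just i) ≡ just i
        per = =∞→≡ _ _ e
        all : ∀ m → (iterₛ s m (just i) <∞ just i) ≡ false
        all m with periodic-reduce p i per m
        ... | zero , _ , e2 = subst (λ w → (w <∞ just i) ≡ false) (sym e2) (≤→<ᵇ i i ≤-refl)
        ... | suc r , r<p , e2 = subst (λ w → (w <∞ just i) ≡ false) (sym e2) (true-not (allB⇒∀< _ N h2 r (<-≤-trans r<p (<⇒≤ p<N))))

      ⇒isCycleMin : ∀ i → i < N → IsCycleMin i → Succ.isCycleMinₛ N s i ≡ true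
      ⇒isCycleMin i i<N ((p , per) , all) with period-below p i i<N per
      ... | p′ , p′<N , per′ = cong₂ _∧_ (∃<⇒anyB _ N p′ p′<N (subst (λ w → (w =∞ just i) ≡ true) (sym per′) (≡→=∞ (just i))))
                                           (∀<⇒allB _ N (λ m _ → not-true (all (suc m))))

    InjectiveBelow : ℕ → Set
    InjectiveBelow N = ∀ i j k → i < N → j < N → s i ≡ just k → s j ≡ just k → i ≡ j

    isLaguerre⇒injective : ∀ N → (∀ x → BoundedBy N (s x)) → Succ.isLaguerreₛ N s ≡ true → InjectiveBelow N
    isLaguerre⇒injective N bnd h i j k i<N j<N ei ej =
      ≡ᵇ→≡ i j (lem (allB⇒∀< _ N (allB⇒∀< _ N (allB⇒∀< _ N h i i<N) j j<N) k (bnd i k ei)))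
      where
      lem : (not (targets (s i) k ∧ targets (s j) k) ∨ (i ≡ᵇ j)) ≡ true → (i ≡ᵇ j) ≡ true
      lem e rewrite ei | ej | ≡ᵇ-refl k = e

    injective⇒isLaguerre : ∀ N → InjectiveBelow N → Succ.isLaguerreₛ N s ≡ true
    injective⇒isLaguerre N inj = ∀<⇒allB _ N (λ i i<N → ∀<⇒allB _ N (λ j j<N → ∀<⇒allB _ N (λ k k<N → lem i j k i<N j<N)))
      where
      lem : ∀ i j k → i < N → j < N → (not (targets (s i) k ∧ targets (s j) k) ∨ (i ≡ᵇ j)) ≡ true
      lem i j k i<N j<N with targets (s i) k in e1 | targets (s j) k in e2
      ... | true | true = subst (λ z → (i ≡ᵇ z) ≡ true) (inj i j k i<N j<N (targets⇒ _ k e1) (targets⇒ _ k e2)) (≡ᵇ-refl i)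
      ... | true | false = refl
      ... | false | true = refl
      ... | false | false = refl

    module Injective (N : ℕ) (bnd : ∀ x → BoundedBy N (s x)) (inj : InjectiveBelow N) where
      open Bounded N bnd

      orbit-cancel-suc : ∀ x a c → x < N → iterₛ s (suc a) (just x) ≡ iterₛ s (suc c) (just x) → iterₛ s (suc a) (just x) ≢ nothing →
        iterₛ s a (just x) ≡ iterₛ s c (just x)
      orbit-cancel-suc x a c x<N e ne with iterₛ s a (just x) in ea | iterₛ s c (just x) in ec
      ... | nothing | _ = ⊥-elim (ne refl)
      ... | just p | nothing = ⊥-elim (ne e)
      ... | just p | just q with s p in sp
      ... | nothing = ⊥-elim (ne refl)
      ... | just w = cong just (inj p q w (iter-bounded a x p x<N ea) (iter-bounded c x q x<N ec) sp (sym e))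

      orbit-cancel : ∀ x a d → x < N → iterₛ s a (just x) ≡ iterₛ s (a + d) (just x) → iterₛ s a (just x) ≢ nothing → just x ≡ iterₛ s d (just x)
      orbit-cancel x zero d x<N e ne = e
      orbit-cancel x (suc a) d x<N e ne = orbit-cancel x a d x<N (orbit-cancel-suc x a (a + d) x<N e ne) (λ z → ne (trans (cong (stepₛ s) z) refl))

      start-orbit-terminates : ∀ v → v < N → (∀ j → j < N → s j ≢ just v) → Σ ℕ (λ m → iterₛ s m (just v) ≡ nothing)
      start-orbit-terminates v v<N st with iterₛ s N (just v) in eN
      ... | nothing = N , eN
      ... | just y with pigeonhole-ℕ N (λ j → orZero (iterₛ s j (just v))) fb
        where
        fb : ∀ j → j ≤ N → orZero (iterₛ s j (just v)) < N
        fb j j≤N with iter-just-before j N (just v) y eN j≤N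
        ... | z , e = subst (λ w → orZero w < N) (sym e) (iter-bounded j v z v<N e)
      ... | a , b , a<b , b≤N , e = ⊥-elim (st z (iter-bounded d v z v<N ez) sz)
        where
        ja = iter-just-before a N (just v) y eN (≤-trans (<⇒≤ a<b) b≤N)
        jb = iter-just-before b N (just v) y eN b≤N
        eab : iterₛ s a (just v) ≡ iterₛ s b (just v)
        eab = trans (proj₂ ja) (trans (cong just (trans (cong orZero (sym (proj₂ ja))) (trans e (cong orZero (proj₂ jb))))) (sym (proj₂ jb)))
        d : ℕ
        d = b ∸ suc a
        eqb : a + suc d ≡ b
        eqb = trans (+-comm a (suc d)) (trans (sym (+-suc d a)) (m∸n+n≡m {b} {suc a} a<b))
        cyc1 : just v ≡ iterₛ s (suc d) (just v)
        cyc1 = orbit-cancel v a (suc d) v<N (trans eab (cong (λ z → iterₛ s z (just v)) (sym eqb))) (λ z → nothing≢just (trans (sym z) (proj₂ ja)))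
        jz = iter-just-before d (suc d) (just v) v (sym cyc1) (n≤1+n d)
        z : ℕ
        z = proj₁ jz
        ez : iterₛ s d (just v) ≡ just z
        ez = proj₂ jz
        sz : s z ≡ just v
        sz = trans (sym (cong (stepₛ s) ez)) (sym cyc1)

    path-end : ∀ m v → iterₛ s m (just v) ≡ nothing → Σ ℕ (λ a → Σ ℕ (λ u → (iterₛ s a (just v) ≡ just u) × (s u ≡ nothing)))
    path-end zero v ()
    path-end (suc m) v h with iterₛ s m (just v) in eq
    ... | nothing = path-end m v eq
    ... | just u = m , u , eq , h

    path-end-unique : ∀ v a b u1 u2 → iterₛ s a (just v) ≡ just u1 → s u1 ≡ nothing → iterₛ s b (just v) ≡ just u2 → s u2 ≡ nothing → u1 ≡ u2
    path-end-unique v a b u1 u2 e1 s1 e2 s2 with <-cmp a b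
    ... | tri≈ _ refl _ = just-inj (trans (sym e1) e2)
    ... | tri< a<b _ _ = ⊥-elim (nothing≢just (trans (sym (iter-nothing-mono (suc a) b (just v) (trans (cong (stepₛ s) e1) s1) a<b)) e2))
    ... | tri> _ _ b<a = ⊥-elim (nothing≢just (trans (sym (iter-nothing-mono (suc b) a (just v) (trans (cong (stepₛ s) e2) s2) b<a)) e1))

    module Pred (N : ℕ) where
      pr : ℕ → ℕ∞
      pr = Succ.predₛ N s

      head-nothing⇒count0 : (p : ℕ → Bool) (xs : List ℕ) → head (filterB p xs) ≡ nothing → count p xs ≡ 0
      head-nothing⇒count0 p xs h with filterB p xs
      ... | [] = refl

      pred-nothing⇒ : ∀ x → pr x ≡ nothing → ∀ j → j < N → s j ≢ just x
      pred-nothing⇒ x h j j<N e = <-irrefl refl (subst (1 ≤_) (head-nothing⇒count0 _ (upTo N) h) (count-pos _ N j j<N (subst (λ w → targets w x ≡ true) (sym e) (targets-refl x))))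

      ⇒pred-nothing : ∀ x → (∀ j → j < N → s j ≢ just x) → pr x ≡ nothing
      ⇒pred-nothing x h = head-filterB-none _ (upTo N) (count-none _ N (λ j j<N → targets-≢ (s j) x (h j j<N)))

      pred-just⇒ : ∀ x j → pr x ≡ just j → (j < N) × (s j ≡ just x)
      pred-just⇒ x j h with head-filterB {Q = _< N} _ (upTo N) j (all-upTo N) h
      ... | pj , j<N = j<N , targets⇒ (s j) x pj

      count-targets : (x : ℕ∞) → (∀ y → x ≡ just y → y < N) → sumN (upTo N) (λ j → ind (targets x j)) ≡ ind (not (x =∞ nothing))
      count-targets nothing h = sumN-zero N _ (λ _ _ → refl)
      count-targets (just y) h = trans (sumN-single N y _ (h y refl) (λ i i<N i≢y → cong ind (≢→≡ᵇ y i (λ e → i≢y (sym e))))) (cong ind (≡ᵇ-refl y))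

      #ends≡#starts : (∀ x → BoundedBy N (s x)) → InjectiveBelow N →
        count (λ u → s u =∞ nothing) (upTo N) ≡ count (λ v → pr v =∞ nothing) (upTo N)
      #ends≡#starts bnd inj = +-cancelʳ-≡ _ _ _ (trans (count-compl (λ u → s u =∞ nothing) (upTo N))
          (trans (sym (count-compl (λ v → pr v =∞ nothing) (upTo N))) (cong (count (λ v → pr v =∞ nothing) (upTo N) +_) (sym mid))))
        where
        open ≡-Reasoning
        mid : count (not ∘ (λ u → s u =∞ nothing)) (upTo N) ≡ count (not ∘ (λ v → pr v =∞ nothing)) (upTo N)
        mid = begin
          count (not ∘ (λ u → s u =∞ nothing)) (upTo N) ≡⟨ count-sumN _ (upTo N) ⟩
          sumN (upTo N) (λ u → ind (not (s u =∞ nothing))) ≡⟨ sumN-cong (upTo N) _ _ (λ u → sym (count-targets (s u) (bnd u))) ⟩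
          sumN (upTo N) (λ u → sumN (upTo N) (λ j → ind (targets (s u) j))) ≡⟨ sumN-swap (upTo N) (upTo N) (λ u j → ind (targets (s u) j)) ⟩
          sumN (upTo N) (λ j → sumN (upTo N) (λ u → ind (targets (s u) j))) ≡⟨ sumN-cong (upTo N) _ _ (λ j → sym (count-sumN (λ u → targets (s u) j) (upTo N))) ⟩
          sumN (upTo N) (λ j → count (λ u → targets (s u) j) (upTo N)) ≡⟨ sumN-cong (upTo N) _ _ (λ j → sym (head-filterB-count _ (upTo N)
              (count-le1 _ N (λ a b a<N b<N pa pb → inj a b j a<N b<N (targets⇒ (s a) j pa) (targets⇒ (s b) j pb))))) ⟩
          sumN (upTo N) (λ j → ind (not (pr j =∞ nothing))) ≡⟨ sym (count-sumN _ (upTo N)) ⟩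
          count (not ∘ (λ v → pr v =∞ nothing)) (upTo N) ∎

  module PathEnds (n : ℕ) (s : ℕ → ℕ∞) (bnd : ∀ x → BoundedBy n (s x)) (inj : Orbit.InjectiveBelow s n)
    (v : ℕ) (v<n : v < n) (pv : Succ.predₛ n s v ≡ nothing) where
    open Orbit s

    isEnd reached : ℕ → Bool
    isEnd u = s u =∞ nothing
    reached u = reachB n v u

    count-reached-ends : count (λ u → isEnd u ∧ reached u) (upTo n) ≡ 1
    count-reached-ends with Injective.start-orbit-terminates n bnd inj v v<n (Pred.pred-nothing⇒ n v pv)
    ... | m , orbit-ends with path-end m v orbit-ends
    ... | i , u , at-u , end-u = count-one _ n u (Bounded.iter-bounded n bnd i v u v<n at-u)
           (cong₂ _∧_ (cong (_=∞ nothing) end-u) (CycleMin.Reach⇒reachB n bnd v u v<n (i , at-u))) unique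
      where
      unique : ∀ u′ → u′ < n → (isEnd u′ ∧ reached u′) ≡ true → u′ ≡ u
      unique u′ u′<n h with ∧≡true⇒ {isEnd u′} h
      ... | end′ , reached′ with reachB⇒Reach n v u′ reached′
      ... | j , at-u′ = path-end-unique v j i u′ u at-u′ (=∞→≡ _ _ end′) at-u end-u

    count-unreached-ends : (K : ℕ) → Succ.numPathsₛ n s ≡ suc K → count (λ u → isEnd u ∧ not (reached u)) (upTo n) ≡ K
    count-unreached-ends K paths = suc-injective (begin
      suc (count (λ u → isEnd u ∧ not (reached u)) (upTo n))                                  ≡⟨ cong (_+ count (λ u → isEnd u ∧ not (reached u)) (upTo n)) (sym count-reached-ends) ⟩
      count (λ u → isEnd u ∧ reached u) (upTo n) + count (λ u → isEnd u ∧ not (reached u)) (upTo n) ≡⟨ sym (count-split isEnd reached (upTo n)) ⟩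
      count isEnd (upTo n)                                                                     ≡⟨ Pred.#ends≡#starts n bnd inj ⟩
      Succ.numPathsₛ n s                                                                       ≡⟨ paths ⟩
      suc K ∎)
      where open ≡-Reasoning

  lcrossTerm : (ℕ → ℕ∞) → ℕ → ℕ → ℕ → ℕ
  lcrossTerm pr k a b = ind ((a <ᵇ b) ∧ ((b <ᵇ k) ∧ ((just k <∞ pr b) ∧ (pr a =∞ just k))))

  lnestTerm : (ℕ → ℕ∞) → ℕ → ℕ → ℕ → ℕ
  lnestTerm pr k a b = ind ((a <ᵇ b) ∧ ((b <ᵇ k) ∧ ((just k <∞ pr a) ∧ (pr b =∞ just k))))

  doubleSum : (N : ℕ) → (ℕ → ℕ → ℕ) → ℕ
  doubleSum N f = sumN (upTo N) (λ a → sumN (upTo N) (f a))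

  reassoc : (a b c d e : Bool) → (a ∧ (b ∧ (c ∧ (d ∧ e)))) ≡ ((a ∧ (b ∧ (c ∧ d))) ∧ e)
  reassoc true true true true e = refl
  reassoc true true true false e = refl
  reassoc true true false d e = refl
  reassoc true false c d e = refl
  reassoc false b c d e = refl


  count-extVertices : (N : ℕ) (x : ℕ∞) → (∀ j → x ≡ just j → j < N) → (h : ℕ∞ → Bool) →
    count (λ l → h l ∧ (x =∞ l)) (nothing ∷ map just (upTo N)) ≡ ind (h x)
  count-extVertices N nothing bx h = trans (count-∷ (λ l → h l ∧ (nothing =∞ l)) nothing (map just (upTo N)))
    (trans (cong (λ z → ind (h nothing ∧ true) + z)
     (trans (count-mapL (λ l → h l ∧ (nothing =∞ l)) just (upTo N)) (count-none (λ i → h (just i) ∧ false) N (λ i _ → ∧-zeroʳ (h (just i))))))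
     (trans (+-identityʳ _) (cong ind (∧-identityʳ (h nothing)))))
  count-extVertices N (just j) bx h = trans (count-∷ (λ l → h l ∧ (just j =∞ l)) nothing (map just (upTo N)))
    (trans (cong (λ z → ind (h nothing ∧ false) + z) (trans (count-mapL (λ l → h l ∧ (just j =∞ l)) just (upTo N))
     (trans (count-sumN (λ i → h (just i) ∧ (j ≡ᵇ i)) (upTo N)) (sumN-single N j (λ i → ind (h (just i) ∧ (j ≡ᵇ i))) (bx j refl)
       (λ i _ i≢j → trans (cong (λ z → ind (h (just i) ∧ z)) (≢→≡ᵇ j i (λ e → i≢j (sym e)))) (cong ind (∧-zeroʳ (h (just i)))))))))
     (trans (cong (λ z → ind z + ind (h (just j) ∧ (j ≡ᵇ j))) (∧-zeroʳ (h nothing))) (trans (cong (λ z → ind (h (just j) ∧ z)) (≡ᵇ-refl j)) (cong ind (∧-identityʳ (h (just j)))))))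

  module CrossNest (N : ℕ) (s : ℕ → ℕ∞) (bnd : ∀ x → BoundedBy N (s x)) where
    open Succ N s
    open Orbit s
    open Pred N

    pred-bounded : ∀ x j → predₛ x ≡ just j → j < N
    pred-bounded x j e = proj₁ (pred-just⇒ x j e)

    count-triples : (P : ℕ × ℕ × ℕ∞ → Bool) → count P triplesₛ ≡ sumN verticesₛ (λ a → sumN verticesₛ (λ b → count (λ l → P (a , b , l)) extVerticesₛ))
    count-triples P = trans (count-concatMap P _ verticesₛ) (sumN-cong verticesₛ _ _ (λ a → trans (count-concatMap P _ verticesₛ) (sumN-cong verticesₛ _ _ (λ b →
      count-mapL P (λ l → a , b , l) extVerticesₛ))))

    lcross-doubleSum : ∀ k → lcrossₛ k ≡ doubleSum N (lcrossTerm predₛ k)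
    lcross-doubleSum k = trans (count-triples _) (sumN-cong verticesₛ _ _ (λ a → (sumN-cong verticesₛ _ _ (λ b →
      (trans (count-cong _ (λ l → ((a <ᵇ b) ∧ ((b <ᵇ k) ∧ ((just k <∞ l) ∧ (predₛ a =∞ just k)))) ∧ (predₛ b =∞ l)) (λ l → reassoc (a <ᵇ b) (b <ᵇ k) (just k <∞ l) (predₛ a =∞ just k) (predₛ b =∞ l)) extVerticesₛ)
        (count-extVertices N (predₛ b) (pred-bounded b) (λ l → (a <ᵇ b) ∧ ((b <ᵇ k) ∧ ((just k <∞ l) ∧ (predₛ a =∞ just k))))))))))

    lnest-doubleSum : ∀ k → lnestₛ k ≡ doubleSum N (lnestTerm predₛ k)
    lnest-doubleSum k = trans (count-triples _) (sumN-cong verticesₛ _ _ (λ a → (sumN-cong verticesₛ _ _ (λ b →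
      (trans (count-cong _ (λ l → ((a <ᵇ b) ∧ ((b <ᵇ k) ∧ ((just k <∞ l) ∧ (predₛ b =∞ just k)))) ∧ (predₛ a =∞ l)) (λ l → reassoc (a <ᵇ b) (b <ᵇ k) (just k <∞ l) (predₛ b =∞ just k) (predₛ a =∞ l)) extVerticesₛ)
        (count-extVertices N (predₛ a) (pred-bounded a) (λ l → (a <ᵇ b) ∧ ((b <ᵇ k) ∧ ((just k <∞ l) ∧ (predₛ b =∞ just k))))))))))

  ind-chain-vanish : (a b k : ℕ) (X : Bool) → (k ≤ a) ⊎ (k ≤ b) → ind ((a <ᵇ b) ∧ ((b <ᵇ k) ∧ X)) ≡ 0
  ind-chain-vanish a b k X h with a <ᵇ b in e1 | b <ᵇ k in e2
  ... | false | _ = refl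
  ... | true | false = refl
  ... | true | true with h
  ... | inj₁ k≤a = ⊥-elim (<-irrefl refl (≤-trans (<ᵇ→< b k e2) (≤-trans k≤a (<⇒≤ (<ᵇ→< a b e1)))))
  ... | inj₂ k≤b = ⊥-elim (<-irrefl refl (≤-trans (<ᵇ→< b k e2) k≤b))

  doubleSum-cong : (n : ℕ) (f g : ℕ → ℕ → ℕ) → (∀ a b → a < n → b < n → f a b ≡ g a b) → doubleSum n f ≡ doubleSum n g
  doubleSum-cong n f g h = sumN-cong-upTo n _ _ (λ a a<n → sumN-cong-upTo n _ _ (λ b b<n → h a b a<n b<n))

  doubleSum-suc : (n k : ℕ) (f : ℕ → ℕ → ℕ) → k ≤ n → (∀ a b → (k ≤ a) ⊎ (k ≤ b) → f a b ≡ 0) → doubleSum (suc n) f ≡ doubleSum n f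
  doubleSum-suc n k f k≤n h = trans (sumS n _) (trans (cong₂ _+_ (sumN-cong-upTo n _ _ (λ a a<n → trans (sumS n (f a)) (trans (cong (sumN (upTo n) (f a) +_) (h a n (inj₂ k≤n))) (+-identityʳ _))))
     (sumN-zero (suc n) (f n) (λ b _ → h n b (inj₁ k≤n)))) (+-identityʳ _))

  lcrossTerm-vanish : (pr : ℕ → ℕ∞) (k a b : ℕ) → (k ≤ a) ⊎ (k ≤ b) → lcrossTerm pr k a b ≡ 0
  lcrossTerm-vanish pr k a b h = ind-chain-vanish a b k _ h

  lnestTerm-vanish : (pr : ℕ → ℕ∞) (k a b : ℕ) → (k ≤ a) ⊎ (k ≤ b) → lnestTerm pr k a b ≡ 0
  lnestTerm-vanish pr k a b h = ind-chain-vanish a b k _ h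

  -- Adding a top vertex n

  -- x′ is x, or x = ∞ became the new top vertex n: either way x′ compares with every i < n as x does.
  Extends : ℕ → ℕ∞ → ℕ∞ → Set
  Extends n x x′ = (x ≡ x′) ⊎ ((x ≡ nothing) × (x′ ≡ just n))

  module _ {n i : ℕ} (i<n : i < n) where
    extends-<i : ∀ {x x′} → Extends n x x′ → (x <∞ just i) ≡ (x′ <∞ just i)
    extends-<i (inj₁ refl) = refl
    extends-<i (inj₂ (refl , refl)) = sym (≤→<ᵇ n i (<⇒≤ i<n))

    extends->i : ∀ {x x′} → Extends n x x′ → (just i <∞ x) ≡ (just i <∞ x′)
    extends->i (inj₁ refl) = refl
    extends->i (inj₂ (refl , refl)) = sym (<→<ᵇ i n i<n)

    extends-=i : ∀ {x x′} → Extends n x x′ → (x =∞ just i) ≡ (x′ =∞ just i)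
    extends-=i (inj₁ refl) = refl
    extends-=i (inj₂ (refl , refl)) = sym (≢→≡ᵇ n i (λ e → <-irrefl (sym e) i<n))

    extends-i= : ∀ {x x′} → Extends n x x′ → (just i =∞ x) ≡ (just i =∞ x′)
    extends-i= (inj₁ refl) = refl
    extends-i= (inj₂ (refl , refl)) = sym (≢→≡ᵇ i n (λ e → <-irrefl e i<n))

  module LowerVertices (n : ℕ) (s s′ : ℕ → ℕ∞)
    (bnd : ∀ x → BoundedBy n (s x)) (bnd′ : ∀ x → BoundedBy (suc n) (s′ x))
    (pred-extends : ∀ i → i < n → Extends n (Succ.predₛ n s i) (Succ.predₛ (suc n) s′ i))
    (succ-extends : ∀ i → i < n → Extends n (s i) (s′ i)) where

    module Old = Succ n s
    module New = Succ (suc n) s′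

    alternating-term-eq : ∀ i → i < n → not (New.isDAscₛ i ∨ New.isDDescₛ i ∨ New.isFixₛ i) ≡ not (Old.isDAscₛ i ∨ Old.isDDescₛ i ∨ Old.isFixₛ i)
    alternating-term-eq i i<n = sym (cong not (cong₂ _∨_ (cong₂ _∧_ (extends-<i i<n (pred-extends i i<n)) (extends->i i<n (succ-extends i i<n)))
      (cong₂ _∨_ (cong₂ _∧_ (extends->i i<n (pred-extends i i<n)) (extends-<i i<n (succ-extends i i<n))) (cong₂ _∧_ (extends-=i i<n (pred-extends i i<n)) (extends-i= i<n (succ-extends i i<n))))))

    valley-eq : ∀ i → i < n → New.isValleyₛ i ≡ Old.isValleyₛ i
    valley-eq i i<n = sym (cong₂ _∧_ (extends->i i<n (pred-extends i i<n)) (extends->i i<n (succ-extends i i<n)))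

    peak-eq : ∀ i → i < n → New.isPeakₛ i ≡ Old.isPeakₛ i
    peak-eq i i<n = sym (cong₂ _∧_ (extends-<i i<n (pred-extends i i<n)) (extends-<i i<n (succ-extends i i<n)))

    ulev-eq : ∀ j → j < n → New.ulevₛ j ≡ Old.ulevₛ j
    ulev-eq j j<n = cong₂ (λ b c → if b then c else 0) (sym (extends->i j<n (succ-extends j j<n)))
      (trans (count-upTo-suc _ n) (trans (cong₂ _+_ (count-cong-upTo _ _ n (λ i i<n → cong ((i <ᵇ j) ∧_) (sym (extends->i j<n (succ-extends i i<n)))))
        (cong ind (cong (_∧ (just j <∞ s′ n)) (≤→<ᵇ n j (<⇒≤ j<n))))) (+-identityʳ _)))

    lcross-eq : ∀ k → k < n → New.lcrossₛ k ≡ Old.lcrossₛ k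
    lcross-eq k k<n = trans (CrossNest.lcross-doubleSum (suc n) s′ bnd′ k) (trans (doubleSum-suc n k (lcrossTerm New.predₛ k) (<⇒≤ k<n) (lcrossTerm-vanish New.predₛ k))
      (trans (doubleSum-cong n (lcrossTerm New.predₛ k) (lcrossTerm Old.predₛ k) (λ a b a<n b<n → cong (λ z → ind ((a <ᵇ b) ∧ ((b <ᵇ k) ∧ z)))
         (sym (cong₂ _∧_ (extends->i k<n (pred-extends b b<n)) (extends-=i k<n (pred-extends a a<n)))))) (sym (CrossNest.lcross-doubleSum n s bnd k))))

    lnest-eq : ∀ k → k < n → New.lnestₛ k ≡ Old.lnestₛ k
    lnest-eq k k<n = trans (CrossNest.lnest-doubleSum (suc n) s′ bnd′ k) (trans (doubleSum-suc n k (lnestTerm New.predₛ k) (<⇒≤ k<n) (lnestTerm-vanish New.predₛ k))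
      (trans (doubleSum-cong n (lnestTerm New.predₛ k) (lnestTerm Old.predₛ k) (λ a b a<n b<n → cong (λ z → ind ((a <ᵇ b) ∧ ((b <ᵇ k) ∧ z)))
         (sym (cong₂ _∧_ (extends->i k<n (pred-extends a a<n)) (extends-=i k<n (pred-extends b b<n)))))) (sym (CrossNest.lnest-doubleSum n s bnd k))))

    valleyWeights-eq : {ℓ : Level} {C : Set ℓ} (a : ℕ → C) → map (λ i → a (New.ulevₛ i)) (filterB New.isValleyₛ (upTo n)) ≡ map (λ i → a (Old.ulevₛ i)) (filterB Old.isValleyₛ (upTo n))
    valleyWeights-eq a = mapfilter-cong-up _ _ _ _ n valley-eq (λ i i<n _ → cong a (ulev-eq i i<n))

    peakWeights-eq : {ℓ : Level} {C : Set ℓ} (b : ℕ → ℕ → C) → map (λ i → b (New.lcrossₛ i) (New.lnestₛ i)) (filterB New.isPeakₛ (upTo n)) ≡ map (λ i → b (Old.lcrossₛ i) (Old.lnestₛ i)) (filterB Old.isPeakₛ (upTo n))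
    peakWeights-eq b = mapfilter-cong-up _ _ _ _ n peak-eq (λ i i<n _ → cong₂ b (lcross-eq i i<n) (lnest-eq i i<n))

    alternating-below-eq : allB (λ i → not (New.isDAscₛ i ∨ New.isDDescₛ i ∨ New.isFixₛ i)) (upTo n) ≡ Old.isAlternatingₛ
    alternating-below-eq = allB-cong-upTo _ _ n alternating-term-eq

  head-++-[] : (xs : List ℕ) → head (xs ++ []) ≡ head xs
  head-++-[] xs = cong head (LP.++-identityʳ xs)

  pred-suc-N : (N : ℕ) (s : ℕ → ℕ∞) (x : ℕ) → targets (s N) x ≡ false → Succ.predₛ (suc N) s x ≡ Succ.predₛ N s x
  pred-suc-N N s x h = trans (cong head (trans (filterS _ N) (cong (λ b → filterB (λ j → targets (s j) x) (upTo N) ++ (if b then [ N ] else [])) h)))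
    (head-++-[] _)

  pred-cong : (N : ℕ) (s s′ : ℕ → ℕ∞) → (∀ j → s′ j ≡ s j) → ∀ x → Succ.predₛ N s′ x ≡ Succ.predₛ N s x
  pred-cong N s s′ h x = cong head (filterB-cong _ _ (λ j → cong (λ z → targets z x) (h j)) (upTo N))

  iter-cong : (s s′ : ℕ → ℕ∞) → (∀ j → s′ j ≡ s j) → ∀ m x → iterₛ s′ m x ≡ iterₛ s m x
  iter-cong s s′ h zero x = refl
  iter-cong s s′ h (suc m) x with iterₛ s′ m x | iterₛ s m x | iter-cong s s′ h m x
  ... | nothing | .nothing | refl = refl
  ... | just y | .(just y) | refl = h y

  anyB-none : (p : ℕ → Bool) (N : ℕ) → (∀ i → i < N → p i ≡ false) → anyB p (upTo N) ≡ false
  anyB-none p N h with anyB p (upTo N) in e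
  ... | false = refl
  ... | true with anyB⇒∃< p N e
  ... | i , i<N , pi = ⊥-elim (false≢true (trans (sym (h i i<N)) pi))

  allB-some : (p : ℕ → Bool) (N i : ℕ) → i < N → p i ≡ false → allB p (upTo N) ≡ false
  allB-some p N i i<N pi with allB p (upTo N) in e
  ... | false = refl
  ... | true = ⊥-elim (false≢true (trans (sym pi) (allB⇒∀< p N e i i<N)))

  module AddIsolated (n : ℕ) (s s′ : ℕ → ℕ∞) (bnd : ∀ x → BoundedBy n (s x)) (out : ∀ x → n ≤ x → s x ≡ nothing)
    (hs : ∀ x → s′ x ≡ s x) where

    module Old = Succ n s
    module New = Succ (suc n) s′

    succ-top : s′ n ≡ nothing
    succ-top = trans (hs n) (out n ≤-refl)

    bnd′ : ∀ x → BoundedBy (suc n) (s′ x)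
    bnd′ x y e = m<n⇒m<1+n (bnd x y (trans (sym (hs x)) e))

    pred-eq : ∀ x → New.predₛ x ≡ Old.predₛ x
    pred-eq x = trans (pred-suc-N n s′ x (cong (λ z → targets z x) succ-top)) (pred-cong n s s′ hs x)

    pred-extends : ∀ i → i < n → Extends n (Succ.predₛ n s i) (Succ.predₛ (suc n) s′ i)
    pred-extends i _ = inj₁ (sym (pred-eq i))
    succ-extends : ∀ i → i < n → Extends n (s i) (s′ i)
    succ-extends i _ = inj₁ (sym (hs i))
    module Lower = LowerVertices n s s′ bnd bnd′ pred-extends succ-extends
    open Lower public using (valleyWeights-eq; peakWeights-eq; alternating-below-eq)

    pred-top : New.predₛ n ≡ nothing
    pred-top = trans (pred-eq n) (Orbit.Pred.⇒pred-nothing s n n (λ j j<n e → <-irrefl refl (bnd j n e)))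

    isLaguerre-eq : New.isLaguerreₛ ≡ Old.isLaguerreₛ
    isLaguerre-eq = bool-iff _ _ (λ h → Orbit.injective⇒isLaguerre s n (λ i j k i<n j<n ei ej → Orbit.isLaguerre⇒injective s′ (suc n) bnd′ h i j k (m<n⇒m<1+n i<n) (m<n⇒m<1+n j<n) (trans (hs i) ei) (trans (hs j) ej)))
                        (λ h → Orbit.injective⇒isLaguerre s′ (suc n) (λ i j k i<n j<n ei ej → Orbit.isLaguerre⇒injective s n bnd h i j k (lt i k i<n ei) (lt j k j<n ej) (trans (sym (hs i)) ei) (trans (sym (hs j)) ej)))
      where
      lt : ∀ i k → i < suc n → s′ i ≡ just k → i < n
      lt i k i<n e with i ≟ n
      ... | yes refl = ⊥-elim (nothing≢just (trans (sym succ-top) e))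
      ... | no i≢n = ≤∧≢⇒< (≤-pred i<n) i≢n

    isAlternating-eq : New.isAlternatingₛ ≡ Old.isAlternatingₛ
    isAlternating-eq = trans (allB-upTo-suc _ n) (trans (cong₂ _∧_ alternating-below-eq (cong (λ z → z ∧ true) top)) (∧-identityʳ Old.isAlternatingₛ))
      where
      top : not (New.isDAscₛ n ∨ New.isDDescₛ n ∨ New.isFixₛ n) ≡ true
      top rewrite pred-top | succ-top = refl

    numPaths-eq : New.numPathsₛ ≡ suc Old.numPathsₛ
    numPaths-eq = trans (count-upTo-suc _ n) (trans (cong₂ _+_ (count-cong-upTo _ _ n (λ i _ → cong (_=∞ nothing) (pred-eq i))) (cong (λ z → ind (z =∞ nothing)) pred-top)) (+-comm _ 1))

    cyc-eq : New.cycₛ ≡ Old.cycₛ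
    cyc-eq = trans (count-upTo-suc New.isCycleMinₛ n) (trans (cong₂ _+_ (count-cong-upTo New.isCycleMinₛ Old.isCycleMinₛ n isCycleMin-eq) (cong ind top-not-cycleMin)) (+-identityʳ _))
      where
      isCycleMin-eq : ∀ i → i < n → New.isCycleMinₛ i ≡ Old.isCycleMinₛ i
      isCycleMin-eq i i<n = trans (cong₂ _∧_ (anyB-cong _ _ (λ m → cong (_=∞ just i) (iter-cong s s′ hs (suc m) (just i))) (upTo (suc n)))
                                   (allB-cong _ _ (λ m → cong (λ z → not (z <∞ just i)) (iter-cong s s′ hs (suc m) (just i))) (upTo (suc n))))
         (bool-iff _ _ (λ h → Orbit.CycleMin.⇒isCycleMin s n bnd i i<n (Orbit.CycleMin.isCycleMin⇒ s (suc n) (λ x y e → m<n⇒m<1+n (bnd x y e)) i (m<n⇒m<1+n i<n) h))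
                       (λ h → Orbit.CycleMin.⇒isCycleMin s (suc n) (λ x y e → m<n⇒m<1+n (bnd x y e)) i (m<n⇒m<1+n i<n) (Orbit.CycleMin.isCycleMin⇒ s n bnd i i<n h)))
      top-not-cycleMin : New.isCycleMinₛ n ≡ false
      top-not-cycleMin = cong (λ z → z ∧ allB (λ m → not (iterₛ s′ (suc m) (just n) <∞ just n)) (upTo (suc n))) (anyB-none (λ m → iterₛ s′ (suc m) (just n) =∞ just n) (suc n) (λ m _ → cong (_=∞ just n) (trans (Orbit.iter-suc′ s′ m (just n)) (trans (cong (iterₛ s′ m) succ-top) (Orbit.iter-nothing s′ m)))))

    ulev-top≡#ends : New.ulevₛ n ≡ count (λ u → s u =∞ nothing) (upTo n)
    ulev-top≡#ends rewrite succ-top = trans (count-upTo-suc (λ i → (i <ᵇ n) ∧ (just n <∞ s′ i)) n)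
        (trans (cong₂ _+_ (count-cong-upTo (λ i → (i <ᵇ n) ∧ (just n <∞ s′ i)) (λ u → s u =∞ nothing) n
                            (λ i i<n → trans (cong (_∧ (just n <∞ s′ i)) (<→<ᵇ i n i<n)) (lem i)))
                          (cong (λ z → ind (z ∧ (just n <∞ s′ n))) (≤→<ᵇ n n ≤-refl))) (+-identityʳ _))
      where
      lem : ∀ i → (just n <∞ s′ i) ≡ (s i =∞ nothing)
      lem i rewrite hs i with s i in e
      ... | nothing = refl
      ... | just y = ≤→<ᵇ n y (<⇒≤ (bnd i y e))

    top-isValley : New.isValleyₛ n ≡ true
    top-isValley rewrite pred-top | succ-top = refl

    top-isPeak : New.isPeakₛ n ≡ false
    top-isPeak rewrite pred-top = refl

    inLDalt-zero : New.inLDaltₛ 0 ≡ false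
    inLDalt-zero = trans (cong (λ z → New.isLaguerreₛ ∧ (New.isAlternatingₛ ∧ (z ≡ᵇ 0))) numPaths-eq)
                         (trans (cong (New.isLaguerreₛ ∧_) (∧-zeroʳ _)) (∧-zeroʳ _))

    inLDalt-suc : ∀ k → New.inLDaltₛ (suc k) ≡ Old.inLDaltₛ k
    inLDalt-suc k = cong₂ _∧_ isLaguerre-eq (cong₂ _∧_ isAlternating-eq (cong (_≡ᵇ suc k) numPaths-eq))

    valleyWeights-isolated : {ℓ : Level} {C : Set ℓ} (f : ℕ → C) (k : ℕ) → Old.inLDaltₛ k ≡ true →
      New.valleyWeights f ≡ Old.valleyWeights f ++ [ f k ]
    valleyWeights-isolated f k adm = trans (map-filterB-upTo-suc _ New.isValleyₛ n)
      (cong₂ _++_ (valleyWeights-eq f) (trans (cong (λ z → if z then [ f (New.ulevₛ n) ] else []) top-isValley) (cong (λ z → [ f z ]) ulev-top)))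
      where
      ulev-top : New.ulevₛ n ≡ k
      ulev-top = trans ulev-top≡#ends (trans (Orbit.Pred.#ends≡#starts s n bnd (Orbit.isLaguerre⇒injective s n bnd (proj₁ (inLDaltₛ⇒ {n} {s} {k} adm))))
                                      (proj₂ (inLDaltₛ⇒ {n} {s} {k} adm)))

    peakWeights-isolated : {ℓ : Level} {C : Set ℓ} (g : ℕ → ℕ → C) → New.peakWeights g ≡ Old.peakWeights g
    peakWeights-isolated g = trans (map-filterB-upTo-suc _ New.isPeakₛ n)
      (trans (cong₂ _++_ (peakWeights-eq g) (cong (λ z → if z then [ g (New.lcrossₛ n) (New.lnestₛ n) ] else []) top-isPeak)) (LP.++-identityʳ _))

  module AddPeak (n : ℕ) (s s′ : ℕ → ℕ∞) (bnd : ∀ x → BoundedBy n (s x)) (out : ∀ x → n ≤ x → s x ≡ nothing)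
    (u v : ℕ) (u<n : u < n) (v<n : v < n) (su : s u ≡ nothing)
    (H : ∀ x → x ≢ u → x ≢ n → s′ x ≡ s x) (Hu : s′ u ≡ just n) (Hn : s′ n ≡ just v) where

    module Old = Succ n s
    module New = Succ (suc n) s′

    u≢n : u ≢ n
    u≢n e = <-irrefl e u<n
    v≢n : v ≢ n
    v≢n e = <-irrefl e v<n

    bnd′ : ∀ x → BoundedBy (suc n) (s′ x)
    bnd′ x y e with x ≟ u | x ≟ n
    ... | yes refl | _ = subst (_< suc n) (just-inj (trans (sym Hu) e)) (n<1+n n)
    ... | no _ | yes refl = subst (_< suc n) (just-inj (trans (sym Hn) e)) (m<n⇒m<1+n v<n)
    ... | no x≢u | no x≢n = m<n⇒m<1+n (bnd x y (trans (sym (H x x≢u x≢n)) e))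

    succ-extends : ∀ i → i < n → Extends n (s i) (s′ i)
    succ-extends i i<n with i ≟ u
    ... | yes refl = inj₂ (su , Hu)
    ... | no i≢u = inj₁ (sym (H i i≢u (λ e → <-irrefl e i<n)))

    targets-below : ∀ x → x < n → ∀ j → j < n → targets (s′ j) x ≡ targets (s j) x
    targets-below x x<n j j<n with j ≟ u
    ... | yes refl = trans (cong (λ z → targets z x) Hu) (trans (≢→≡ᵇ n x (λ e → <-irrefl (sym e) x<n)) (sym (cong (λ z → targets z x) su)))
    ... | no j≢u = cong (λ z → targets z x) (H j j≢u (λ e → <-irrefl e j<n))

    pred-other : ∀ x → x < n → x ≢ v → New.predₛ x ≡ Old.predₛ x
    pred-other x x<n x≢v = trans (pred-suc-N n s′ x (trans (cong (λ z → targets z x) Hn) (≢→≡ᵇ v x (λ e → x≢v (sym e)))))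
      (cong head (filterB-cong-upTo _ _ n (targets-below x x<n)))

    pred-v : Old.predₛ v ≡ nothing → New.predₛ v ≡ just n
    pred-v pv = cong head (trans (filterS _ n) (cong₂ _++_ (trans (filterB-cong-upTo _ _ n (targets-below v v<n))
                   (count0-filter _ (upTo n) (Orbit.Pred.head-nothing⇒count0 s n _ (upTo n) pv)))
                 (cong (λ b → if b then [ n ] else []) (trans (cong (λ z → targets z v) Hn) (≡ᵇ-refl v)))))

    pred-top : New.predₛ n ≡ just u
    pred-top = trans (pred-suc-N n s′ n (trans (cong (λ z → targets z n) Hn) (≢→≡ᵇ v n v≢n)))
      (cong head (trans (filterB-cong-upTo _ _ n lem) (filter-single u n u<n)))
      where
      lem : ∀ j → j < n → targets (s′ j) n ≡ (j ≡ᵇ u)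
      lem j j<n with j ≟ u
      ... | yes refl = trans (cong (λ z → targets z n) Hu) (trans (≡ᵇ-refl n) (sym (≡ᵇ-refl j)))
      ... | no j≢u = trans (cong (λ z → targets z n) (H j j≢u (λ e → <-irrefl e j<n))) (trans (lem2 (s j) (bnd j)) (sym (≢→≡ᵇ j u j≢u)))
        where
        lem2 : (x : ℕ∞) → (∀ y → x ≡ just y → y < n) → targets x n ≡ false
        lem2 nothing _ = refl
        lem2 (just y) b = ≢→≡ᵇ y n (λ e → <-irrefl e (b y refl))

    data VertexKind (x : ℕ) : Set where
      isN : x ≡ n → VertexKind x
      isU : x ≡ u → VertexKind x
      isO : x < n → x ≢ u → VertexKind x

    classify : ∀ x → x < suc n → VertexKind x
    classify x x<n with x ≟ n | x ≟ u
    ... | yes e | _ = isN e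
    ... | no _ | yes e = isU e
    ... | no x≢n | no x≢u = isO (≤∧≢⇒< (≤-pred x<n) x≢n) x≢u

    isLaguerre⇒ : Orbit.InjectiveBelow s′ (suc n) → Orbit.InjectiveBelow s n × (∀ j → j < n → s j ≢ just v)
    isLaguerre⇒ inj′ = (λ i j k i<n j<n ei ej → inj′ i j k (m<n⇒m<1+n i<n) (m<n⇒m<1+n j<n) (trans (Hs i i<n ei) ei) (trans (Hs j j<n ej) ej)) ,
                 (λ j j<n e → <-irrefl (inj′ j n v (m<n⇒m<1+n j<n) (n<1+n n) (trans (Hs j j<n e) e) Hn) j<n)
      where
      Hs : ∀ i → i < n → ∀ {k} → s i ≡ just k → s′ i ≡ s i
      Hs i i<n {k} e with i ≟ u
      ... | yes refl = ⊥-elim (nothing≢just (trans (sym su) e))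
      ... | no i≢u = H i i≢u (λ z → <-irrefl z i<n)

    ⇒isLaguerre : Orbit.InjectiveBelow s n → (∀ j → j < n → s j ≢ just v) → Orbit.InjectiveBelow s′ (suc n)
    ⇒isLaguerre inj st i j k i<N j<N ei ej with classify i i<N | classify j j<N
    ... | isN refl | isN refl = refl
    ... | isU refl | isU refl = refl
    ... | isN refl | isU refl = ⊥-elim (v≢n (just-inj (trans (sym Hn) (trans ei (trans (sym ej) Hu)))))
    ... | isU refl | isN refl = ⊥-elim (v≢n (just-inj (trans (sym Hn) (trans ej (trans (sym ei) Hu)))))
    ... | isN refl | isO j<n j≢u = ⊥-elim (st j j<n (trans (sym (H j j≢u (λ z → <-irrefl z j<n))) (trans ej (trans (sym ei) Hn))))
    ... | isO i<n i≢u | isN refl = ⊥-elim (st i i<n (trans (sym (H i i≢u (λ z → <-irrefl z i<n))) (trans ei (trans (sym ej) Hn))))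
    ... | isU refl | isO j<n j≢u = ⊥-elim (<-irrefl refl (bnd j n (trans (sym (H j j≢u (λ z → <-irrefl z j<n))) (trans ej (trans (sym ei) Hu)))))
    ... | isO i<n i≢u | isU refl = ⊥-elim (<-irrefl refl (bnd i n (trans (sym (H i i≢u (λ z → <-irrefl z i<n))) (trans ei (trans (sym ej) Hu)))))
    ... | isO i<n i≢u | isO j<n j≢u = inj i j k i<n j<n (trans (sym (H i i≢u (λ z → <-irrefl z i<n))) ei) (trans (sym (H j j≢u (λ z → <-irrefl z j<n))) ej)

    isLaguerre-eq : New.isLaguerreₛ ≡ Old.isLaguerreₛ ∧ (Old.predₛ v =∞ nothing)
    isLaguerre-eq = bool-iff _ _
      (λ h → let (inj , st) = isLaguerre⇒ (Orbit.isLaguerre⇒injective s′ (suc n) bnd′ h) in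
         cong₂ _∧_ (Orbit.injective⇒isLaguerre s n inj) (cong (_=∞ nothing) (Orbit.Pred.⇒pred-nothing s n v st)))
      (λ h → let (h1 , h2) = ∧≡true⇒ {Old.isLaguerreₛ} h in
         Orbit.injective⇒isLaguerre s′ (suc n) (⇒isLaguerre (Orbit.isLaguerre⇒injective s n bnd h1) (Orbit.Pred.pred-nothing⇒ s n v (=∞→≡ _ _ h2))))

    inLDalt-not-start : ∀ k {y} → Old.predₛ v ≡ just y → New.inLDaltₛ k ≡ false
    inLDalt-not-start k pv = cong (_∧ (New.isAlternatingₛ ∧ (New.numPathsₛ ≡ᵇ k)))
      (trans isLaguerre-eq (trans (cong (λ z → Old.isLaguerreₛ ∧ (z =∞ nothing)) pv) (∧-zeroʳ _)))

  argmin : (a : ℕ) (f : ℕ → ℕ) → Σ ℕ (λ j0 → (j0 ≤ a) × (∀ j → j ≤ a → f j0 ≤ f j))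
  argmin zero f = 0 , z≤n , λ { j z≤n → ≤-refl }
  argmin (suc a) f with argmin a f
  ... | j0 , j0≤a , h with f (suc a) <? f j0
  ... | yes lt = suc a , ≤-refl , λ j j≤ → lem j j≤
    where
    lem : ∀ j → j ≤ suc a → f (suc a) ≤ f j
    lem j j≤ with j ≟ suc a
    ... | yes refl = ≤-refl
    ... | no j≢ = ≤-trans (<⇒≤ lt) (h j (≤-pred (≤∧≢⇒< j≤ j≢)))
  ... | no nlt = j0 , m≤n⇒m≤1+n j0≤a , λ j j≤ → lem j j≤
    where
    lem : ∀ j → j ≤ suc a → f j0 ≤ f j
    lem j j≤ with j ≟ suc a
    ... | yes refl = ≮⇒≥ nlt
    ... | no j≢ = h j (≤-pred (≤∧≢⇒< j≤ j≢))

  and4-false : (a b c : Bool) → (a ∧ (b ∧ (c ∧ false))) ≡ false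
  and4-false true true true = refl
  and4-false true true false = refl
  and4-false true false c = refl
  and4-false false b c = refl

  top-lt : (n : ℕ) (x : ℕ∞) → (∀ y → x ≡ just y → y < n) → (just n <∞ x) ≡ (x =∞ nothing)
  top-lt n nothing _ = refl
  top-lt n (just y) b = ≤→<ᵇ n y (<⇒≤ (b y refl))

  module AddPeakAtStart (n : ℕ) (s s′ : ℕ → ℕ∞) (bnd : ∀ x → BoundedBy n (s x)) (out : ∀ x → n ≤ x → s x ≡ nothing)
    (u v : ℕ) (u<n : u < n) (v<n : v < n) (su : s u ≡ nothing)
    (H : ∀ x → x ≢ u → x ≢ n → s′ x ≡ s x) (Hu : s′ u ≡ just n) (Hn : s′ n ≡ just v)
    (pv : Succ.predₛ n s v ≡ nothing) where

    open AddPeak n s s′ bnd out u v u<n v<n su H Hu Hn public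

    pred-extends : ∀ i → i < n → Extends n (Old.predₛ i) (New.predₛ i)
    pred-extends i i<n with i ≟ v
    ... | yes refl = inj₂ (pv , pred-v pv)
    ... | no i≢v = inj₁ (sym (pred-other i i<n i≢v))

    module Lower = LowerVertices n s s′ bnd bnd′ pred-extends succ-extends

    isAlternating-eq : New.isAlternatingₛ ≡ Old.isAlternatingₛ
    isAlternating-eq = trans (allB-upTo-suc _ n) (trans (cong₂ _∧_ Lower.alternating-below-eq (cong (λ z → z ∧ true) top)) (∧-identityʳ Old.isAlternatingₛ))
      where
      top : not (New.isDAscₛ n ∨ New.isDDescₛ n ∨ New.isFixₛ n) ≡ true
      top rewrite pred-top | Hn | ≤→<ᵇ n v (<⇒≤ v<n) | ≤→<ᵇ n u (<⇒≤ u<n) | ≢→≡ᵇ u n u≢n = cong (λ z → not (z ∨ false ∨ false)) (∧-zeroʳ (u <ᵇ n))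

    numPaths-eq : Old.numPathsₛ ≡ suc New.numPathsₛ
    numPaths-eq = trans (count-drop1 (λ i → Old.predₛ i =∞ nothing) (λ i → New.predₛ i =∞ nothing) n v v<n (cong (_=∞ nothing) pv) (cong (_=∞ nothing) (pred-v pv))
              (λ i i<n i≢v → cong (_=∞ nothing) (sym (pred-other i i<n i≢v))))
           (cong suc (sym (trans (count-upTo-suc (λ i → New.predₛ i =∞ nothing) n) (trans (cong (λ z → count (λ i → New.predₛ i =∞ nothing) (upTo n) + ind (z =∞ nothing)) pred-top) (+-identityʳ _)))))

    top-isValley : New.isValleyₛ n ≡ false
    top-isValley rewrite pred-top = cong (_∧ (just n <∞ s′ n)) (≤→<ᵇ n u (<⇒≤ u<n))

    top-isPeak : New.isPeakₛ n ≡ true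
    top-isPeak rewrite pred-top | Hn = cong₂ _∧_ (<→<ᵇ u n u<n) (<→<ᵇ v n v<n)

    pred-bounded : ∀ b → ∀ y → Old.predₛ b ≡ just y → y < n
    pred-bounded b y e = proj₁ (Orbit.Pred.pred-just⇒ s n b y e)

    lcross-top : New.lcrossₛ n ≡ count (λ b → (v <ᵇ b) ∧ (Old.predₛ b =∞ nothing)) (upTo n)
    lcross-top = trans (CrossNest.lcross-doubleSum (suc n) s′ bnd′ n) (trans (doubleSum-suc n n (lcrossTerm New.predₛ n) ≤-refl (lcrossTerm-vanish New.predₛ n))
      (trans (sumN-single n v _ v<n (λ a a<n a≢v → sumN-zero n _ (λ b _ → cong ind
          (trans (cong (λ z → (a <ᵇ b) ∧ ((b <ᵇ n) ∧ ((just n <∞ New.predₛ b) ∧ z))) (trans (cong (_=∞ just n) (pred-other a a<n a≢v)) (lem a)))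
                 (and4-false (a <ᵇ b) (b <ᵇ n) (just n <∞ New.predₛ b))))))
       (trans (sumN-cong-upTo n _ _ (λ b b<n → cong ind (inner b b<n))) (sym (count-sumN _ (upTo n))))))
      where
      lem : ∀ a → (Old.predₛ a =∞ just n) ≡ false
      lem a with Old.predₛ a in e
      ... | nothing = refl
      ... | just y = ≢→≡ᵇ y n (λ z → <-irrefl z (pred-bounded a y e))
      inner : ∀ b → b < n → ((v <ᵇ b) ∧ ((b <ᵇ n) ∧ ((just n <∞ New.predₛ b) ∧ (New.predₛ v =∞ just n)))) ≡ ((v <ᵇ b) ∧ (Old.predₛ b =∞ nothing))
      inner b b<n with b ≟ v
      ... | yes refl rewrite ≤→<ᵇ b b ≤-refl = refl
      ... | no b≢v rewrite pred-v pv | ≡ᵇ-refl n | <→<ᵇ b n b<n | pred-other b b<n b≢v = cong ((v <ᵇ b) ∧_) (trans (∧-identityʳ _) (top-lt n (Old.predₛ b) (pred-bounded b)))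

    lnest-top : New.lnestₛ n ≡ count (λ a → (a <ᵇ v) ∧ (Old.predₛ a =∞ nothing)) (upTo n)
    lnest-top = trans (CrossNest.lnest-doubleSum (suc n) s′ bnd′ n) (trans (doubleSum-suc n n (lnestTerm New.predₛ n) ≤-refl (lnestTerm-vanish New.predₛ n))
      (trans (sumN-cong-upTo n _ _ (λ a a<n → trans (sumN-single n v _ v<n (λ b b<n b≢v → cong ind
          (trans (cong (λ z → (a <ᵇ b) ∧ ((b <ᵇ n) ∧ ((just n <∞ New.predₛ a) ∧ z))) (trans (cong (_=∞ just n) (pred-other b b<n b≢v)) (lem b)))
                 (and4-false (a <ᵇ b) (b <ᵇ n) (just n <∞ New.predₛ a))))) (cong ind (inner a a<n))))
       (sym (count-sumN _ (upTo n)))))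
      where
      lem : ∀ a → (Old.predₛ a =∞ just n) ≡ false
      lem a with Old.predₛ a in e
      ... | nothing = refl
      ... | just y = ≢→≡ᵇ y n (λ z → <-irrefl z (pred-bounded a y e))
      inner : ∀ a → a < n → ((a <ᵇ v) ∧ ((v <ᵇ n) ∧ ((just n <∞ New.predₛ a) ∧ (New.predₛ v =∞ just n)))) ≡ ((a <ᵇ v) ∧ (Old.predₛ a =∞ nothing))
      inner a a<n with a ≟ v
      ... | yes refl rewrite ≤→<ᵇ a a ≤-refl = refl
      ... | no a≢v rewrite pred-v pv | ≡ᵇ-refl n | <→<ᵇ v n v<n | pred-other a a<n a≢v = cong ((a <ᵇ v) ∧_) (trans (∧-identityʳ _) (top-lt n (Old.predₛ a) (pred-bounded a)))

    inLDalt-eq : ∀ k → New.inLDaltₛ k ≡ Old.inLDaltₛ (suc k)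
    inLDalt-eq k = cong₂ _∧_ (trans isLaguerre-eq (trans (cong (λ z → Old.isLaguerreₛ ∧ (z =∞ nothing)) pv) (∧-identityʳ _)))
                             (cong₂ _∧_ isAlternating-eq (cong (_≡ᵇ suc k) (sym numPaths-eq)))

    valleyWeights-peak : {ℓ : Level} {C : Set ℓ} (f : ℕ → C) → New.valleyWeights f ≡ Old.valleyWeights f
    valleyWeights-peak f = trans (map-filterB-upTo-suc _ New.isValleyₛ n)
      (trans (cong₂ _++_ (Lower.valleyWeights-eq f) (cong (λ z → if z then [ f (New.ulevₛ n) ] else []) top-isValley)) (LP.++-identityʳ _))

    peakWeights-peak : {ℓ : Level} {C : Set ℓ} (g : ℕ → ℕ → C) →
      New.peakWeights g ≡ Old.peakWeights g ++ [ g (#above n Old.isStartₛ v) (#below n Old.isStartₛ v) ]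
    peakWeights-peak g = trans (map-filterB-upTo-suc _ New.isPeakₛ n)
      (cong₂ _++_ (Lower.peakWeights-eq g) (trans (cong (λ z → if z then [ g (New.lcrossₛ n) (New.lnestₛ n) ] else []) top-isPeak)
                                               (cong₂ (λ x y → [ g x y ]) lcross-top lnest-top)))

  -- Closing u → n → v creates a cycle exactly when v reaches u; its minimum is the least vertex from v to u.
  module AddPeakCycles (n : ℕ) (s s′ : ℕ → ℕ∞) (bnd : ∀ x → BoundedBy n (s x)) (out : ∀ x → n ≤ x → s x ≡ nothing)
    (u v : ℕ) (u<n : u < n) (v<n : v < n) (su : s u ≡ nothing)
    (H : ∀ x → x ≢ u → x ≢ n → s′ x ≡ s x) (Hu : s′ u ≡ just n) (Hn : s′ n ≡ just v)
    (pv : Succ.predₛ n s v ≡ nothing) (inj : Orbit.InjectiveBelow s n) where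

    module Peak = AddPeak n s s′ bnd out u v u<n v<n su H Hu Hn
    module Old = Succ n s
    module New = Succ (suc n) s′
    bnd′ = Peak.bnd′
    open Orbit s using (iter-+; iter-nothing-mono; iter-nothing; Reach; reachB; reachB⇒Reach; orZero; iter-just-before)
    module Orbit′ = Orbit s′
    open Orbit.Bounded s n bnd using (iter-bounded)
    module CM = Orbit.CycleMin s n bnd
    module CM′ = Orbit.CycleMin s′ (suc n) bnd′
    bnd-suc : ∀ x → BoundedBy (suc n) (s x)
    bnd-suc x y e = m<n⇒m<1+n (bnd x y e)
    module CM⁺ = Orbit.CycleMin s (suc n) bnd-suc
    open Orbit.Injective s n bnd inj using (start-orbit-terminates)

    iter-agrees : ∀ x → x < n → ∀ m → (∀ j → j < m → iterₛ s j (just x) ≢ just u) → iterₛ s′ m (just x) ≡ iterₛ s m (just x)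
    iter-agrees x x<n zero h = refl
    iter-agrees x x<n (suc m) h rewrite iter-agrees x x<n m (λ j j<m → h j (m<n⇒m<1+n j<m)) with iterₛ s m (just x) in e
    ... | nothing = refl
    ... | just y = H y (λ y≡u → h m (n<1+n m) (trans e (cong just y≡u))) (λ y≡n → <-irrefl y≡n (iter-bounded m x y x<n e))

    u-not-earlier : ∀ x b → iterₛ s b (just x) ≡ just u → ∀ j → j < b → iterₛ s j (just x) ≢ just u
    u-not-earlier x b e j j<b e2 = nothing≢just (trans (sym (iter-nothing-mono (suc j) b (just x) (trans (cong (stepₛ s) e2) su) j<b)) e)

    through-top : ∀ x b → x < n → iterₛ s b (just x) ≡ just u → iterₛ s′ (suc (suc b)) (just x) ≡ just v
    through-top x b x<n e = trans (cong (λ z → stepₛ s′ (stepₛ s′ z)) (trans (iter-agrees x x<n b (u-not-earlier x b e)) e)) (trans (cong (stepₛ s′) Hu) Hn)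

    iter-agrees-unreached : ∀ x → x < n → ¬ Reach x u → ∀ m → iterₛ s′ m (just x) ≡ iterₛ s m (just x)
    iter-agrees-unreached x x<n nr m = iter-agrees x x<n m (λ j _ e → nr (j , e))

    R : ℕ → Bool
    R i = reachB n i u

    isCycleMin-unreached : ∀ i → i < n → R i ≡ false → New.isCycleMinₛ i ≡ Old.isCycleMinₛ i
    isCycleMin-unreached i i<n rf = trans (cong₂ _∧_ (anyB-cong _ _ (λ m → cong (_=∞ just i) (iter-agrees-unreached i i<n nr (suc m))) (upTo (suc n)))
                                   (allB-cong _ _ (λ m → cong (λ z → not (z <∞ just i)) (iter-agrees-unreached i i<n nr (suc m))) (upTo (suc n))))
         (bool-iff _ _ (λ h → CM.⇒isCycleMin i i<n (CM⁺.isCycleMin⇒ i (m<n⇒m<1+n i<n) h))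
                       (λ h → CM⁺.⇒isCycleMin i (m<n⇒m<1+n i<n) (CM.isCycleMin⇒ i i<n h)))
      where
      nr : ¬ Reach i u
      nr r = false≢true (trans (sym rf) (CM.Reach⇒reachB i u i<n r))

    ¬isCycleMin-reached : ∀ i → i < n → R i ≡ true → Old.isCycleMinₛ i ≡ false
    ¬isCycleMin-reached i i<n rt with Old.isCycleMinₛ i in e
    ... | false = refl
    ... | true with CM.isCycleMin⇒ i i<n e | reachB⇒Reach n i u rt
    ... | ((p , per) , _) | (b , eb) = ⊥-elim (Orbit.periodic-total s p i per (suc b) (trans (cong (stepₛ s) eb) su))

    count-old-cycles : count (λ i → New.isCycleMinₛ i ∧ not (R i)) (upTo n) ≡ Old.cycₛ
    count-old-cycles = trans (count-cong-upTo (λ i → New.isCycleMinₛ i ∧ not (R i)) (λ i → Old.isCycleMinₛ i ∧ not (R i)) n lem) (trans (sym (+-identityˡ _)) (trans (cong (_+ count (λ i → Old.isCycleMinₛ i ∧ not (R i)) (upTo n)) (sym zero-part)) (sym (count-split Old.isCycleMinₛ R (upTo n)))))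
      where
      lem : ∀ i → i < n → (New.isCycleMinₛ i ∧ not (R i)) ≡ (Old.isCycleMinₛ i ∧ not (R i))
      lem i i<n with R i in e
      ... | true = trans (∧-zeroʳ _) (sym (∧-zeroʳ _))
      ... | false = cong (_∧ true) (isCycleMin-unreached i i<n e)
      zero-part : count (λ i → Old.isCycleMinₛ i ∧ R i) (upTo n) ≡ 0
      zero-part = count-none _ n (λ i i<n → lem2 i i<n)
        where
        lem2 : ∀ i → i < n → (Old.isCycleMinₛ i ∧ R i) ≡ false
        lem2 i i<n with R i in e
        ... | true = cong (_∧ true) (¬isCycleMin-reached i i<n e)
        ... | false = ∧-zeroʳ _

    top-not-cycleMin : New.isCycleMinₛ n ≡ false
    top-not-cycleMin = trans (cong (anyB (λ m → iterₛ s′ (suc m) (just n) =∞ just n) (upTo (suc n)) ∧_)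
              (allB-some (λ m → not (iterₛ s′ (suc m) (just n) <∞ just n)) (suc n) 0 (s≤s z≤n)
                (cong (λ z → not (z <∞ just n)) Hn ▸ cong not (<→<ᵇ v n v<n))))
            (∧-zeroʳ _)
      where
      _▸_ : ∀ {a b c : Bool} → a ≡ b → b ≡ c → a ≡ c
      _▸_ = trans

    st : ∀ j → j < n → s j ≢ just v
    st = Orbit.Pred.pred-nothing⇒ s n v pv

    no-new-cycle : reachB n v u ≡ false → count (λ i → New.isCycleMinₛ i ∧ R i) (upTo n) ≡ 0
    no-new-cycle rf = count-none _ n lem
      where
      nrv : ¬ Reach v u
      nrv r = false≢true (trans (sym rf) (CM.Reach⇒reachB v u v<n r))
      lem : ∀ i → i < n → (New.isCycleMinₛ i ∧ R i) ≡ false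
      lem i i<n with R i in er | New.isCycleMinₛ i in ec
      ... | false | c = ∧-zeroʳ c
      ... | true | false = refl
      ... | true | true with CM′.isCycleMin⇒ i (m<n⇒m<1+n i<n) ec | reachB⇒Reach n i u er | start-orbit-terminates v v<n st
      ... | ((p , per) , _) | (b , eb) | (mv , emv) = ⊥-elim (Orbit′.periodic-total p i per (mv + suc (suc b))
            (trans (Orbit′.iter-+ mv (suc (suc b)) (just i)) (trans (cong (iterₛ s′ mv) (through-top i b i<n eb)) (trans (iter-agrees-unreached v v<n nrv mv) emv))))

    module NewCycle (a : ℕ) (ea : iterₛ s a (just v) ≡ just u) where
      f : ℕ → ℕ
      f j = orZero (iterₛ s j (just v))

      jv : ∀ j → j ≤ a → iterₛ s j (just v) ≡ just (f j)
      jv j j≤a with iter-just-before j a (just v) u ea j≤a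
      ... | z , e = trans e (cong just (cong orZero (sym e)))

      eqa : ∀ j → j ≤ a → iterₛ s′ j (just v) ≡ iterₛ s j (just v)
      eqa j j≤a = iter-agrees v v<n j (λ j′ j′<j → u-not-earlier v a ea j′ (<-≤-trans j′<j j≤a))

      am = argmin a f
      j0 : ℕ
      j0 = proj₁ am
      j0≤a : j0 ≤ a
      j0≤a = proj₁ (proj₂ am)
      hmin : ∀ j → j ≤ a → f j0 ≤ f j
      hmin = proj₂ (proj₂ am)
      i0 : ℕ
      i0 = f j0
      i0<n : i0 < n
      i0<n = iter-bounded j0 v i0 v<n (jv j0 j0≤a)
      ej0 : iterₛ s′ j0 (just v) ≡ just i0
      ej0 = trans (eqa j0 j0≤a) (jv j0 j0≤a)

      per′v : iterₛ s′ (suc (suc a)) (just v) ≡ just v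
      per′v = through-top v a v<n ea

      i0-per : iterₛ s′ (suc (suc a)) (just i0) ≡ just i0
      i0-per = trans (cong (iterₛ s′ (suc (suc a))) (sym ej0)) (trans (sym (Orbit′.iter-+ (suc (suc a)) j0 (just v)))
        (trans (cong (λ z → iterₛ s′ z (just v)) (+-comm (suc (suc a)) j0)) (trans (Orbit′.iter-+ j0 (suc (suc a)) (just v)) (trans (cong (iterₛ s′ j0) per′v) ej0))))

      i0-min : ∀ m → (iterₛ s′ m (just i0) <∞ just i0) ≡ false
      i0-min m with Orbit′.periodic-reduce (suc a) v per′v (m + j0)
      ... | r , r≤ , er = subst (λ z → (z <∞ just i0) ≡ false) (sym e2) (lem r r≤)
        where
        e2 : iterₛ s′ m (just i0) ≡ iterₛ s′ r (just v)
        e2 = trans (cong (iterₛ s′ m) (sym ej0)) (trans (sym (Orbit′.iter-+ m j0 (just v))) er)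
        lem : ∀ r → r ≤ suc a → (iterₛ s′ r (just v) <∞ just i0) ≡ false
        lem r r≤ with r ≟ suc a
        ... | yes refl rewrite eqa a ≤-refl | ea | Hu = ≤→<ᵇ n i0 (<⇒≤ i0<n)
        ... | no r≢ rewrite eqa r (≤-pred (≤∧≢⇒< r≤ r≢)) | jv r (≤-pred (≤∧≢⇒< r≤ r≢)) = ≤→<ᵇ (f r) i0 (hmin r (≤-pred (≤∧≢⇒< r≤ r≢)))

      i0-R : R i0 ≡ true
      i0-R = CM.Reach⇒reachB i0 u i0<n (a ∸ j0 , trans (cong (iterₛ s (a ∸ j0)) (sym (jv j0 j0≤a)))
                 (trans (sym (iter-+ (a ∸ j0) j0 (just v))) (trans (cong (λ z → iterₛ s z (just v)) (m∸n+n≡m j0≤a)) ea)))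

      i0-cm : New.isCycleMinₛ i0 ≡ true
      i0-cm = CM′.⇒isCycleMin i0 (m<n⇒m<1+n i0<n) ((suc a , i0-per) , i0-min)

      uniq : ∀ y → y < n → (New.isCycleMinₛ y ∧ R y) ≡ true → y ≡ i0
      uniq y y<n h with ∧≡true⇒ {New.isCycleMinₛ y} h
      ... | h1 , h2 with CM′.isCycleMin⇒ y (m<n⇒m<1+n y<n) h1 | reachB⇒Reach n y u h2
      ... | ((p , pery) , miny) | (b , eb) = ≤-antisym y≤i0 i0≤y
        where
        D : ℕ
        D = j0 + suc (suc b)
        ity : iterₛ s′ D (just y) ≡ just i0
        ity = trans (Orbit′.iter-+ j0 (suc (suc b)) (just y)) (trans (cong (iterₛ s′ j0) (through-top y b y<n eb)) ej0)
        y≤i0 : y ≤ i0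
        y≤i0 = <ᵇ-false→ i0 y (subst (λ z → (z <∞ just y) ≡ false) ity (miny D))
        big : iterₛ s′ (D * suc p) (just y) ≡ just y
        big = Orbit′.periodic-multiple p y pery D
        E : ℕ
        E = D * suc p ∸ D
        itE : iterₛ s′ E (just i0) ≡ just y
        itE = trans (cong (iterₛ s′ E) (sym ity)) (trans (sym (Orbit′.iter-+ E D (just y)))
                (trans (cong (λ z → iterₛ s′ z (just y)) (m∸n+n≡m (m≤m*n D (suc p)))) big))
        i0≤y : i0 ≤ y
        i0≤y = <ᵇ-false→ y i0 (subst (λ z → (z <∞ just i0) ≡ false) itE (i0-min E))

      one-new-cycle : count (λ i → New.isCycleMinₛ i ∧ R i) (upTo n) ≡ 1
      one-new-cycle = count-one _ n i0 i0<n (cong₂ _∧_ i0-cm i0-R) uniq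

    count-new-cycles : count (λ i → New.isCycleMinₛ i ∧ R i) (upTo n) ≡ ind (reachB n v u)
    count-new-cycles with reachB n v u in e
    ... | false = no-new-cycle e
    ... | true with reachB⇒Reach n v u e
    ... | (a , ea) = NewCycle.one-new-cycle a ea

    cyc-eq : New.cycₛ ≡ Old.cycₛ + ind (reachB n v u)
    cyc-eq = trans (count-upTo-suc New.isCycleMinₛ n) (trans (cong₂ _+_ (count-split New.isCycleMinₛ R (upTo n)) (cong ind top-not-cycleMin))
      (trans (+-identityʳ _) (trans (cong₂ _+_ count-new-cycles count-old-cycles) (+-comm (ind (reachB n v u)) Old.cycₛ))))

  WellFormed : ℕ → ℕ → List ℕ∞ → Set
  WellFormed N m L = (length L ≡ m) × All (BoundedBy N) L

  succChoices-bounded : (N : ℕ) → All (BoundedBy N) (succChoices N)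
  succChoices-bounded N = (λ y ()) ∷ map⁺ (All.map (λ {x} x<N y e → subst (_< N) (just-inj e) x<N) (all-upTo N))

  allLists-wellFormed : (N : ℕ) (E : List ℕ∞) → All (BoundedBy N) E → (m : ℕ) → All (WellFormed N m) (allLists E m)
  allLists-wellFormed N E hE zero = (refl , []) ∷ []
  allLists-wellFormed N E hE (suc m) =
    concat⁺ (map⁺ (All.map (λ {x} px → map⁺ (All.map (λ { (len , al) → cong suc len , px ∷ al }) (allLists-wellFormed N E hE m))) hE))

  succOf-bounded : (N : ℕ) (L : List ℕ∞) → All (BoundedBy N) L → ∀ x → BoundedBy N (succOf L x)
  succOf-bounded N (e ∷ L) (p ∷ ps) zero y h = p y h
  succOf-bounded N (e ∷ L) (p ∷ ps) (suc x) y h = succOf-bounded N L ps x y h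

  succOf-beyond : (L : List ℕ∞) → ∀ x → length L ≤ x → succOf L x ≡ nothing
  succOf-beyond [] x _ = refl
  succOf-beyond (e ∷ L) (suc x) (s≤s h) = succOf-beyond L x h

  succOf-snoc-< : (L : List ℕ∞) (e : ℕ∞) → ∀ x → x < length L → succOf (L ++ [ e ]) x ≡ succOf L x
  succOf-snoc-< (a ∷ L) e zero _ = refl
  succOf-snoc-< (a ∷ L) e (suc x) (s≤s h) = succOf-snoc-< L e x h

  succOf-snoc-≡ : (L : List ℕ∞) (e : ℕ∞) → succOf (L ++ [ e ]) (length L) ≡ e
  succOf-snoc-≡ [] e = refl
  succOf-snoc-≡ (a ∷ L) e = succOf-snoc-≡ L e

  succOf-snoc-> : (L : List ℕ∞) (e : ℕ∞) → ∀ x → length L < x → succOf (L ++ [ e ]) x ≡ nothing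
  succOf-snoc-> [] e (suc x) _ = refl
  succOf-snoc-> (a ∷ L) e (suc x) (s≤s h) = succOf-snoc-> L e x h

  length-setAt : (L : List ℕ∞) (u : ℕ) (t : ℕ∞) → length (setAt L u t) ≡ length L
  length-setAt [] u t = refl
  length-setAt (x ∷ L) zero t = refl
  length-setAt (x ∷ L) (suc u) t = cong suc (length-setAt L u t)

  succOf-setAt-≡ : (L : List ℕ∞) (u : ℕ) (t : ℕ∞) → u < length L → succOf (setAt L u t) u ≡ t
  succOf-setAt-≡ (x ∷ L) zero t _ = refl
  succOf-setAt-≡ (x ∷ L) (suc u) t (s≤s h) = succOf-setAt-≡ L u t h

  succOf-setAt-≢ : (L : List ℕ∞) (u : ℕ) (t : ℕ∞) → ∀ x → x ≢ u → succOf (setAt L u t) x ≡ succOf L x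
  succOf-setAt-≢ [] u t x h = refl
  succOf-setAt-≢ (a ∷ L) zero t zero h = ⊥-elim (h refl)
  succOf-setAt-≢ (a ∷ L) zero t (suc x) h = refl
  succOf-setAt-≢ (a ∷ L) (suc u) t zero h = refl
  succOf-setAt-≢ (a ∷ L) (suc u) t (suc x) h = succOf-setAt-≢ L u t x (λ e → h (cong suc e))

  one-occurrence : (n : ℕ) (L : List ℕ∞) → 1 ≤ count (λ e → e =∞ just n) L → Σ ℕ (λ i → (i < length L) × (succOf L i ≡ just n))
  one-occurrence n (x ∷ L) h with x =∞ just n in e
  ... | true = 0 , s≤s z≤n , =∞→≡ x (just n) e
  ... | false with one-occurrence n L h
  ... | i , i< , ei = suc i , s≤s i< , ei

  two-occurrences : (n : ℕ) (L : List ℕ∞) → 2 ≤ count (λ e → e =∞ just n) L →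
    Σ ℕ (λ i → Σ ℕ (λ j → (i ≢ j) × (i < length L) × (j < length L) × (succOf L i ≡ just n) × (succOf L j ≡ just n)))
  two-occurrences n (x ∷ L) h with x =∞ just n in e
  ... | true with one-occurrence n L (≤-pred h)
  ... | j , j< , ej = 0 , suc j , (λ ()) , s≤s z≤n , s≤s j< , =∞→≡ x (just n) e , ej
  two-occurrences n (x ∷ L) h | false with two-occurrences n L h
  ... | i , j , i≢j , i< , j< , ei , ej = suc i , suc j , (λ z → i≢j (suc-injective z)) , s≤s i< , s≤s j< , ei , ej

  inLDalt-¬alternating : (N : ℕ) (s : ℕ → ℕ∞) (k : ℕ) → Succ.isAlternatingₛ N s ≡ false → Succ.inLDaltₛ N s k ≡ false
  inLDalt-¬alternating N s k h = trans (cong (λ z → Succ.isLaguerreₛ N s ∧ (z ∧ (Succ.numPathsₛ N s ≡ᵇ k))) h) (∧-zeroʳ (Succ.isLaguerreₛ N s))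

  inLDalt-¬Laguerre : (N : ℕ) (s : ℕ → ℕ∞) (k : ℕ) → Succ.isLaguerreₛ N s ≡ false → Succ.inLDaltₛ N s k ≡ false
  inLDalt-¬Laguerre N s k h = cong (_∧ (Succ.isAlternatingₛ N s ∧ (Succ.numPathsₛ N s ≡ᵇ k))) h

  module Excluded (n : ℕ) (s′ : ℕ → ℕ∞) where
    module New = Succ (suc n) s′

    not-alternating-at-top : not (New.isDAscₛ n ∨ New.isDDescₛ n ∨ New.isFixₛ n) ≡ false → New.isAlternatingₛ ≡ false
    not-alternating-at-top h = allB-some _ (suc n) n (n<1+n n) h

    top-double-descent : ∀ x → x < n → (∀ j → j < n → BoundedBy n (s′ j)) → s′ n ≡ just x → ∀ k → New.inLDaltₛ k ≡ false
    top-double-descent x x<n bounded hn k = inLDalt-¬alternating (suc n) s′ k (not-alternating-at-top bad-top)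
      where
      pred-top : New.predₛ n ≡ nothing
      pred-top = Orbit.Pred.⇒pred-nothing s′ (suc n) n (λ j j<N e → lem j j<N e)
        where
        lem : ∀ j → j < suc n → s′ j ≢ just n
        lem j j<N e with j ≟ n
        ... | yes refl = <-irrefl (just-inj (trans (sym hn) e)) x<n
        ... | no j≢n = <-irrefl refl (bounded j (≤∧≢⇒< (≤-pred j<N) j≢n) n e)
      bad-top : not (New.isDAscₛ n ∨ New.isDDescₛ n ∨ New.isFixₛ n) ≡ false
      bad-top rewrite pred-top | hn | <→<ᵇ x n x<n = refl

    top-loop : (∀ j → j < n → BoundedBy n (s′ j)) → s′ n ≡ just n → ∀ k → New.inLDaltₛ k ≡ false
    top-loop bounded hn k = inLDalt-¬alternating (suc n) s′ k (not-alternating-at-top bad-top)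
      where
      pred-top : New.predₛ n ≡ just n
      pred-top = cong head (trans (filterS _ n) (cong₂ _++_ (count0-filter _ (upTo n) (count-none _ n (λ j j<n → targets-≢ (s′ j) n (λ e → <-irrefl refl (bounded j j<n n e)))))
              (cong (λ b → if b then [ n ] else []) (trans (cong (λ z → targets z n) hn) (≡ᵇ-refl n)))))
      bad-top : not (New.isDAscₛ n ∨ New.isDDescₛ n ∨ New.isFixₛ n) ≡ false
      bad-top rewrite pred-top | hn | ≡ᵇ-refl n | ≤→<ᵇ n n ≤-refl = refl

    top-double-ascent : ∀ u → u < n → s′ u ≡ just n → (∀ j → j < n → j ≢ u → BoundedBy n (s′ j)) → s′ n ≡ nothing → ∀ k → New.inLDaltₛ k ≡ false
    top-double-ascent u u<n hu bounded hn k = inLDalt-¬alternating (suc n) s′ k (not-alternating-at-top bad-top)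
      where
      pred-top : New.predₛ n ≡ just u
      pred-top = trans (pred-suc-N n s′ n (cong (λ z → targets z n) hn)) (cong head (trans (filterB-cong-upTo _ _ n lem) (filter-single u n u<n)))
        where
        lem : ∀ j → j < n → targets (s′ j) n ≡ (j ≡ᵇ u)
        lem j j<n with j ≟ u
        ... | yes refl = trans (cong (λ z → targets z n) hu) (trans (≡ᵇ-refl n) (sym (≡ᵇ-refl j)))
        ... | no j≢u = trans (targets-≢ (s′ j) n (λ e → <-irrefl refl (bounded j j<n j≢u n e))) (sym (≢→≡ᵇ j u j≢u))
      bad-top : not (New.isDAscₛ n ∨ New.isDDescₛ n ∨ New.isFixₛ n) ≡ false
      bad-top rewrite pred-top | hn | <→<ᵇ u n u<n = refl

  two-predecessors-excluded : (N : ℕ) (s : ℕ → ℕ∞) (i j k : ℕ) → i ≢ j → i < N → j < N → k < N → s i ≡ just k → s j ≡ just k →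
    ∀ k′ → Succ.inLDaltₛ N s k′ ≡ false
  two-predecessors-excluded N s i j k i≢j i<N j<N k<N ei ej k′ = inLDalt-¬Laguerre N s k′ not-laguerre
    where
    not-laguerre : Succ.isLaguerreₛ N s ≡ false
    not-laguerre with Succ.isLaguerreₛ N s in e
    ... | false = refl
    ... | true = ⊥-elim (false≢true (trans (sym bad-top) (allB⇒∀< _ N (allB⇒∀< _ N (allB⇒∀< _ N e i i<N) j j<N) k k<N)))
      where
      bad-top : (not (targets (s i) k ∧ targets (s j) k) ∨ (i ≡ᵇ j)) ≡ false
      bad-top rewrite ei | ej | ≡ᵇ-refl k | ≢→≡ᵇ i j i≢j = refl

module Sums {c ℓ : Level} (R : CommutativeSemiring c ℓ) where

  open import Data.Nat using (zero; suc; _∸_; _<_; _≤_; z≤n; s≤s) renaming (_+_ to _+ℕ_)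
  open import Data.Nat.Properties using (≤-trans; m≤n+m; <-irrefl; suc-injective)
  import Data.Nat.Properties as ℕₚ
  open import Data.Bool using (Bool; true; false; if_then_else_)
  open import Data.List using (List; []; _∷_; [_]; map; length; concatMap; upTo; _++_)
  open import Data.List.Properties using (map-applyUpTo; map-cong)
  open import Data.List.Relation.Unary.All using (All; []; _∷_)
  open import Data.List.Relation.Unary.All.Properties using (all-upTo)
  open import Data.Maybe using (just; nothing)
  open import Data.Empty using (⊥-elim)
  open import Function using (_∘_; id)
  import Relation.Binary.PropositionalEquality as ≡
  open ≡ using (_≡_)
  open CommutativeSemiring R renaming (refl to ≈-refl; sym to ≈-sym; trans to ≈-trans; reflexive to ≈-reflexive)
  open import Algebra.Properties.CommutativeSemigroup +-commutativeSemigroup using (interchange)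
  open import Relation.Binary.Reasoning.Setoid setoid
  open Combinatorics

  Σ[_]_ : {A : Set} → List A → (A → Carrier) → Carrier
  Σ[ xs ] f = sumR R (map f xs)

  when : Bool → Carrier → Carrier
  when b x = if b then x else 0#

  sum-cong : {A : Set} (xs : List A) {f g : A → Carrier} → (∀ x → f x ≈ g x) → Σ[ xs ] f ≈ Σ[ xs ] g
  sum-cong [] e = ≈-refl
  sum-cong (x ∷ xs) e = +-cong (e x) (sum-cong xs e)

  sum-cong-All : {A : Set} {Q : A → Set} (xs : List A) {f g : A → Carrier} → All Q xs → (∀ x → Q x → f x ≈ g x) →
    Σ[ xs ] f ≈ Σ[ xs ] g
  sum-cong-All [] [] e = ≈-refl
  sum-cong-All (x ∷ xs) (q ∷ qs) e = +-cong (e x q) (sum-cong-All xs qs e)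

  sum-cong-upTo : (n : ℕ) {f g : ℕ → Carrier} → (∀ i → i < n → f i ≈ g i) → Σ[ upTo n ] f ≈ Σ[ upTo n ] g
  sum-cong-upTo n = sum-cong-All (upTo n) (all-upTo n)

  sum-zero : {A : Set} (xs : List A) {f : A → Carrier} → (∀ x → f x ≈ 0#) → Σ[ xs ] f ≈ 0#
  sum-zero [] e = ≈-refl
  sum-zero (x ∷ xs) e = ≈-trans (+-cong (e x) (sum-zero xs e)) (+-identityˡ 0#)

  sum-zero-upTo : (n : ℕ) {f : ℕ → Carrier} → (∀ i → i < n → f i ≈ 0#) → Σ[ upTo n ] f ≈ 0#
  sum-zero-upTo n h = ≈-trans (sum-cong-upTo n h) (sum-zero (upTo n) (λ _ → ≈-refl))

  sum-++ : {A : Set} (xs ys : List A) (f : A → Carrier) → Σ[ xs ++ ys ] f ≈ Σ[ xs ] f + Σ[ ys ] f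
  sum-++ [] ys f = ≈-sym (+-identityˡ _)
  sum-++ (x ∷ xs) ys f = ≈-trans (+-congˡ (sum-++ xs ys f)) (≈-sym (+-assoc _ _ _))

  sum-upTo-suc : (n : ℕ) (f : ℕ → Carrier) → Σ[ upTo (suc n) ] f ≈ Σ[ upTo n ] f + f n
  sum-upTo-suc n f = begin
    Σ[ upTo (suc n) ] f        ≡⟨ ≡.cong (λ xs → Σ[ xs ] f) (upTo-snoc n) ⟩
    Σ[ upTo n ++ [ n ] ] f     ≈⟨ sum-++ (upTo n) [ n ] f ⟩
    Σ[ upTo n ] f + (f n + 0#) ≈⟨ +-congˡ (+-identityʳ (f n)) ⟩
    Σ[ upTo n ] f + f n        ∎

  sum-filterB : {A : Set} (p : A → Bool) (w : A → Carrier) (xs : List A) →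
    sumR R (map w (filterB p xs)) ≈ Σ[ xs ] (λ x → when (p x) (w x))
  sum-filterB p w [] = ≈-refl
  sum-filterB p w (x ∷ xs) with p x
  ... | true = +-congˡ (sum-filterB p w xs)
  ... | false = ≈-trans (sum-filterB p w xs) (≈-sym (+-identityˡ _))

  sum-map : {A B : Set} (g : A → B) (xs : List A) (f : B → Carrier) → Σ[ map g xs ] f ≈ Σ[ xs ] (f ∘ g)
  sum-map g [] f = ≈-refl
  sum-map g (x ∷ xs) f = +-congˡ (sum-map g xs f)

  sum-upTo-cons : (n : ℕ) (f : ℕ → Carrier) → Σ[ upTo (suc n) ] f ≈ f 0 + Σ[ upTo n ] (f ∘ suc)
  sum-upTo-cons n f = +-congˡ (≈-trans (≈-reflexive (≡.cong (λ xs → Σ[ xs ] f) (≡.sym (map-applyUpTo id suc n))))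
                                       (sum-map suc (upTo n) f))

  sum-concatMap : {A B : Set} (g : A → List B) (xs : List A) (f : B → Carrier) →
    Σ[ concatMap g xs ] f ≈ Σ[ xs ] (λ x → Σ[ g x ] f)
  sum-concatMap g [] f = ≈-refl
  sum-concatMap g (x ∷ xs) f = ≈-trans (sum-++ (g x) (concatMap g xs) f) (+-congˡ (sum-concatMap g xs f))

  sum-+ : {A : Set} (xs : List A) (f g : A → Carrier) → Σ[ xs ] (λ x → f x + g x) ≈ Σ[ xs ] f + Σ[ xs ] g
  sum-+ [] f g = ≈-sym (+-identityˡ 0#)
  sum-+ (x ∷ xs) f g = ≈-trans (+-congˡ (sum-+ xs f g)) (interchange _ _ _ _)

  sum-*ˡ : {A : Set} (xs : List A) (c : Carrier) (f : A → Carrier) → Σ[ xs ] (λ x → c * f x) ≈ c * Σ[ xs ] f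
  sum-*ˡ [] c f = ≈-sym (zeroʳ c)
  sum-*ˡ (x ∷ xs) c f = ≈-trans (+-congˡ (sum-*ˡ xs c f)) (≈-sym (distribˡ c _ _))

  sum-*ʳ : {A : Set} (xs : List A) (c : Carrier) (f : A → Carrier) → Σ[ xs ] (λ x → f x * c) ≈ Σ[ xs ] f * c
  sum-*ʳ xs c f = ≈-trans (sum-cong xs (λ x → *-comm (f x) c)) (≈-trans (sum-*ˡ xs c f) (*-comm c _))

  sum-swap : {A B : Set} (xs : List A) (ys : List B) (f : A → B → Carrier) →
    Σ[ xs ] (λ x → Σ[ ys ] (f x)) ≈ Σ[ ys ] (λ y → Σ[ xs ] (λ x → f x y))
  sum-swap [] ys f = ≈-sym (sum-zero ys (λ _ → ≈-refl))
  sum-swap (x ∷ xs) ys f = ≈-trans (+-congˡ (sum-swap xs ys f)) (≈-sym (sum-+ ys (f x) (λ y → Σ[ xs ] (λ x → f x y))))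

  when-sum : {A : Set} (b : Bool) (xs : List A) (f : A → Carrier) → when b (Σ[ xs ] f) ≈ Σ[ xs ] (λ x → when b (f x))
  when-sum true xs f = ≈-refl
  when-sum false xs f = ≈-sym (sum-zero xs (λ _ → ≈-refl))

  when-* : (b : Bool) (x y : Carrier) → when b x * y ≈ when b (x * y)
  when-* true x y = ≈-refl
  when-* false x y = zeroˡ y

  prodR-++ : (xs ys : List Carrier) → prodR R (xs ++ ys) ≈ prodR R xs * prodR R ys
  prodR-++ [] ys = ≈-sym (*-identityˡ _)
  prodR-++ (x ∷ xs) ys = ≈-trans (*-congˡ (prodR-++ xs ys)) (≈-sym (*-assoc _ _ _))

  powR-+-ind : (x : Carrier) (m : ℕ) (b : Bool) → powR R x (m +ℕ ind b) ≈ powR R x m * (if b then x else 1#)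
  powR-+-ind x zero true = *-comm x 1#
  powR-+-ind x zero false = ≈-sym (*-identityʳ 1#)
  powR-+-ind x (suc m) b = ≈-trans (*-congˡ (powR-+-ind x m b)) (≈-sym (*-assoc _ _ _))

  natR-+ : (m n : ℕ) → natR R (m +ℕ n) ≈ natR R m + natR R n
  natR-+ zero n = ≈-sym (+-identityˡ _)
  natR-+ (suc m) n = ≈-trans (+-congˡ (natR-+ m n)) (≈-sym (+-assoc _ _ _))

  sum-when-const : (p : ℕ → Bool) (x : Carrier) (n : ℕ) → Σ[ upTo n ] (λ u → when (p u) x) ≈ natR R (count p (upTo n)) * x
  sum-when-const p x zero = ≈-sym (zeroˡ x)
  sum-when-const p x (suc n) = begin
    Σ[ upTo (suc n) ] (λ u → when (p u) x)                  ≈⟨ sum-upTo-suc n _ ⟩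
    Σ[ upTo n ] (λ u → when (p u) x) + when (p n) x          ≈⟨ +-cong (sum-when-const p x n) (when-ind (p n)) ⟩
    natR R (count p (upTo n)) * x + natR R (ind (p n)) * x  ≈⟨ ≈-sym (distribʳ x _ _) ⟩
    (natR R (count p (upTo n)) + natR R (ind (p n))) * x    ≈⟨ *-congʳ (≈-sym (natR-+ (count p (upTo n)) (ind (p n)))) ⟩
    natR R (count p (upTo n) +ℕ ind (p n)) * x              ≡⟨ ≡.cong (λ m → natR R m * x) (≡.sym (count-upTo-suc p n)) ⟩
    natR R (count p (upTo (suc n))) * x                     ∎
    where
    when-ind : (b : Bool) → when b x ≈ natR R (ind b) * x
    when-ind true = ≈-sym (≈-trans (*-congʳ (+-identityʳ 1#)) (*-identityˡ x))
    when-ind false = ≈-sym (zeroˡ x)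

  sum-allLists-suc : {A : Set} (E : List A) (m : ℕ) (F : List A → Carrier) →
    Σ[ allLists E (suc m) ] F ≈ Σ[ E ] (λ x → Σ[ allLists E m ] (λ L → F (x ∷ L)))
  sum-allLists-suc E m F = ≈-trans (sum-concatMap _ E F) (sum-cong E (λ x → sum-map (x ∷_) (allLists E m) F))

  sum-allLists-snoc : {A : Set} (E : List A) (m : ℕ) (F : List A → Carrier) →
    Σ[ allLists E (suc m) ] F ≈ Σ[ allLists E m ] (λ L → Σ[ E ] (λ e → F (L ++ [ e ])))
  sum-allLists-snoc E zero F = begin
    Σ[ allLists E 1 ] F                ≈⟨ sum-allLists-suc E 0 F ⟩
    Σ[ E ] (λ x → F (x ∷ []) + 0#)     ≈⟨ sum-cong E (λ x → +-identityʳ _) ⟩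
    Σ[ E ] (λ x → F (x ∷ []))          ≈⟨ ≈-sym (+-identityʳ _) ⟩
    Σ[ E ] (λ x → F (x ∷ [])) + 0#     ∎
  sum-allLists-snoc E (suc m) F = begin
    Σ[ allLists E (suc (suc m)) ] F
      ≈⟨ sum-allLists-suc E (suc m) F ⟩
    Σ[ E ] (λ x → Σ[ allLists E (suc m) ] (λ L → F (x ∷ L)))
      ≈⟨ sum-cong E (λ x → sum-allLists-snoc E m (λ L → F (x ∷ L))) ⟩
    Σ[ E ] (λ x → Σ[ allLists E m ] (λ L → Σ[ E ] (λ e → F (x ∷ L ++ [ e ]))))
      ≈⟨ ≈-sym (sum-allLists-suc E m _) ⟩
    Σ[ allLists E (suc m) ] (λ L → Σ[ E ] (λ e → F (L ++ [ e ]))) ∎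

  sum-allLists-zero : {A : Set} (E : List A) (m : ℕ) {F : List A → Carrier} → (∀ L → length L ≡ m → F L ≈ 0#) →
    Σ[ allLists E m ] F ≈ 0#
  sum-allLists-zero E m h = ≈-trans (sum-cong-All (allLists E m) (allLists-length E m) h) (sum-zero (allLists E m) (λ _ → ≈-refl))

  -- A list over succChoices (suc n) containing just n exactly once, at position u, is setAt L u (just n)
  -- for exactly one list L over succChoices n, namely the one with nothing at u.
  module ByTopOccurrence (n : ℕ) where

    occ : List ℕ∞ → ℕ
    occ = count (_=∞ just n)

    E : List ℕ∞
    E = succChoices n

    E′ : List ℕ∞
    E′ = E ++ [ just n ]

    occ-top : ∀ L → occ (just n ∷ L) ≡ suc (occ L)
    occ-top L = ≡.trans (count-∷ (_=∞ just n) (just n) L) (≡.cong (λ b → ind b +ℕ occ L) (≡ᵇ-refl n))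

    occ-∷ : ∀ x L → occ L ≤ occ (x ∷ L)
    occ-∷ x L = ≡.subst (occ L ≤_) (≡.sym (count-∷ (_=∞ just n) x L)) (m≤n+m (occ L) _)

    insertionSum : (m : ℕ) (F : List ℕ∞ → Carrier) (L : List ℕ∞) → Carrier
    insertionSum m F L = Σ[ upTo m ] (λ u → when (succOf L u =∞ nothing) (F (setAt L u (just n))))

    insertionSum-∷ : (m : ℕ) (F : List ℕ∞ → Carrier) (x : ℕ∞) (L : List ℕ∞) →
      insertionSum (suc m) F (x ∷ L) ≈ when (x =∞ nothing) (F (just n ∷ L)) + insertionSum m (λ L′ → F (x ∷ L′)) L
    insertionSum-∷ m F x L = sum-upTo-cons m _

    sum-E-nothing : (y : Carrier) → Σ[ E ] (λ x → when (x =∞ nothing) y) ≈ y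
    sum-E-nothing y = ≈-trans (+-congˡ (≈-trans (sum-map just (upTo n) _) (sum-zero (upTo n) (λ _ → ≈-refl)))) (+-identityʳ y)

    sum-E-ext : (m : ℕ) (F : List ℕ∞ → Carrier) →
      Σ[ allLists E′ (suc m) ] F ≈ Σ[ E ] (λ x → Σ[ allLists E′ m ] (λ L → F (x ∷ L))) + Σ[ allLists E′ m ] (λ L → F (just n ∷ L))
    sum-E-ext m F = ≈-trans (sum-allLists-suc E′ m F) (≈-trans (sum-++ E [ just n ] _) (+-congˡ (+-identityʳ _)))

    sum-no-top : (m : ℕ) (F : List ℕ∞ → Carrier) → (∀ L → length L ≡ m → 1 ≤ occ L → F L ≈ 0#) →
      Σ[ allLists E′ m ] F ≈ Σ[ allLists E m ] F
    sum-no-top zero F h = ≈-refl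
    sum-no-top (suc m) F h = begin
      Σ[ allLists E′ (suc m) ] F
        ≈⟨ sum-E-ext m F ⟩
      Σ[ E ] (λ x → Σ[ allLists E′ m ] (λ L → F (x ∷ L))) + Σ[ allLists E′ m ] (λ L → F (just n ∷ L))
        ≈⟨ +-cong (sum-cong E (λ x → sum-no-top m (λ L → F (x ∷ L)) (λ L len o → h (x ∷ L) (≡.cong suc len) (≤-trans o (occ-∷ x L)))))
                  (sum-allLists-zero E′ m (λ L len → h (just n ∷ L) (≡.cong suc len) (≡.subst (1 ≤_) (≡.sym (occ-top L)) (s≤s z≤n)))) ⟩
      Σ[ E ] (λ x → Σ[ allLists E m ] (λ L → F (x ∷ L))) + 0#
        ≈⟨ +-identityʳ _ ⟩
      Σ[ E ] (λ x → Σ[ allLists E m ] (λ L → F (x ∷ L)))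
        ≈⟨ ≈-sym (sum-allLists-suc E m F) ⟩
      Σ[ allLists E (suc m) ] F ∎

    sum-split-top : (m : ℕ) (F : List ℕ∞ → Carrier) → (∀ L → length L ≡ m → 2 ≤ occ L → F L ≈ 0#) →
      Σ[ allLists E′ m ] F ≈ Σ[ allLists E m ] (λ L → F L + insertionSum m F L)
    sum-split-top zero F h = ≈-sym (+-congʳ (+-identityʳ _))
    sum-split-top (suc m) F h = begin
      Σ[ allLists E′ (suc m) ] F
        ≈⟨ sum-E-ext m F ⟩
      Σ[ E ] (λ x → Σ[ allLists E′ m ] (λ L → F (x ∷ L))) + Σ[ allLists E′ m ] (λ L → F (just n ∷ L))
        ≈⟨ +-cong (sum-cong E (λ x → sum-split-top m (λ L → F (x ∷ L)) (λ L len o → h (x ∷ L) (≡.cong suc len) (≤-trans o (occ-∷ x L)))))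
                  (sum-no-top m (λ L → F (just n ∷ L)) (λ L len o → h (just n ∷ L) (≡.cong suc len) (≡.subst (2 ≤_) (≡.sym (occ-top L)) (s≤s o)))) ⟩
      Σ[ E ] (λ x → Σ[ allLists E m ] (λ L → F (x ∷ L) + insertionSum m (λ L′ → F (x ∷ L′)) L)) + Σ[ allLists E m ] (λ L → F (just n ∷ L))
        ≈⟨ +-congˡ (≈-sym (sum-E-nothing _)) ⟩
      Σ[ E ] (λ x → Σ[ allLists E m ] (λ L → F (x ∷ L) + insertionSum m (λ L′ → F (x ∷ L′)) L))
        + Σ[ E ] (λ x → when (x =∞ nothing) (Σ[ allLists E m ] (λ L → F (just n ∷ L))))
        ≈⟨ ≈-sym (sum-+ E _ _) ⟩
      Σ[ E ] (λ x → Σ[ allLists E m ] (λ L → F (x ∷ L) + insertionSum m (λ L′ → F (x ∷ L′)) L)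
                  + when (x =∞ nothing) (Σ[ allLists E m ] (λ L → F (just n ∷ L))))
        ≈⟨ sum-cong E (λ x → +-congˡ (when-sum (x =∞ nothing) (allLists E m) _)) ⟩
      Σ[ E ] (λ x → Σ[ allLists E m ] (λ L → F (x ∷ L) + insertionSum m (λ L′ → F (x ∷ L′)) L)
                  + Σ[ allLists E m ] (λ L → when (x =∞ nothing) (F (just n ∷ L))))
        ≈⟨ sum-cong E (λ x → ≈-trans (≈-sym (sum-+ (allLists E m) _ _)) (sum-cong (allLists E m) (regroup x))) ⟩
      Σ[ E ] (λ x → Σ[ allLists E m ] (λ L → F (x ∷ L) + insertionSum (suc m) F (x ∷ L)))
        ≈⟨ ≈-sym (sum-allLists-suc E m _) ⟩
      Σ[ allLists E (suc m) ] (λ L → F L + insertionSum (suc m) F L) ∎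
      where
      regroup : ∀ x L → (F (x ∷ L) + insertionSum m (λ L′ → F (x ∷ L′)) L) + when (x =∞ nothing) (F (just n ∷ L))
                        ≈ F (x ∷ L) + insertionSum (suc m) F (x ∷ L)
      regroup x L = ≈-trans (+-assoc _ _ _) (+-congˡ (≈-trans (+-comm _ _) (≈-sym (insertionSum-∷ m F x L))))

  sum-when-none : (n : ℕ) (p : ℕ → Bool) (g : ℕ → Carrier) → count p (upTo n) ≡ 0 → Σ[ upTo n ] (λ v → when (p v) (g v)) ≈ 0#
  sum-when-none n p g h = sum-zero-upTo n vanish
    where
    vanish : ∀ v → v < n → when (p v) (g v) ≈ 0#
    vanish v v<n with p v in e
    ... | false = ≈-refl
    ... | true = ⊥-elim (<-irrefl ≡.refl (≡.subst (1 ≤_) h (count-pos p n v v<n e)))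

  -- Each of the K + 1 marked points v has (#above, #below) = (l, K ∸ l) for a different l.
  sum-ranks : (n K : ℕ) (p : ℕ → Bool) (f : ℕ → ℕ → Carrier) → count p (upTo n) ≡ suc K →
    Σ[ upTo n ] (λ v → when (p v) (f (#above n p v) (#below n p v))) ≈ Σ[ upTo (suc K) ] (λ l → f l (K ∸ l))
  sum-ranks zero K p f ()
  sum-ranks (suc n) K p f h = begin
    Σ[ upTo (suc n) ] (λ v → when (p v) (f (#above (suc n) p v) (#below (suc n) p v)))
      ≈⟨ sum-upTo-suc n _ ⟩
    Σ[ upTo n ] (λ v → when (p v) (f (#above (suc n) p v) (#below (suc n) p v)))
      + when (p n) (f (#above (suc n) p n) (#below (suc n) p n))
      ≈⟨ +-cong (lower (p n) ≡.refl) (≈-reflexive (≡.cong₂ (λ x y → when (p n) (f x y)) (#above-top n p) (#below-top n p))) ⟩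
    Σ[ upTo n ] (λ v → when (p v) (f (#above n p v +ℕ ind (p n)) (#below n p v))) + when (p n) (f 0 (count p (upTo n)))
      ≈⟨ top-case (p n) ≡.refl ⟩
    Σ[ upTo (suc K) ] (λ l → f l (K ∸ l)) ∎
    where
    lower : (b : Bool) → p n ≡ b →
      Σ[ upTo n ] (λ v → when (p v) (f (#above (suc n) p v) (#below (suc n) p v)))
        ≈ Σ[ upTo n ] (λ v → when (p v) (f (#above n p v +ℕ ind b) (#below n p v)))
    lower b e = sum-cong-upTo n (λ v v<n → ≈-reflexive (≡.cong₂ (λ x y → when (p v) (f x y))
      (≡.trans (#above-suc n p v v<n) (≡.cong (λ z → #above n p v +ℕ ind z) e)) (#below-suc n p v v<n)))

    count-rest : (b : Bool) → p n ≡ b → count p (upTo n) +ℕ ind b ≡ suc K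
    count-rest b e = ≡.trans (≡.cong (λ z → count p (upTo n) +ℕ ind z) (≡.sym e)) (≡.trans (≡.sym (count-upTo-suc p n)) h)

    top-marked : (K′ : ℕ) → count p (upTo n) ≡ K′ →
      Σ[ upTo n ] (λ v → when (p v) (f (#above n p v +ℕ 1) (#below n p v))) + f 0 (count p (upTo n))
        ≈ Σ[ upTo (suc K′) ] (λ l → f l (K′ ∸ l))
    top-marked zero c = ≈-trans (+-cong (sum-when-none n p _ c) (≈-reflexive (≡.cong (f 0) c))) (+-comm 0# _)
    top-marked (suc K′) c = begin
      Σ[ upTo n ] (λ v → when (p v) (f (#above n p v +ℕ 1) (#below n p v))) + f 0 (count p (upTo n))
        ≈⟨ +-cong (sum-ranks n K′ p (λ x y → f (x +ℕ 1) y) c) (≈-reflexive (≡.cong (f 0) c)) ⟩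
      Σ[ upTo (suc K′) ] (λ l → f (l +ℕ 1) (K′ ∸ l)) + f 0 (suc K′)
        ≈⟨ +-comm _ _ ⟩
      f 0 (suc K′) + Σ[ upTo (suc K′) ] (λ l → f (l +ℕ 1) (K′ ∸ l))
        ≡⟨ ≡.cong (λ xs → f 0 (suc K′) + sumR R xs) (map-cong (λ l → ≡.cong (λ x → f x (K′ ∸ l)) (ℕₚ.+-comm l 1)) (upTo (suc K′))) ⟩
      f 0 (suc K′) + Σ[ upTo (suc K′) ] (λ l → f (suc l) (suc K′ ∸ suc l))
        ≈⟨ ≈-sym (sum-upTo-cons (suc K′) (λ l → f l (suc K′ ∸ l))) ⟩
      Σ[ upTo (suc (suc K′)) ] (λ l → f l (suc K′ ∸ l)) ∎

    top-case : (b : Bool) → p n ≡ b →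
      Σ[ upTo n ] (λ v → when (p v) (f (#above n p v +ℕ ind b) (#below n p v))) + when b (f 0 (count p (upTo n)))
        ≈ Σ[ upTo (suc K) ] (λ l → f l (K ∸ l))
    top-case false e = ≈-trans (+-identityʳ _) (≈-trans
      (sum-cong-upTo n (λ v _ → ≈-reflexive (≡.cong (λ x → when (p v) (f x (#below n p v))) (ℕₚ.+-identityʳ _))))
      (sum-ranks n K p f (≡.trans (≡.sym (ℕₚ.+-identityʳ _)) (count-rest false e))))
    top-case true e = top-marked K (suc-injective (≡.trans (ℕₚ.+-comm 1 _) (count-rest true e)))

module Recurrence {c ℓ : Level} (R : CommutativeSemiring c ℓ) (lam : CommutativeSemiring.Carrier R)
  (a : ℕ → CommutativeSemiring.Carrier R) (b : ℕ → ℕ → CommutativeSemiring.Carrier R) where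

  open import Data.Nat using (zero; suc; _∸_; _<_; _≤_; _≡ᵇ_) renaming (_+_ to _+ℕ_)
  open import Data.Nat.Properties using (<-cmp; ≤-refl; <⇒≤; <-irrefl; m<n⇒m<1+n; n<1+n)
  import Data.Nat.Properties as ℕₚ
  open import Data.Bool using (Bool; true; false; _∧_; not; if_then_else_)
  open import Data.List using (List; []; [_]; map; length; upTo; _++_)
  open import Data.List.Properties using (map-++; ++-identityʳ)
  open import Data.List.Relation.Unary.All using (All)
  open import Data.Maybe using (just; nothing)
  open import Data.Product using (_,_; proj₁; proj₂)
  open import Data.Empty using (⊥-elim)
  open import Relation.Binary using (tri<; tri≈; tri>)
  import Relation.Binary.PropositionalEquality as ≡
  open ≡ using (_≡_; _≢_)
  open CommutativeSemiring R renaming (refl to ≈-refl; sym to ≈-sym; trans to ≈-trans; reflexive to ≈-reflexive)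
  open import Relation.Binary.Reasoning.Setoid setoid
  open import Algebra.Solver.Ring.NaturalCoefficients.Default R
  open Combinatorics
  open Sums R

  weightₛ : (N : ℕ) → (ℕ → ℕ∞) → Carrier
  weightₛ N s = powR R lam (Succ.cycₛ N s) * prodR R (Succ.valleyWeights N s a) * prodR R (Succ.peakWeights N s b)

  termₛ : (N k : ℕ) → (ℕ → ℕ∞) → Carrier
  termₛ N k s = when (Succ.inLDaltₛ N s k) (weightₛ N s)

  Q : ℕ → ℕ → Carrier
  Q n k = Σ[ allLists (succChoices n) n ] (λ L → termₛ n k (succOf L))

  Qtilde≈Q : ∀ n k → Qtilde R lam a b n k ≈ Q n k
  Qtilde≈Q n k = begin
    Qtilde R lam a b n k
      ≈⟨ sum-filterB _ (weight R lam a b) (allDigraphs n) ⟩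
    Σ[ allDigraphs n ] (λ G → when (isLaguerre G ∧ isAlternating G ∧ (numPaths G ≡ᵇ k)) (weight R lam a b G))
      ≈⟨ sum-cong (allDigraphs n) (λ G → ≈-reflexive (≡.cong₂ when (Transfer.inLDalt-transfer G k) (weight-transfer G))) ⟩
    Σ[ allDigraphs n ] (λ G → termₛ n k (succOf (succList G)))
      ≈⟨ ≈-sym (sum-map succList (allDigraphs n) _) ⟩
    Σ[ map succList (allDigraphs n) ] (λ L → termₛ n k (succOf L))
      ≡⟨ ≡.cong (λ Ls → Σ[ Ls ] (λ L → termₛ n k (succOf L))) (map-succList-allDigraphs n) ⟩
    Q n k ∎
    where
    weight-transfer : ∀ {n} (G : Digraph n) → weight R lam a b G ≡ weightₛ n (succOf (succList G))
    weight-transfer G = ≡.cong₂ _*_ (≡.cong₂ _*_ (≡.cong (powR R lam) cyc-eq) (≡.cong (prodR R) (valleyWeights-transfer a)))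
                                    (≡.cong (prodR R) (peakWeights-transfer b))
      where open Transfer G

  term-excluded : (N k : ℕ) (s : ℕ → ℕ∞) → Succ.inLDaltₛ N s k ≡ false → termₛ N k s ≈ 0#
  term-excluded N k s e rewrite e = ≈-refl

  term-step : ∀ {N N′ k k′ s s′} (x : Carrier) → Succ.inLDaltₛ N′ s′ k′ ≡ Succ.inLDaltₛ N s k →
    (Succ.inLDaltₛ N s k ≡ true → weightₛ N′ s′ ≈ x * weightₛ N s) → termₛ N′ k′ s′ ≈ x * termₛ N k s
  term-step {N} {k = k} {s = s} x same w rewrite same with Succ.inLDaltₛ N s k
  ... | true = w ≡.refl
  ... | false = ≈-sym (zeroʳ x)

  cycleFactor : Bool → Carrier
  cycleFactor r = if r then lam else 1#

  weight-extend : ∀ {N N′ s s′} (r : Bool) (xs ys : List Carrier) →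
    Succ.cycₛ N′ s′ ≡ Succ.cycₛ N s +ℕ ind r →
    Succ.valleyWeights N′ s′ a ≡ Succ.valleyWeights N s a ++ xs →
    Succ.peakWeights N′ s′ b ≡ Succ.peakWeights N s b ++ ys →
    weightₛ N′ s′ ≈ (cycleFactor r * prodR R xs * prodR R ys) * weightₛ N s
  weight-extend {N} {N′} {s} {s′} r xs ys cyc≡ valleys≡ peaks≡ = begin
    powR R lam (Succ.cycₛ N′ s′) * prodR R (Succ.valleyWeights N′ s′ a) * prodR R (Succ.peakWeights N′ s′ b)
      ≈⟨ *-cong (*-cong (≈-reflexive (≡.cong (powR R lam) cyc≡)) (≈-reflexive (≡.cong (prodR R) valleys≡)))
                (≈-reflexive (≡.cong (prodR R) peaks≡)) ⟩
    powR R lam (C +ℕ ind r) * prodR R (V ++ xs) * prodR R (P ++ ys)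
      ≈⟨ *-cong (*-cong (powR-+-ind lam C r) (prodR-++ V xs)) (prodR-++ P ys) ⟩
    (powR R lam C * cycleFactor r) * (prodR R V * prodR R xs) * (prodR R P * prodR R ys)
      ≈⟨ solve 6 (λ l f v x p y → ((l :* f) :* (v :* x)) :* (p :* y) := ((f :* x) :* y) :* ((l :* v) :* p)) ≈-refl
                 (powR R lam C) (cycleFactor r) (prodR R V) (prodR R xs) (prodR R P) (prodR R ys) ⟩
    (cycleFactor r * prodR R xs * prodR R ys) * weightₛ N s ∎
    where
    C = Succ.cycₛ N s
    V = Succ.valleyWeights N s a
    P = Succ.peakWeights N s b

  module IsolatedTop (n : ℕ) (s s′ : ℕ → ℕ∞) (bnd : ∀ x → BoundedBy n (s x)) (out : ∀ x → n ≤ x → s x ≡ nothing)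
    (hs : ∀ x → s′ x ≡ s x) where
    open AddIsolated n s s′ bnd out hs

    term-isolated-zero : termₛ (suc n) 0 s′ ≈ 0#
    term-isolated-zero = term-excluded (suc n) 0 s′ inLDalt-zero

    term-isolated : ∀ k → termₛ (suc n) (suc k) s′ ≈ a k * termₛ n k s
    term-isolated k = term-step {n} {suc n} {k} {suc k} {s} {s′} (a k) (inLDalt-suc k) (λ adm → ≈-trans
      (weight-extend {n} {suc n} {s} {s′} false [ a k ] [] (≡.trans cyc-eq (≡.sym (ℕₚ.+-identityʳ _))) (valleyWeights-isolated a k adm)
                     (≡.trans (peakWeights-isolated b) (≡.sym (++-identityʳ _))))
      (*-congʳ (solve 1 (λ x → (con 1 :* (x :* con 1)) :* con 1 := x) ≈-refl (a k))))

  peakFactorAt : (n : ℕ) (s : ℕ → ℕ∞) (u v : ℕ) → Carrier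
  peakFactorAt n s u v = cycleFactor (Orbit.reachB s n v u) * b (#above n (Succ.isStartₛ n s) v) (#below n (Succ.isStartₛ n s) v)

  module PeakTop (n : ℕ) (s s′ : ℕ → ℕ∞) (bnd : ∀ x → BoundedBy n (s x)) (out : ∀ x → n ≤ x → s x ≡ nothing)
    (u v : ℕ) (u<n : u < n) (v<n : v < n) (su : s u ≡ nothing)
    (H : ∀ x → x ≢ u → x ≢ n → s′ x ≡ s x) (Hu : s′ u ≡ just n) (Hn : s′ n ≡ just v) where
    open Succ n s using (isStartₛ)

    term-peak : ∀ k → termₛ (suc n) k s′ ≈ when (isStartₛ v) (peakFactorAt n s u v) * termₛ n (suc k) s
    term-peak k with Succ.predₛ n s v in pv
    ... | just y = ≈-trans (term-excluded (suc n) k s′ (AddPeak.inLDalt-not-start n s s′ bnd out u v u<n v<n su H Hu Hn k pv)) (≈-sym (zeroˡ _))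
    ... | nothing = term-step {n} {suc n} {suc k} {k} {s} {s′} (peakFactorAt n s u v) (inLDalt-eq k) (λ adm → ≈-trans
      (weight-extend {n} {suc n} {s} {s′} (Orbit.reachB s n v u) [] [ b (#above n isStartₛ v) (#below n isStartₛ v) ]
                     (AddPeakCycles.cyc-eq n s s′ bnd out u v u<n v<n su H Hu Hn pv (Orbit.isLaguerre⇒injective s n bnd (proj₁ (inLDaltₛ⇒ {n} {s} {suc k} adm))))
                     (≡.trans (valleyWeights-peak a) (≡.sym (++-identityʳ _))) (peakWeights-peak b))
      (*-congʳ (solve 2 (λ r x → (r :* con 1) :* (x :* con 1) := r :* x) ≈-refl
                        (cycleFactor (Orbit.reachB s n v u)) (b (#above n isStartₛ v) (#below n isStartₛ v)))))
      where open AddPeakAtStart n s s′ bnd out u v u<n v<n su H Hu Hn pv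

  peakFactor : ℕ → Carrier
  peakFactor k = (lam + natR R k) * sumR R (map (λ l → b l (k ∸ l)) (upTo (suc k)))

  -- Of the K + 1 path ends exactly one, the end of the path of v, is reached from v.
  sum-end-choices : (n : ℕ) (s : ℕ → ℕ∞) (bnd : ∀ x → BoundedBy n (s x)) (inj : Orbit.InjectiveBelow s n)
    (v : ℕ) → v < n → Succ.isStartₛ n s v ≡ true → (K : ℕ) → Succ.numPathsₛ n s ≡ suc K →
    Σ[ upTo n ] (λ u → when (s u =∞ nothing) (cycleFactor (Orbit.reachB s n v u))) ≈ lam + natR R K
  sum-end-choices n s bnd inj v v<n sv K paths = begin
    Σ[ upTo n ] (λ u → when (isEnd u) (cycleFactor (reached u)))
      ≈⟨ sum-cong (upTo n) (λ u → split (isEnd u) (reached u)) ⟩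
    Σ[ upTo n ] (λ u → when (isEnd u ∧ reached u) lam + when (isEnd u ∧ not (reached u)) 1#)
      ≈⟨ sum-+ (upTo n) _ _ ⟩
    Σ[ upTo n ] (λ u → when (isEnd u ∧ reached u) lam) + Σ[ upTo n ] (λ u → when (isEnd u ∧ not (reached u)) 1#)
      ≈⟨ +-cong (sum-when-const _ lam n) (sum-when-const _ 1# n) ⟩
    natR R (count (λ u → isEnd u ∧ reached u) (upTo n)) * lam + natR R (count (λ u → isEnd u ∧ not (reached u)) (upTo n)) * 1#
      ≡⟨ ≡.cong₂ (λ x y → natR R x * lam + natR R y * 1#) (PathEnds.count-reached-ends n s bnd inj v v<n (=∞→≡ _ _ sv))
                                                        (PathEnds.count-unreached-ends n s bnd inj v v<n (=∞→≡ _ _ sv) K paths) ⟩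
    (1# + 0#) * lam + natR R K * 1#
      ≈⟨ +-cong (≈-trans (*-congʳ (+-identityʳ 1#)) (*-identityˡ lam)) (*-identityʳ _) ⟩
    lam + natR R K ∎
    where
    isEnd reached : ℕ → Bool
    isEnd u = s u =∞ nothing
    reached = Orbit.reachB s n v
    split : (x y : Bool) → when x (cycleFactor y) ≈ when (x ∧ y) lam + when (x ∧ not y) 1#
    split true true = ≈-sym (+-identityʳ lam)
    split true false = ≈-sym (+-identityˡ 1#)
    split false y = ≈-sym (+-identityˡ 0#)

  peak-coefficient : (n : ℕ) (s : ℕ → ℕ∞) (bnd : ∀ x → BoundedBy n (s x)) (inj : Orbit.InjectiveBelow s n)
    (K : ℕ) → Succ.numPathsₛ n s ≡ suc K →
    Σ[ upTo n ] (λ u → when (s u =∞ nothing) (Σ[ upTo n ] (λ v → when (Succ.isStartₛ n s v) (peakFactorAt n s u v))))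
      ≈ peakFactor K
  peak-coefficient n s bnd inj K paths = begin
    Σ[ upTo n ] (λ u → when (s u =∞ nothing) (Σ[ upTo n ] (λ v → when (isStart v) (F u v))))
      ≈⟨ sum-cong (upTo n) (λ u → when-sum (s u =∞ nothing) (upTo n) _) ⟩
    Σ[ upTo n ] (λ u → Σ[ upTo n ] (λ v → when (s u =∞ nothing) (when (isStart v) (F u v))))
      ≈⟨ sum-swap (upTo n) (upTo n) _ ⟩
    Σ[ upTo n ] (λ v → Σ[ upTo n ] (λ u → when (s u =∞ nothing) (when (isStart v) (F u v))))
      ≈⟨ sum-cong-upTo n per-start ⟩
    Σ[ upTo n ] (λ v → (lam + natR R K) * when (isStart v) (B v))
      ≈⟨ sum-*ˡ (upTo n) _ _ ⟩
    (lam + natR R K) * Σ[ upTo n ] (λ v → when (isStart v) (B v))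
      ≈⟨ *-congˡ (sum-ranks n K isStart b paths) ⟩
    peakFactor K ∎
    where
    isStart : ℕ → Bool
    isStart = Succ.isStartₛ n s
    F : ℕ → ℕ → Carrier
    F = peakFactorAt n s
    B : ℕ → Carrier
    B v = b (#above n isStart v) (#below n isStart v)

    per-start : ∀ v → v < n →
      Σ[ upTo n ] (λ u → when (s u =∞ nothing) (when (isStart v) (F u v))) ≈ (lam + natR R K) * when (isStart v) (B v)
    per-start v v<n with isStart v in sv
    ... | false = ≈-trans (sum-zero (upTo n) (λ u → when-zero (s u =∞ nothing))) (≈-sym (zeroʳ _))
      where
      when-zero : (x : Bool) → when x 0# ≈ 0#
      when-zero true = ≈-refl
      when-zero false = ≈-refl
    ... | true = begin
      Σ[ upTo n ] (λ u → when (s u =∞ nothing) (cycleFactor (Orbit.reachB s n v u) * B v))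
        ≈⟨ sum-cong (upTo n) (λ u → ≈-sym (when-* (s u =∞ nothing) _ (B v))) ⟩
      Σ[ upTo n ] (λ u → when (s u =∞ nothing) (cycleFactor (Orbit.reachB s n v u)) * B v)
        ≈⟨ sum-*ʳ (upTo n) (B v) _ ⟩
      Σ[ upTo n ] (λ u → when (s u =∞ nothing) (cycleFactor (Orbit.reachB s n v u))) * B v
        ≈⟨ *-congʳ (sum-end-choices n s bnd inj v v<n sv K paths) ⟩
      (lam + natR R K) * B v ∎

  stepDown : ℕ → ℕ → List ℕ∞ → Carrier
  stepDown n zero L = 0#
  stepDown n (suc k) L = a k * termₛ n k (succOf L)

  extensionSum : ℕ → ℕ → List ℕ∞ → Carrier
  extensionSum n k L = Σ[ succChoices (suc n) ] (λ e → termₛ (suc n) k (succOf (L ++ [ e ])))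

  module Extensions (n k : ℕ) (L : List ℕ∞) (len : length L ≡ n) (wf : All (BoundedBy n) L) where
    s : ℕ → ℕ∞
    s = succOf L

    bnd : ∀ x → BoundedBy n (s x)
    bnd = succOf-bounded n L wf

    out : ∀ x → n ≤ x → s x ≡ nothing
    out x n≤x = succOf-beyond L x (≡.subst (_≤ x) (≡.sym len) n≤x)

    snoc-< : ∀ L′ e x → length L′ ≡ n → x < n → succOf (L′ ++ [ e ]) x ≡ succOf L′ x
    snoc-< L′ e x l x<n = succOf-snoc-< L′ e x (≡.subst (x <_) (≡.sym l) x<n)

    snoc-≡ : ∀ L′ e → length L′ ≡ n → succOf (L′ ++ [ e ]) n ≡ e
    snoc-≡ L′ e l = ≡.subst (λ z → succOf (L′ ++ [ e ]) z ≡ e) l (succOf-snoc-≡ L′ e)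

    snoc-> : ∀ L′ e x → length L′ ≡ n → n < x → succOf (L′ ++ [ e ]) x ≡ nothing
    snoc-> L′ e x l n<x = succOf-snoc-> L′ e x (≡.subst (_< x) (≡.sym l) n<x)

    extensionSum-split : ∀ L′ → extensionSum n k L′ ≈
      termₛ (suc n) k (succOf (L′ ++ [ nothing ])) + (Σ[ upTo n ] (λ y → termₛ (suc n) k (succOf (L′ ++ [ just y ])))
                                                     + termₛ (suc n) k (succOf (L′ ++ [ just n ])))
    extensionSum-split L′ = +-congˡ (≈-trans (sum-map just (upTo (suc n)) _) (sum-upTo-suc n _))

    isolated-succ : ∀ x → succOf (L ++ [ nothing ]) x ≡ s x
    isolated-succ x with <-cmp x n
    ... | tri< x<n _ _ = snoc-< L nothing x len x<n
    ... | tri≈ _ ≡.refl _ = ≡.trans (snoc-≡ L nothing len) (≡.sym (out x ≤-refl))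
    ... | tri> _ _ n<x = ≡.trans (snoc-> L nothing x len n<x) (≡.sym (out x (<⇒≤ n<x)))

    extensionSum-unreached : extensionSum n k L ≈ stepDown n k L
    extensionSum-unreached = ≈-trans (extensionSum-split L)
      (≈-trans (+-cong isolated (+-cong (sum-zero-upTo n descent) loop)) (≈-trans (+-congˡ (+-identityˡ 0#)) (+-identityʳ _)))
      where
      bounded-below : ∀ e j → j < n → BoundedBy n (succOf (L ++ [ e ]) j)
      bounded-below e j j<n y h = bnd j y (≡.trans (≡.sym (snoc-< L e j len j<n)) h)
      descent : ∀ y → y < n → termₛ (suc n) k (succOf (L ++ [ just y ])) ≈ 0#
      descent y y<n = term-excluded (suc n) k (succOf (L ++ [ just y ])) (Excluded.top-double-descent n (succOf (L ++ [ just y ])) y y<n (bounded-below (just y)) (snoc-≡ L (just y) len) k)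
      loop : termₛ (suc n) k (succOf (L ++ [ just n ])) ≈ 0#
      loop = term-excluded (suc n) k (succOf (L ++ [ just n ])) (Excluded.top-loop n (succOf (L ++ [ just n ])) (bounded-below (just n)) (snoc-≡ L (just n) len) k)
      isolated-top : ∀ k → termₛ (suc n) k (succOf (L ++ [ nothing ])) ≈ stepDown n k L
      isolated-top zero = IsolatedTop.term-isolated-zero n s (succOf (L ++ [ nothing ])) bnd out isolated-succ
      isolated-top (suc k′) = IsolatedTop.term-isolated n s (succOf (L ++ [ nothing ])) bnd out isolated-succ k′
      isolated : termₛ (suc n) k (succOf (L ++ [ nothing ])) ≈ stepDown n k L
      isolated = isolated-top k

    module FromEnd (u : ℕ) (u<n : u < n) (su : s u ≡ nothing) where
      Lu : List ℕ∞
      Lu = setAt L u (just n)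

      lenU : length Lu ≡ n
      lenU = ≡.trans (length-setAt L u (just n)) len

      below-other : ∀ e x → x < n → x ≢ u → succOf (Lu ++ [ e ]) x ≡ s x
      below-other e x x<n x≢u = ≡.trans (snoc-< Lu e x lenU x<n) (succOf-setAt-≢ L u (just n) x x≢u)

      at-u : ∀ e → succOf (Lu ++ [ e ]) u ≡ just n
      at-u e = ≡.trans (snoc-< Lu e u lenU u<n) (succOf-setAt-≡ L u (just n) (≡.subst (u <_) (≡.sym len) u<n))

      other : ∀ v x → x ≢ u → x ≢ n → succOf (Lu ++ [ just v ]) x ≡ s x
      other v x x≢u x≢n with <-cmp x n
      ... | tri< x<n _ _ = below-other (just v) x x<n x≢u
      ... | tri≈ _ e _ = ⊥-elim (x≢n e)
      ... | tri> _ _ n<x = ≡.trans (snoc-> Lu (just v) x lenU n<x) (≡.sym (out x (<⇒≤ n<x)))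

      ascent : termₛ (suc n) k (succOf (Lu ++ [ nothing ])) ≈ 0#
      ascent = term-excluded (suc n) k (succOf (Lu ++ [ nothing ])) (Excluded.top-double-ascent n (succOf (Lu ++ [ nothing ])) u u<n (at-u nothing)
        (λ j j<n j≢u y h → bnd j y (≡.trans (≡.sym (below-other nothing j j<n j≢u)) h)) (snoc-≡ Lu nothing lenU) k)

      loop : termₛ (suc n) k (succOf (Lu ++ [ just n ])) ≈ 0#
      loop = term-excluded (suc n) k (succOf (Lu ++ [ just n ])) (two-predecessors-excluded (suc n) (succOf (Lu ++ [ just n ])) u n n (λ e → <-irrefl e u<n)
        (m<n⇒m<1+n u<n) (n<1+n n) (n<1+n n) (at-u (just n)) (snoc-≡ Lu (just n) lenU) k)

      extensionSum-from-end : extensionSum n k Lu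
        ≈ Σ[ upTo n ] (λ v → when (Succ.isStartₛ n s v) (peakFactorAt n s u v) * termₛ n (suc k) s)
      extensionSum-from-end = ≈-trans (extensionSum-split Lu) (≈-trans
        (+-cong ascent (+-cong (sum-cong-upTo n (λ v v<n → PeakTop.term-peak n s (succOf (Lu ++ [ just v ])) bnd out u v u<n v<n su (other v) (at-u (just v))
                                                             (snoc-≡ Lu (just v) lenU) k)) loop))
        (≈-trans (+-identityˡ _) (+-identityʳ _)))

    insertionSum-reached : ByTopOccurrence.insertionSum n n (extensionSum n k) L ≈ peakFactor k * termₛ n (suc k) s
    insertionSum-reached = begin
      ByTopOccurrence.insertionSum n n (extensionSum n k) L
        ≈⟨ sum-cong-upTo n per-end ⟩
      Σ[ upTo n ] (λ u → when (s u =∞ nothing) (Σ[ upTo n ] (λ v → when (Succ.isStartₛ n s v) (peakFactorAt n s u v))) * termₛ n (suc k) s)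
        ≈⟨ sum-*ʳ (upTo n) _ _ ⟩
      Σ[ upTo n ] (λ u → when (s u =∞ nothing) (Σ[ upTo n ] (λ v → when (Succ.isStartₛ n s v) (peakFactorAt n s u v)))) * termₛ n (suc k) s
        ≈⟨ coefficient (Succ.inLDaltₛ n s (suc k)) ≡.refl ⟩
      peakFactor k * termₛ n (suc k) s ∎
      where
      per-end : ∀ u → u < n → when (s u =∞ nothing) (extensionSum n k (setAt L u (just n)))
        ≈ when (s u =∞ nothing) (Σ[ upTo n ] (λ v → when (Succ.isStartₛ n s v) (peakFactorAt n s u v))) * termₛ n (suc k) s
      per-end u u<n with s u in su
      ... | just _ = ≈-sym (zeroˡ _)
      ... | nothing = ≈-trans (FromEnd.extensionSum-from-end u u<n su) (sum-*ʳ (upTo n) _ _)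
      coefficient : (b′ : Bool) → Succ.inLDaltₛ n s (suc k) ≡ b′ →
        Σ[ upTo n ] (λ u → when (s u =∞ nothing) (Σ[ upTo n ] (λ v → when (Succ.isStartₛ n s v) (peakFactorAt n s u v)))) * termₛ n (suc k) s
          ≈ peakFactor k * termₛ n (suc k) s
      coefficient false e = ≈-trans (*-congˡ (term-excluded n (suc k) s e)) (≈-trans (zeroʳ _) (≈-sym (≈-trans (*-congˡ (term-excluded n (suc k) s e)) (zeroʳ _))))
      coefficient true e = *-congʳ (peak-coefficient n s bnd (Orbit.isLaguerre⇒injective s n bnd (proj₁ (inLDaltₛ⇒ {n} {s} {suc k} e))) k (proj₂ (inLDaltₛ⇒ {n} {s} {suc k} e)))

  stepDownSum : ℕ → ℕ → Carrier
  stepDownSum n zero = 0#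
  stepDownSum n (suc k) = a k * Q n k

  Q-recurrence : ∀ n k → Q (suc n) k ≈ stepDownSum n k + peakFactor k * Q n (suc k)
  Q-recurrence n k = begin
    Q (suc n) k
      ≈⟨ sum-allLists-snoc (succChoices (suc n)) n _ ⟩
    Σ[ allLists (succChoices (suc n)) n ] (extensionSum n k)
      ≡⟨ ≡.cong (λ E → Σ[ allLists E n ] (extensionSum n k)) (succChoices-suc n) ⟩
    Σ[ allLists (succChoices n ++ [ just n ]) n ] (extensionSum n k)
      ≈⟨ ByTopOccurrence.sum-split-top n n (extensionSum n k) two-in ⟩
    Σ[ allLists (succChoices n) n ] (λ L → extensionSum n k L + ByTopOccurrence.insertionSum n n (extensionSum n k) L)
      ≈⟨ sum-cong-All (allLists (succChoices n) n) (allLists-wellFormed n (succChoices n) (succChoices-bounded n) n)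
           (λ L (len , wf) → +-cong (Extensions.extensionSum-unreached n k L len wf) (Extensions.insertionSum-reached n k L len wf)) ⟩
    Σ[ allLists (succChoices n) n ] (λ L → stepDown n k L + peakFactor k * termₛ n (suc k) (succOf L))
      ≈⟨ sum-+ (allLists (succChoices n) n) _ _ ⟩
    Σ[ allLists (succChoices n) n ] (stepDown n k) + Σ[ allLists (succChoices n) n ] (λ L → peakFactor k * termₛ n (suc k) (succOf L))
      ≈⟨ +-cong (sum-stepDown k) (sum-*ˡ (allLists (succChoices n) n) (peakFactor k) _) ⟩
    stepDownSum n k + peakFactor k * Q n (suc k) ∎
    where
    sum-stepDown : ∀ k → Σ[ allLists (succChoices n) n ] (stepDown n k) ≈ stepDownSum n k
    sum-stepDown zero = sum-zero (allLists (succChoices n) n) (λ _ → ≈-refl)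
    sum-stepDown (suc k) = sum-*ˡ (allLists (succChoices n) n) (a k) _

    two-in : ∀ L → length L ≡ n → 2 ≤ ByTopOccurrence.occ n L → extensionSum n k L ≈ 0#
    two-in L len o with two-occurrences n L o
    ... | i , j , i≢j , i< , j< , ei , ej = sum-zero (succChoices (suc n)) (λ e → term-excluded (suc n) k (succOf (L ++ [ e ]))
           (two-predecessors-excluded (suc n) (succOf (L ++ [ e ])) i j n i≢j (lt i i<) (lt j j<) (n<1+n n)
              (≡.trans (succOf-snoc-< L e i i<) ei) (≡.trans (succOf-snoc-< L e j j<) ej) k))
      where
      lt : ∀ x → x < length L → x < suc n
      lt x x< = m<n⇒m<1+n (≡.subst (x <_) len x<)

  prodA-suc : ∀ k → prodA R a (suc k) ≈ prodA R a k * a k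
  prodA-suc k = begin
    prodR R (map a (upTo (suc k)))        ≡⟨ ≡.cong (λ xs → prodR R (map a xs)) (upTo-snoc k) ⟩
    prodR R (map a (upTo k ++ [ k ]))     ≡⟨ ≡.cong (prodR R) (map-++ a (upTo k) [ k ]) ⟩
    prodR R (map a (upTo k) ++ [ a k ])   ≈⟨ prodR-++ (map a (upTo k)) [ a k ] ⟩
    prodA R a k * (a k * 1#)              ≈⟨ *-congˡ (*-identityʳ (a k)) ⟩
    prodA R a k * a k                     ∎

  J′ : ℕ → ℕ → Carrier
  J′ = J R (alpha R lam a b) (zeroSeq R)

  Q≈prodA*J : ∀ n k → Q n k ≈ prodA R a k * J′ n k
  Q≈prodA*J zero zero = solve 0 (((con 1 :* con 1) :* con 1) :+ con 0 := con 1 :* con 1) ≈-refl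
  Q≈prodA*J zero (suc k) = ≈-trans (+-identityʳ 0#) (≈-sym (zeroʳ _))
  Q≈prodA*J (suc n) zero = begin
    Q (suc n) 0                             ≈⟨ Q-recurrence n 0 ⟩
    0# + peakFactor 0 * Q n 1               ≈⟨ +-congˡ (*-congˡ (Q≈prodA*J n 1)) ⟩
    0# + peakFactor 0 * (prodA R a 1 * J′ n 1)
      ≈⟨ solve 5 (λ L B a0 J₁ J₀ → con 0 :+ (L :* B) :* ((a0 :* con 1) :* J₁) := con 1 :* ((L :* a0 :* B) :* J₁ :+ con 0 :* J₀)) ≈-refl
           (lam + natR R 0) (sumR R (map (λ l → b l (0 ∸ l)) (upTo 1))) (a 0) (J′ n 1) (J′ n 0) ⟩
    prodA R a 0 * J′ (suc n) 0 ∎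
  Q≈prodA*J (suc n) (suc k) = begin
    Q (suc n) (suc k)
      ≈⟨ Q-recurrence n (suc k) ⟩
    a k * Q n k + peakFactor (suc k) * Q n (suc (suc k))
      ≈⟨ +-cong (*-congˡ (Q≈prodA*J n k)) (*-congˡ (≈-trans (Q≈prodA*J n (suc (suc k))) (*-congʳ (≈-trans (prodA-suc (suc k)) (*-congʳ (prodA-suc k)))))) ⟩
    a k * (P * J′ n k) + peakFactor (suc k) * (P * a k * a (suc k) * J′ n (suc (suc k)))
      ≈⟨ solve 8 (λ ak P Jk L B ak₁ J₂ J₁ → ak :* (P :* Jk) :+ (L :* B) :* (P :* ak :* ak₁ :* J₂)
                   := (P :* ak) :* (Jk :+ (L :* ak₁ :* B) :* J₂ :+ con 0 :* J₁)) ≈-refl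
           (a k) P (J′ n k) (lam + natR R (suc k)) (sumR R (map (λ l → b l (suc k ∸ l)) (upTo (suc (suc k))))) (a (suc k))
           (J′ n (suc (suc k))) (J′ n (suc k)) ⟩
    (P * a k) * J′ (suc n) (suc k)
      ≈⟨ *-congʳ (≈-sym (prodA-suc k)) ⟩
    prodA R a (suc k) * J′ (suc n) (suc k) ∎
    where
    P = prodA R a k

theorem6p6 : {c ℓ : Level} (R : CommutativeSemiring c ℓ) →
    let open CommutativeSemiring R in
    (lam : Carrier) (a : ℕ → Carrier) (b : ℕ → ℕ → Carrier) (n k : ℕ) →
    Qtilde R lam a b n k ≈ prodA R a k * J R (alpha R lam a b) (zeroSeq R) n k
theorem6p6 R lam a b n k = CommutativeSemiring.trans R (Qtilde≈Q n k) (Q≈prodA*J n k)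
  where open Recurrence R lam a b
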